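{- Let $n>t>1$ be integers with $\gcd(n,t)=1$, let $Y,Z$ be indeterminates over a field $k$, and let $0\neq a\in k$. Then the polynomial $$\frac{(Z+Y)^n-Y^n}{Z}-\frac{a[(Z+Y)^t-Y^t]}{Z}$$ is irreducible in $k(Y)[Z]$. -}

module Defs where

open import Level using (Level; _⊔_; Lift; lift) renaming (suc to lsuc)
open import Data.Unit.Polymorphic using (⊤; tt)
open import Data.Product using (Σ; ∃; _×_; _,_)
open import Data.List using (List; []; _∷_; _++_; map; foldr)
open import Data.Nat using (ℕ; zero; suc)
open import Relation.Nullary using (¬_)
open import Algebra.Bundles using (CommutativeRing)
open import Algebra.Bundles.Raw using (RawRing)

record Field (c ℓ : Level) : Set (lsuc (c ⊔ ℓ)) where
  field
    commutativeRing : CommutativeRing c ℓ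
  open CommutativeRing commutativeRing public
  field
    1≉0     : ¬ (1# ≈ 0#)
    inverse : ∀ x → ¬ (x ≈ 0#) → ∃ λ y → x * y ≈ 1#

-- Univariate polynomials over a (raw) ring, as coefficient lists,
-- lowest degree first; equality is coefficientwise up to trailing zeros.

module PolyOver {c ℓ : Level} (R : RawRing c ℓ) where
  open RawRing R

  Poly : Set c
  Poly = List Carrier

  infix 4 _≈ₚ_
  _≈ₚ_ : Poly → Poly → Set ℓ
  []       ≈ₚ []       = ⊤
  []       ≈ₚ (b ∷ bs) = (b ≈ 0#) × ([] ≈ₚ bs)
  (a ∷ as) ≈ₚ []       = (a ≈ 0#) × (as ≈ₚ [])
  (a ∷ as) ≈ₚ (b ∷ bs) = (a ≈ b) × (as ≈ₚ bs)

  infixl 6 _+ₚ_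
  _+ₚ_ : Poly → Poly → Poly
  []       +ₚ q        = q
  (a ∷ p)  +ₚ []       = a ∷ p
  (a ∷ p)  +ₚ (b ∷ q)  = (a + b) ∷ (p +ₚ q)

  -ₚ_ : Poly → Poly
  -ₚ p = map -_ p

  infixl 7 _*ₚ_
  _*ₚ_ : Poly → Poly → Poly
  []      *ₚ q = []
  (a ∷ p) *ₚ q = map (a *_) q +ₚ (0# ∷ (p *ₚ q))

  const : Carrier → Poly
  const a = a ∷ []

  X : Poly
  X = 0# ∷ 1# ∷ []

  polyRawRing : RawRing c ℓ
  polyRawRing = record
    { Carrier = Poly
    ; _≈_ = _≈ₚ_
    ; _+_ = _+ₚ_
    ; _*_ = _*ₚ_
    ; -_  = -ₚ_
    ; 0#  = []
    ; 1#  = const 1#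
    }

-- Fraction field of a (raw) domain R: a fraction is a numerator together
-- with a list of nonzero denominators (the denominator is their product;
-- keeping a list means products of denominators are nonzero by
-- construction).  n / D ≈ m / E  iff  n·∏E ≈ m·∏D.

module FracOver {c ℓ : Level} (R : RawRing c ℓ) where
  open RawRing R

  NonZero : Set (c ⊔ ℓ)
  NonZero = Σ Carrier λ d → ¬ (d ≈ 0#)

  prodD : List NonZero → Carrier
  prodD = foldr (λ { (d , _) acc → d * acc }) 1#

  record Frac : Set (c ⊔ ℓ) where
    constructor _/_
    field
      num : Carrier
      den : List NonZero
  open Frac public

  infix 4 _≈f_
  _≈f_ : Frac → Frac → Set ℓ
  (n / D) ≈f (m / E) = n * prodD E ≈ m * prodD D

  _+f_ : Frac → Frac → Frac
  (n / D) +f (m / E) = (n * prodD E + m * prodD D) / (D ++ E)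

  _*f_ : Frac → Frac → Frac
  (n / D) *f (m / E) = (n * m) / (D ++ E)

  -f_ : Frac → Frac
  -f (n / D) = (- n) / D

  embed : Carrier → Frac
  embed a = a / []

  fracRawRing : RawRing (c ⊔ ℓ) ℓ
  fracRawRing = record
    { Carrier = Frac
    ; _≈_ = _≈f_
    ; _+_ = _+f_
    ; _*_ = _*f_
    ; -_  = -f_
    ; 0#  = embed 0#
    ; 1#  = embed 1#
    }

module Divisibility {c ℓ : Level} (R : RawRing c ℓ) where
  open RawRing R

  IsUnit : Carrier → Set (c ⊔ ℓ)
  IsUnit u = ∃ λ v → u * v ≈ 1#

  Irreducible : Carrier → Set (c ⊔ ℓ)
  Irreducible p =
    ¬ (p ≈ 0#) × ¬ IsUnit p ×
    (∀ f g → p ≈ f * g → ¬ (¬ IsUnit f × ¬ IsUnit g))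

  infixr 8 _^_
  _^_ : Carrier → ℕ → Carrier
  x ^ zero  = 1#
  x ^ suc n = x * (x ^ n)

module RationalFunctionPolys {c ℓ : Level} (k : Field c ℓ) where
  open Field k using (commutativeRing)
  kRaw : RawRing c ℓ
  kRaw = CommutativeRing.rawRing commutativeRing

  module kY = PolyOver kRaw
  module KY = FracOver kY.polyRawRing
  module KYZ = PolyOver KY.fracRawRing
  open Divisibility KYZ.polyRawRing public

  KYZring : RawRing (c ⊔ ℓ) ℓ
  KYZring = KYZ.polyRawRing

  Z : KYZ.Poly
  Z = KYZ.X

  Y : KYZ.Poly
  Y = KYZ.const (KY.embed kY.X)

  ι : Field.Carrier k → KYZ.Poly
  ι a = KYZ.const (KY.embed (kY.const a))

{-# OPTIONS --safe #-}

-- Write T for Y and substitute Z = u T.  Then Z P becomes u T Q, where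
-- Q = S n T ^ (n - 1) - a S t T ^ (t - 1) has coefficients in k[u] and
-- S m = ((1 + u) ^ m - 1) / u.  By Gauss's lemma, a factorization of P
-- over k(Y) yields a factorization of Q in k[u][T] whose factors are, up
-- to constants, the images of the original ones.  As gcd n t = 1, the
-- polynomials S n and S t are coprime and the characteristic of k divides
-- at most one of n, t; for the other one, S m is squarefree, and
-- Eisenstein's criterion at a prime factor of it shows that one factor of
-- Q is a monomial whose coefficient divides both S n and S t.  That
-- coefficient is a constant, so the corresponding factor of P does not
-- involve Z and is a unit of k(Y)[Z].

module Submission where

open import Defs
open import Level using (Level)
open import Data.Nat using (ℕ; suc; _≤_; _<_; s≤s)
open import Data.Nat.GCD using (gcd)
open import Data.Product using (_,_)
open import Relation.Binary using (Rel)
open import Relation.Binary.PropositionalEquality using (_≡_)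
open import Relation.Nullary using (¬_)
open import Relation.Nullary.Negation using (Stable)
open import Algebra.Bundles using (CommutativeRing)
open import Algebra.Bundles.Raw using (RawRing)
open import Algebra.Structures using (IsCommutativeRing)

module _ {q} (Q : ℕ → Set q) where

  open import Data.Nat using (zero; z≤n)
  open import Data.Nat.Induction using (<-rec)
  open import Data.Nat.Properties using (m≤n⇒m<n∨m≡n)
  open import Data.Product using (∃; _×_)
  open import Data.Sum using (_⊎_; inj₁; inj₂)
  open import Relation.Binary.PropositionalEquality using (refl)
  open import Relation.Nullary using (yes; no)
  open import Relation.Nullary.Decidable using (¬¬-excluded-middle)
  open import Relation.Nullary.Negation using (DoubleNegation)

  Least : ℕ → Set q
  Least m = Q m × (∀ j → j < m → ¬ Q j)

  Greatest : ℕ → Set q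
  Greatest m = Q m × (∀ j → m < j → ¬ Q j)

  ¬¬-least : ∀ i → Q i → DoubleNegation (∃ Least)
  ¬¬-least = <-rec (λ i → Q i → DoubleNegation (∃ Least)) λ i rec qi k →
    ¬¬-excluded-middle {A = ∃ λ j → j < i × Q j} λ where
      (yes (j , j<i , qj)) → rec j<i qj k
      (no ∄j) → k (i , qi , λ j j<i qj → ∄j (j , j<i , qj))

  ¬¬-greatest : ∀ N {i} → Q i → (∀ j → N ≤ j → ¬ Q j) → DoubleNegation (∃ Greatest)
  ¬¬-greatest zero qi above = λ _ → above _ z≤n qi
  ¬¬-greatest (suc N) qi above k = ¬¬-excluded-middle λ where
      (yes qN) → k (N , qN , above)
      (no ¬qN) → ¬¬-greatest N qi (λ j N≤j → lower ¬qN (m≤n⇒m<n∨m≡n N≤j)) k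
    where
    lower : ∀ {j} → ¬ Q N → N < j ⊎ N ≡ j → ¬ Q j
    lower _ (inj₁ N<j) = above _ N<j
    lower ¬qN (inj₂ refl) = ¬qN

module ¬¬-Closure {c ℓ} (R : CommutativeRing c ℓ) where

  open import Relation.Nullary.Negation using (DoubleNegation; negated-stable; ¬¬-map)

  open CommutativeRing R

  infix 4 _≈¬¬_
  _≈¬¬_ : Rel Carrier ℓ
  x ≈¬¬ y = DoubleNegation (x ≈ y)

  ≈¬¬-stable : ∀ {x y} → Stable (x ≈¬¬ y)
  ≈¬¬-stable = negated-stable

  private
    lift : ∀ {x y} → x ≈ y → x ≈¬¬ y
    lift x≈y k = k x≈y

    lift₂ : ∀ {x y u v a b} → (x ≈ y → u ≈ v → a ≈ b) → x ≈¬¬ y → u ≈¬¬ v → a ≈¬¬ b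
    lift₂ f p q k = p λ p′ → q λ q′ → k (f p′ q′)

  isCommutativeRing¬¬ : IsCommutativeRing _≈¬¬_ _+_ _*_ -_ 0# 1#
  isCommutativeRing¬¬ = record
    { isRing = record
      { +-isAbelianGroup = record
        { isGroup = record
          { isMonoid = record
            { isSemigroup = record
              { isMagma = record
                { isEquivalence = record { refl = lift refl ; sym = ¬¬-map sym ; trans = lift₂ trans }
                ; ∙-cong = lift₂ +-cong }
              ; assoc = λ x y z → lift (+-assoc x y z) }
            ; identity = (λ x → lift (+-identityˡ x)) , (λ x → lift (+-identityʳ x)) }
          ; inverse = (λ x → lift (-‿inverseˡ x)) , (λ x → lift (-‿inverseʳ x))
          ; ⁻¹-cong = ¬¬-map -‿cong }
        ; comm = λ x y → lift (+-comm x y) }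
      ; *-cong = lift₂ *-cong
      ; *-assoc = λ x y z → lift (*-assoc x y z)
      ; *-identity = (λ x → lift (*-identityˡ x)) , (λ x → lift (*-identityʳ x))
      ; distrib = (λ x y z → lift (distribˡ x y z)) , (λ x y z → lift (distribʳ x y z)) }
    ; *-comm = λ x y → lift (*-comm x y) }

module Polynomials {c ℓ ℓ′} (R₀ : RawRing c ℓ) (Eq : Rel (RawRing.Carrier R₀) ℓ′)
  (isCR : IsCommutativeRing Eq (RawRing._+_ R₀) (RawRing._*_ R₀) (RawRing.-_ R₀) (RawRing.0# R₀) (RawRing.1# R₀))
  where

  open import Data.List using ([]; _∷_; map; length)
  open import Data.Nat as ℕ using (zero)
  open import Data.Unit.Polymorphic using (tt)
  open import Function using (_∘_)
  open import Relation.Binary using (Setoid)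
  open import Relation.Binary.PropositionalEquality as ≡ using (_≢_)
  open import Relation.Nullary.Negation using (DoubleNegation; contradiction)

  coefficientRing : CommutativeRing c ℓ′
  coefficientRing = record { isCommutativeRing = isCR }

  open CommutativeRing coefficientRing public hiding (zero)
  open PolyOver R₀ public using (Poly; _+ₚ_; _*ₚ_; -ₚ_; const; X)
  open import Algebra.Properties.Ring ring using (-0#≈0#)
  open import Algebra.Properties.CommutativeSemigroup +-commutativeSemigroup using (interchange; x∙yz≈y∙xz)
  import Relation.Binary.Reasoning.Setoid setoid as ≈-Reasoning

  coeff : Poly → ℕ → Carrier
  coeff []      i       = 0#
  coeff (a ∷ p) zero    = a
  coeff (a ∷ p) (suc i) = coeff p i

  infix 4 _≋_
  record _≋_ (p q : Poly) : Set ℓ′ where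
    constructor mk≋
    field at : ∀ i → coeff p i ≈ coeff q i
  open _≋_ public

  ≋-refl : ∀ {p} → p ≋ p
  ≋-refl = mk≋ λ _ → refl

  ≋-sym : ∀ {p q} → p ≋ q → q ≋ p
  ≋-sym e = mk≋ λ i → sym (at e i)

  ≋-trans : ∀ {p q r} → p ≋ q → q ≋ r → p ≋ r
  ≋-trans e f = mk≋ λ i → trans (at e i) (at f i)

  ≋-setoid : Setoid c ℓ′
  ≋-setoid = record { Carrier = Poly ; _≈_ = _≋_ ; isEquivalence = record { refl = ≋-refl ; sym = ≋-sym ; trans = ≋-trans } }

  coeff-≡ : ∀ p {i j} → i ≡ j → coeff p i ≈ coeff p j
  coeff-≡ p ≡.refl = refl

  ∷-cong : ∀ {a b p q} → a ≈ b → p ≋ q → (a ∷ p) ≋ (b ∷ q)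
  ∷-cong a≈b p≋q = mk≋ λ where
    zero    → a≈b
    (suc i) → at p≋q i

  ∷-tail : ∀ {a b p q} → (a ∷ p) ≋ (b ∷ q) → p ≋ q
  ∷-tail e = mk≋ λ i → at e (suc i)

  ∷-tail[] : ∀ {a p} → (a ∷ p) ≋ [] → p ≋ []
  ∷-tail[] e = mk≋ λ i → at e (suc i)

  const-cong : ∀ {a b} → a ≈ b → const a ≋ const b
  const-cong e = ∷-cong e ≋-refl

  const-≈0 : ∀ {a} → a ≈ 0# → const a ≋ []
  const-≈0 a≈0 = mk≋ λ where
    zero    → a≈0
    (suc i) → refl

  coeff-+ : ∀ p q i → coeff (p +ₚ q) i ≈ coeff p i + coeff q i
  coeff-+ []      q       i       = sym (+-identityˡ _)
  coeff-+ (a ∷ p) []      i       = sym (+-identityʳ _)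
  coeff-+ (a ∷ p) (b ∷ q) zero    = refl
  coeff-+ (a ∷ p) (b ∷ q) (suc i) = coeff-+ p q i

  coeff-neg : ∀ p i → coeff (-ₚ p) i ≈ - coeff p i
  coeff-neg []      i       = sym -0#≈0#
  coeff-neg (a ∷ p) zero    = refl
  coeff-neg (a ∷ p) (suc i) = coeff-neg p i

  coeff-scale : ∀ a p i → coeff (map (a *_) p) i ≈ a * coeff p i
  coeff-scale a []      i       = sym (zeroʳ a)
  coeff-scale a (b ∷ p) zero    = refl
  coeff-scale a (b ∷ p) (suc i) = coeff-scale a p i

  coeff-*-zero : ∀ a p q → coeff ((a ∷ p) *ₚ q) zero ≈ a * coeff q zero
  coeff-*-zero a p q = begin
    coeff (map (a *_) q +ₚ (0# ∷ p *ₚ q)) zero ≈⟨ coeff-+ (map (a *_) q) _ zero ⟩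
    coeff (map (a *_) q) zero + 0#             ≈⟨ +-identityʳ _ ⟩
    coeff (map (a *_) q) zero                  ≈⟨ coeff-scale a q zero ⟩
    a * coeff q zero                           ∎
    where open ≈-Reasoning

  coeff-*-suc : ∀ a p q i → coeff ((a ∷ p) *ₚ q) (suc i) ≈ a * coeff q (suc i) + coeff (p *ₚ q) i
  coeff-*-suc a p q i = trans (coeff-+ (map (a *_) q) _ (suc i)) (+-cong (coeff-scale a q (suc i)) refl)

  +ₚ-cong : ∀ {p p′ q q′} → p ≋ p′ → q ≋ q′ → p +ₚ q ≋ p′ +ₚ q′
  +ₚ-cong {p} {p′} {q} {q′} e f = mk≋ λ i → begin
    coeff (p +ₚ q) i          ≈⟨ coeff-+ p q i ⟩
    coeff p i + coeff q i     ≈⟨ +-cong (at e i) (at f i) ⟩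
    coeff p′ i + coeff q′ i   ≈⟨ coeff-+ p′ q′ i ⟨
    coeff (p′ +ₚ q′) i        ∎
    where open ≈-Reasoning

  -ₚ-cong : ∀ {p p′} → p ≋ p′ → -ₚ p ≋ -ₚ p′
  -ₚ-cong {p} {p′} e = mk≋ λ i → trans (coeff-neg p i) (trans (-‿cong (at e i)) (sym (coeff-neg p′ i)))

  +ₚ-assoc : ∀ p q r → (p +ₚ q) +ₚ r ≋ p +ₚ (q +ₚ r)
  +ₚ-assoc p q r = mk≋ λ i → begin
    coeff ((p +ₚ q) +ₚ r) i               ≈⟨ trans (coeff-+ (p +ₚ q) r i) (+-cong (coeff-+ p q i) refl) ⟩
    (coeff p i + coeff q i) + coeff r i   ≈⟨ +-assoc _ _ _ ⟩
    coeff p i + (coeff q i + coeff r i)   ≈⟨ trans (coeff-+ p (q +ₚ r) i) (+-cong refl (coeff-+ q r i)) ⟨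
    coeff (p +ₚ (q +ₚ r)) i               ∎
    where open ≈-Reasoning

  +ₚ-comm : ∀ p q → p +ₚ q ≋ q +ₚ p
  +ₚ-comm p q = mk≋ λ i → trans (coeff-+ p q i) (trans (+-comm _ _) (sym (coeff-+ q p i)))

  +ₚ-identityˡ : ∀ p → [] +ₚ p ≋ p
  +ₚ-identityˡ p = ≋-refl

  +ₚ-identityʳ : ∀ p → p +ₚ [] ≋ p
  +ₚ-identityʳ p = mk≋ λ i → trans (coeff-+ p [] i) (+-identityʳ _)

  -ₚ-inverseˡ : ∀ p → (-ₚ p) +ₚ p ≋ []
  -ₚ-inverseˡ p = mk≋ λ i → trans (coeff-+ (-ₚ p) p i) (trans (+-cong (coeff-neg p i) refl) (-‿inverseˡ _))

  -ₚ-inverseʳ : ∀ p → p +ₚ (-ₚ p) ≋ []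
  -ₚ-inverseʳ p = ≋-trans (+ₚ-comm p (-ₚ p)) (-ₚ-inverseˡ p)

  *ₚ-zeroˡ-≋ : ∀ p q → p ≋ [] → p *ₚ q ≋ []
  *ₚ-zeroˡ-≋ []      q e = ≋-refl
  *ₚ-zeroˡ-≋ (a ∷ p) q e = mk≋ λ where
      zero    → trans (coeff-*-zero a p q) (trans (*-cong a≈0 refl) (zeroˡ _))
      (suc i) → trans (coeff-*-suc a p q i)
                  (trans (+-cong (trans (*-cong a≈0 refl) (zeroˡ _)) (at (*ₚ-zeroˡ-≋ p q (∷-tail[] e)) i)) (+-identityˡ _))
    where a≈0 = at e zero

  *ₚ-zeroʳ : ∀ p → p *ₚ [] ≋ []
  *ₚ-zeroʳ []      = ≋-refl
  *ₚ-zeroʳ (a ∷ p) = mk≋ λ where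
    zero    → refl
    (suc i) → at (*ₚ-zeroʳ p) i

  *ₚ-congˡ : ∀ {p p′} q → p ≋ p′ → p *ₚ q ≋ p′ *ₚ q
  *ₚ-congˡ {[]}    {[]}     q e = ≋-refl
  *ₚ-congˡ {[]}    {b ∷ p′} q e = ≋-sym (*ₚ-zeroˡ-≋ (b ∷ p′) q (≋-sym e))
  *ₚ-congˡ {a ∷ p} {[]}     q e = *ₚ-zeroˡ-≋ (a ∷ p) q e
  *ₚ-congˡ {a ∷ p} {b ∷ p′} q e = mk≋ λ where
      zero    → trans (coeff-*-zero a p q) (trans (*-cong (at e zero) refl) (sym (coeff-*-zero b p′ q)))
      (suc i) → trans (coeff-*-suc a p q i)
                  (trans (+-cong (*-cong (at e zero) refl) (at (*ₚ-congˡ q (∷-tail e)) i)) (sym (coeff-*-suc b p′ q i)))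

  *ₚ-congʳ : ∀ p {q q′} → q ≋ q′ → p *ₚ q ≋ p *ₚ q′
  *ₚ-congʳ []      e = ≋-refl
  *ₚ-congʳ (a ∷ p) {q} {q′} e = mk≋ λ where
      zero    → trans (coeff-*-zero a p q) (trans (*-cong refl (at e zero)) (sym (coeff-*-zero a p q′)))
      (suc i) → trans (coeff-*-suc a p q i)
                  (trans (+-cong (*-cong refl (at e (suc i))) (at (*ₚ-congʳ p e) i)) (sym (coeff-*-suc a p q′ i)))

  *ₚ-cong : ∀ {p p′ q q′} → p ≋ p′ → q ≋ q′ → p *ₚ q ≋ p′ *ₚ q′
  *ₚ-cong {p′ = p′} {q = q} e f = ≋-trans (*ₚ-congˡ q e) (*ₚ-congʳ p′ f)

  0∷-*ₚ : ∀ p q → (0# ∷ p) *ₚ q ≋ 0# ∷ (p *ₚ q)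
  0∷-*ₚ p q = mk≋ λ where
    zero    → trans (coeff-*-zero 0# p q) (zeroˡ _)
    (suc i) → trans (coeff-*-suc 0# p q i) (trans (+-cong (zeroˡ _) refl) (+-identityˡ _))

  scale-+ : ∀ a b r → map ((a + b) *_) r ≋ map (a *_) r +ₚ map (b *_) r
  scale-+ a b r = mk≋ λ i → begin
    coeff (map ((a + b) *_) r) i                      ≈⟨ coeff-scale (a + b) r i ⟩
    (a + b) * coeff r i                               ≈⟨ distribʳ _ _ _ ⟩
    a * coeff r i + b * coeff r i                     ≈⟨ +-cong (coeff-scale a r i) (coeff-scale b r i) ⟨
    coeff (map (a *_) r) i + coeff (map (b *_) r) i   ≈⟨ coeff-+ (map (a *_) r) _ i ⟨
    coeff (map (a *_) r +ₚ map (b *_) r) i            ∎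
    where open ≈-Reasoning

  +ₚ-interchange : ∀ p q r s → (p +ₚ q) +ₚ (r +ₚ s) ≋ (p +ₚ r) +ₚ (q +ₚ s)
  +ₚ-interchange p q r s = mk≋ λ i → begin
    coeff ((p +ₚ q) +ₚ (r +ₚ s)) i                      ≈⟨ trans (coeff-+ (p +ₚ q) (r +ₚ s) i) (+-cong (coeff-+ p q i) (coeff-+ r s i)) ⟩
    (coeff p i + coeff q i) + (coeff r i + coeff s i)   ≈⟨ interchange _ _ _ _ ⟩
    (coeff p i + coeff r i) + (coeff q i + coeff s i)   ≈⟨ trans (coeff-+ (p +ₚ r) (q +ₚ s) i) (+-cong (coeff-+ p r i) (coeff-+ q s i)) ⟨
    coeff ((p +ₚ r) +ₚ (q +ₚ s)) i                      ∎
    where open ≈-Reasoning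

  *ₚ-distribʳ : ∀ r p q → (p +ₚ q) *ₚ r ≋ (p *ₚ r) +ₚ (q *ₚ r)
  *ₚ-distribʳ r []      q       = ≋-refl
  *ₚ-distribʳ r (a ∷ p) []      = ≋-sym (+ₚ-identityʳ _)
  *ₚ-distribʳ r (a ∷ p) (b ∷ q) =
    ≋-trans (+ₚ-cong (scale-+ a b r) (∷-cong (sym (+-identityʳ 0#)) (*ₚ-distribʳ r p q)))
            (+ₚ-interchange (map (a *_) r) (map (b *_) r) (0# ∷ p *ₚ r) (0# ∷ q *ₚ r))

  scale-*ₚ : ∀ a q r → map (a *_) q *ₚ r ≋ map (a *_) (q *ₚ r)
  scale-*ₚ a []      r = ≋-refl
  scale-*ₚ a (b ∷ q) r = mk≋ λ where
      zero → begin
        coeff ((a * b ∷ map (a *_) q) *ₚ r) zero   ≈⟨ coeff-*-zero (a * b) (map (a *_) q) r ⟩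
        (a * b) * coeff r zero                     ≈⟨ *-assoc _ _ _ ⟩
        a * (b * coeff r zero)                     ≈⟨ *-cong refl (coeff-*-zero b q r) ⟨
        a * coeff ((b ∷ q) *ₚ r) zero              ≈⟨ coeff-scale a ((b ∷ q) *ₚ r) zero ⟨
        coeff (map (a *_) ((b ∷ q) *ₚ r)) zero     ∎
      (suc i) → begin
        coeff ((a * b ∷ map (a *_) q) *ₚ r) (suc i)                 ≈⟨ coeff-*-suc (a * b) (map (a *_) q) r i ⟩
        (a * b) * coeff r (suc i) + coeff (map (a *_) q *ₚ r) i     ≈⟨ +-cong (*-assoc _ _ _) (trans (at (scale-*ₚ a q r) i) (coeff-scale a (q *ₚ r) i)) ⟩
        a * (b * coeff r (suc i)) + a * coeff (q *ₚ r) i            ≈⟨ distribˡ _ _ _ ⟨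
        a * (b * coeff r (suc i) + coeff (q *ₚ r) i)                ≈⟨ *-cong refl (coeff-*-suc b q r i) ⟨
        a * coeff ((b ∷ q) *ₚ r) (suc i)                            ≈⟨ coeff-scale a ((b ∷ q) *ₚ r) (suc i) ⟨
        coeff (map (a *_) ((b ∷ q) *ₚ r)) (suc i)                   ∎
    where open ≈-Reasoning

  *ₚ-assoc : ∀ p q r → (p *ₚ q) *ₚ r ≋ p *ₚ (q *ₚ r)
  *ₚ-assoc []      q r = ≋-refl
  *ₚ-assoc (a ∷ p) q r =
    ≋-trans (*ₚ-distribʳ r (map (a *_) q) (0# ∷ p *ₚ q))
            (+ₚ-cong (scale-*ₚ a q r) (≋-trans (0∷-*ₚ (p *ₚ q) r) (∷-cong refl (*ₚ-assoc p q r))))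

  *ₚ-∷ : ∀ p b q → p *ₚ (b ∷ q) ≋ map (b *_) p +ₚ (0# ∷ p *ₚ q)
  *ₚ-∷ []      b q = mk≋ λ where
    zero    → refl
    (suc i) → refl
  *ₚ-∷ (a ∷ p) b q = mk≋ λ where
      zero → trans (coeff-*-zero a p (b ∷ q)) (trans (*-comm _ _) (sym (trans (coeff-+ (map (b *_) (a ∷ p)) (0# ∷ (a ∷ p) *ₚ q) zero) (+-identityʳ _))))
      (suc i) → begin
        coeff ((a ∷ p) *ₚ (b ∷ q)) (suc i)                           ≈⟨ coeff-*-suc a p (b ∷ q) i ⟩
        a * coeff q i + coeff (p *ₚ (b ∷ q)) i                       ≈⟨ +-cong refl (trans (at (*ₚ-∷ p b q) i) (coeff-+ (map (b *_) p) _ i)) ⟩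
        a * coeff q i + (coeff (map (b *_) p) i + coeff (0# ∷ p *ₚ q) i)   ≈⟨ x∙yz≈y∙xz _ _ _ ⟩
        coeff (map (b *_) p) i + (a * coeff q i + coeff (0# ∷ p *ₚ q) i)   ≈⟨ +-cong refl (trans (coeff-+ (map (a *_) q) _ i) (+-cong (coeff-scale a q i) refl)) ⟨
        coeff (map (b *_) p) i + coeff ((a ∷ p) *ₚ q) i              ≈⟨ coeff-+ (map (b *_) (a ∷ p)) (0# ∷ (a ∷ p) *ₚ q) (suc i) ⟨
        coeff (map (b *_) (a ∷ p) +ₚ (0# ∷ (a ∷ p) *ₚ q)) (suc i)    ∎
    where open ≈-Reasoning

  *ₚ-comm : ∀ p q → p *ₚ q ≋ q *ₚ p
  *ₚ-comm []      q = ≋-sym (*ₚ-zeroʳ q)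
  *ₚ-comm (a ∷ p) q = ≋-trans (+ₚ-cong ≋-refl (∷-cong refl (*ₚ-comm p q))) (≋-sym (*ₚ-∷ q a p))

  *ₚ-identityˡ : ∀ p → const 1# *ₚ p ≋ p
  *ₚ-identityˡ p = mk≋ λ i → trans (coeff-+ (map (1# *_) p) (0# ∷ []) i)
                              (trans (+-cong (trans (coeff-scale 1# p i) (*-identityˡ _)) (coeff-0∷[] i)) (+-identityʳ _))
    where
    coeff-0∷[] : ∀ i → coeff (0# ∷ []) i ≈ 0#
    coeff-0∷[] zero    = refl
    coeff-0∷[] (suc i) = refl

  *ₚ-identityʳ : ∀ p → p *ₚ const 1# ≋ p
  *ₚ-identityʳ p = ≋-trans (*ₚ-comm p (const 1#)) (*ₚ-identityˡ p)

  *ₚ-distribˡ : ∀ p q r → p *ₚ (q +ₚ r) ≋ p *ₚ q +ₚ p *ₚ r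
  *ₚ-distribˡ p q r = ≋-trans (*ₚ-comm p (q +ₚ r)) (≋-trans (*ₚ-distribʳ p q r) (+ₚ-cong (*ₚ-comm q p) (*ₚ-comm r p)))

  isCommutativeRingₚ : IsCommutativeRing _≋_ _+ₚ_ _*ₚ_ -ₚ_ [] (const 1#)
  isCommutativeRingₚ = record
    { isRing = record
      { +-isAbelianGroup = record
        { isGroup = record
          { isMonoid = record
            { isSemigroup = record
              { isMagma = record { isEquivalence = Setoid.isEquivalence ≋-setoid ; ∙-cong = +ₚ-cong }
              ; assoc = +ₚ-assoc }
            ; identity = +ₚ-identityˡ , +ₚ-identityʳ }
          ; inverse = -ₚ-inverseˡ , -ₚ-inverseʳ
          ; ⁻¹-cong = -ₚ-cong }
        ; comm = +ₚ-comm }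
      ; *-cong = *ₚ-cong
      ; *-assoc = *ₚ-assoc
      ; *-identity = *ₚ-identityˡ , *ₚ-identityʳ
      ; distrib = *ₚ-distribˡ , *ₚ-distribʳ }
    ; *-comm = *ₚ-comm }

  polyRing : CommutativeRing c ℓ′
  polyRing = record { isCommutativeRing = isCommutativeRingₚ }

  open Divisibility (PolyOver.polyRawRing R₀) public using () renaming (_^_ to _^ₚ_)

  ^ₚ-cong : ∀ {p q} n → p ≋ q → p ^ₚ n ≋ q ^ₚ n
  ^ₚ-cong zero    e = ≋-refl
  ^ₚ-cong (suc n) e = *ₚ-cong e (^ₚ-cong n e)

  coeff-≥length : ∀ p i → length p ≤ i → coeff p i ≈ 0#
  coeff-≥length []      i       _         = refl
  coeff-≥length (a ∷ p) (suc i) (s≤s le) = coeff-≥length p i le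

  coeff-const* : ∀ a p i → coeff (const a *ₚ p) i ≈ a * coeff p i
  coeff-const* a p i = trans (coeff-+ (map (a *_) p) (0# ∷ []) i) (trans (+-cong (coeff-scale a p i) (0∷[] i)) (+-identityʳ _))
    where
    0∷[] : ∀ i → coeff (0# ∷ []) i ≈ 0#
    0∷[] zero    = refl
    0∷[] (suc i) = refl

  const-*ₚ : ∀ a b → const a *ₚ const b ≋ const (a * b)
  const-*ₚ a b = mk≋ λ where
    zero    → coeff-const* a (const b) zero
    (suc i) → trans (coeff-const* a (const b) (suc i)) (zeroʳ a)

  scale≋const* : ∀ a p → map (a *_) p ≋ const a *ₚ p
  scale≋const* a p = mk≋ λ i → trans (coeff-scale a p i) (sym (coeff-const* a p i))

  X*ₚ≋0∷ : ∀ p → X *ₚ p ≋ 0# ∷ p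
  X*ₚ≋0∷ p = ≋-trans (0∷-*ₚ (const 1#) p) (∷-cong refl (*ₚ-identityˡ p))

  ∷≋const+X* : ∀ a p → (a ∷ p) ≋ const a +ₚ X *ₚ p
  ∷≋const+X* a p = ≋-sym (≋-trans (+ₚ-cong (≋-refl {const a}) (X*ₚ≋0∷ p)) (∷-cong (+-identityʳ a) ≋-refl))

  monomial : Carrier → ℕ → Poly
  monomial a zero    = const a
  monomial a (suc e) = 0# ∷ monomial a e

  monomial-cong : ∀ {a b} e → a ≈ b → monomial a e ≋ monomial b e
  monomial-cong zero    a≈b = const-cong a≈b
  monomial-cong (suc e) a≈b = ∷-cong refl (monomial-cong e a≈b)

  coeff-monomial*-+ : ∀ a e d j → coeff (monomial a e *ₚ d) (e ℕ.+ j) ≈ a * coeff d j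
  coeff-monomial*-+ a zero    d j = coeff-const* a d j
  coeff-monomial*-+ a (suc e) d j = trans (at (0∷-*ₚ (monomial a e) d) (suc (e ℕ.+ j))) (coeff-monomial*-+ a e d j)

  coeff-monomial-≡ : ∀ a e → coeff (monomial a e) e ≈ a
  coeff-monomial-≡ a zero    = refl
  coeff-monomial-≡ a (suc e) = coeff-monomial-≡ a e

  coeff-monomial-≢ : ∀ a e i → i ≢ e → coeff (monomial a e) i ≈ 0#
  coeff-monomial-≢ a zero    zero    i≢e = contradiction ≡.refl i≢e
  coeff-monomial-≢ a zero    (suc i) _   = refl
  coeff-monomial-≢ a (suc e) zero    _   = refl
  coeff-monomial-≢ a (suc e) (suc i) i≢e = coeff-monomial-≢ a e i (i≢e ∘ ≡.cong suc)

  X*-monomial : ∀ a e → X *ₚ monomial a e ≋ monomial a (suc e)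
  X*-monomial a e = X*ₚ≋0∷ (monomial a e)

  ^-≡-^ₚ : ∀ p n → Divisibility._^_ (CommutativeRing.rawRing polyRing) p n ≡ p ^ₚ n
  ^-≡-^ₚ p zero    = ≡.refl
  ^-≡-^ₚ p (suc n) = ≡.cong (p *ₚ_) (^-≡-^ₚ p n)

  *-^ₚ : ∀ p q n → (p *ₚ q) ^ₚ n ≋ p ^ₚ n *ₚ q ^ₚ n
  *-^ₚ p q zero    = ≋-sym (*ₚ-identityˡ (const 1#))
  *-^ₚ p q (suc n) = ≋-trans (*ₚ-congʳ (p *ₚ q) (*-^ₚ p q n)) (interchangeₚ p q (p ^ₚ n) (q ^ₚ n))
    where open import Algebra.Properties.CommutativeSemigroup (CommutativeRing.*-commutativeSemigroup polyRing)
            using () renaming (interchange to interchangeₚ)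

  const-^ₚ : ∀ a n → const a ^ₚ n ≋ const (Divisibility._^_ R₀ a n)
  const-^ₚ a zero    = ≋-refl
  const-^ₚ a (suc n) = ≋-trans (*ₚ-congʳ (const a) (const-^ₚ a n)) (const-*ₚ a _)

  monomial≋const*X^ : ∀ a e → monomial a e ≋ const a *ₚ X ^ₚ e
  monomial≋const*X^ a zero    = ≋-sym (≋-trans (const-*ₚ a 1#) (const-cong (*-identityʳ a)))
  monomial≋const*X^ a (suc e) = ≋-trans (≋-sym (X*-monomial a e)) (≋-trans (*ₚ-congʳ X (monomial≋const*X^ a e)) (x∙yz≈y∙xzₚ X (const a) (X ^ₚ e)))
    where open import Algebra.Properties.CommutativeSemigroup (CommutativeRing.*-commutativeSemigroup polyRing)
            using () renaming (x∙yz≈y∙xz to x∙yz≈y∙xzₚ)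

  const*-monomial : ∀ a b e → const a *ₚ monomial b e ≋ monomial (a * b) e
  const*-monomial a b e = ≋-trans (*ₚ-congʳ (const a) (monomial≋const*X^ b e))
    (≋-trans (≋-sym (*ₚ-assoc (const a) (const b) (X ^ₚ e))) (≋-trans (*ₚ-congˡ (X ^ₚ e) (const-*ₚ a b)) (≋-sym (monomial≋const*X^ (a * b) e))))

  module FromRaw (≈⇒Eq : ∀ {x y} → RawRing._≈_ R₀ x y → x ≈ y) where
    ≈ₚ⇒≋ : ∀ {p q} → PolyOver._≈ₚ_ R₀ p q → p ≋ q
    ≈ₚ⇒≋ {[]}    {[]}    _       = ≋-refl
    ≈ₚ⇒≋ {[]}    {b ∷ q} (e , r) = mk≋ λ where
      zero    → sym (≈⇒Eq e)
      (suc i) → at (≈ₚ⇒≋ {[]} {q} r) i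
    ≈ₚ⇒≋ {a ∷ p} {[]}    (e , r) = mk≋ λ where
      zero    → ≈⇒Eq e
      (suc i) → at (≈ₚ⇒≋ {p} {[]} r) i
    ≈ₚ⇒≋ {a ∷ p} {b ∷ q} (e , r) = ∷-cong (≈⇒Eq e) (≈ₚ⇒≋ r)

  module ToRaw (Eq⇒¬¬≈ : ∀ {x y} → x ≈ y → DoubleNegation (RawRing._≈_ R₀ x y)) where
    ≋⇒¬¬≈ₚ : ∀ {p q} → p ≋ q → DoubleNegation (PolyOver._≈ₚ_ R₀ p q)
    ≋⇒¬¬≈ₚ {[]}    {[]}    _ k = k tt
    ≋⇒¬¬≈ₚ {[]}    {b ∷ q} e k = Eq⇒¬¬≈ (sym (at e zero)) λ e₀ → ≋⇒¬¬≈ₚ {[]} {q} (mk≋ λ i → at e (suc i)) λ r → k (e₀ , r)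
    ≋⇒¬¬≈ₚ {a ∷ p} {[]}    e k = Eq⇒¬¬≈ (at e zero) λ e₀ → ≋⇒¬¬≈ₚ {p} {[]} (∷-tail[] e) λ r → k (e₀ , r)
    ≋⇒¬¬≈ₚ {a ∷ p} {b ∷ q} e k = Eq⇒¬¬≈ (at e zero) λ e₀ → ≋⇒¬¬≈ₚ (∷-tail e) λ r → k (e₀ , r)

  module Evaluation {c₂ ℓ₂} (S : CommutativeRing c₂ ℓ₂) (φ : Carrier → CommutativeRing.Carrier S)
    (φ-cong : ∀ {x y} → x ≈ y → CommutativeRing._≈_ S (φ x) (φ y))
    (φ-+ : ∀ x y → CommutativeRing._≈_ S (φ (x + y)) (CommutativeRing._+_ S (φ x) (φ y)))
    (φ-* : ∀ x y → CommutativeRing._≈_ S (φ (x * y)) (CommutativeRing._*_ S (φ x) (φ y)))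
    (φ-1 : CommutativeRing._≈_ S (φ 1#) (CommutativeRing.1# S))
    (x₀ : CommutativeRing.Carrier S) where

    private module S = CommutativeRing S
    open import Relation.Binary.Reasoning.Setoid S.setoid 

    open Divisibility S.rawRing public using () renaming (_^_ to _^S_)
    open import Algebra.Properties.Group S.+-group using (inverseˡ-unique)
    open import Algebra.Properties.Ring S.ring using (x+x≈x⇒x≈0)
    open import Algebra.Properties.CommutativeSemigroup S.+-commutativeSemigroup using () renaming (interchange to S-interchange)
    open import Algebra.Properties.CommutativeSemigroup S.*-commutativeSemigroup using () renaming (x∙yz≈y∙xz to S-x∙yz≈y∙xz)

    φ-0 : φ 0# S.≈ S.0#
    φ-0 = x+x≈x⇒x≈0 (φ 0#) (S.trans (S.sym (φ-+ 0# 0#)) (φ-cong (+-identityʳ 0#)))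

    ev : Poly → S.Carrier
    ev []      = S.0#
    ev (a ∷ p) = φ a S.+ x₀ S.* ev p

    ev-≋[] : ∀ p → p ≋ [] → ev p S.≈ S.0#
    ev-≋[] []      e = S.refl
    ev-≋[] (a ∷ p) e = S.trans (S.+-cong (S.trans (φ-cong (at e zero)) φ-0) (S.*-cong S.refl (ev-≋[] p (∷-tail[] e))))
                                (S.trans (S.+-identityˡ _) (S.zeroʳ x₀))

    ev-cong : ∀ {p q} → p ≋ q → ev p S.≈ ev q
    ev-cong {[]}    {q}     e = S.sym (ev-≋[] q (≋-sym e))
    ev-cong {a ∷ p} {[]}    e = ev-≋[] (a ∷ p) e
    ev-cong {a ∷ p} {b ∷ q} e = S.+-cong (φ-cong (at e zero)) (S.*-cong S.refl (ev-cong (∷-tail e)))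

    ev-+ : ∀ p q → ev (p +ₚ q) S.≈ ev p S.+ ev q
    ev-+ []      q       = S.sym (S.+-identityˡ _)
    ev-+ (a ∷ p) []      = S.sym (S.+-identityʳ _)
    ev-+ (a ∷ p) (b ∷ q) = begin
      φ (a + b) S.+ x₀ S.* ev (p +ₚ q)                ≈⟨ S.+-cong (φ-+ a b) (S.trans (S.*-cong S.refl (ev-+ p q)) (S.distribˡ _ _ _)) ⟩
      (φ a S.+ φ b) S.+ (x₀ S.* ev p S.+ x₀ S.* ev q) ≈⟨ S-interchange _ _ _ _ ⟩
      (φ a S.+ x₀ S.* ev p) S.+ (φ b S.+ x₀ S.* ev q) ∎

    ev-scale : ∀ a q → ev (map (a *_) q) S.≈ φ a S.* ev q
    ev-scale a []      = S.sym (S.zeroʳ _)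
    ev-scale a (b ∷ q) = begin
      φ (a * b) S.+ x₀ S.* ev (map (a *_) q)   ≈⟨ S.+-cong (φ-* a b) (S.trans (S.*-cong S.refl (ev-scale a q)) (S-x∙yz≈y∙xz _ _ _)) ⟩
      φ a S.* φ b S.+ φ a S.* (x₀ S.* ev q)    ≈⟨ S.distribˡ _ _ _ ⟨
      φ a S.* (φ b S.+ x₀ S.* ev q)            ∎

    ev-* : ∀ p q → ev (p *ₚ q) S.≈ ev p S.* ev q
    ev-* []      q = S.sym (S.zeroˡ _)
    ev-* (a ∷ p) q = begin
      ev (map (a *_) q +ₚ (0# ∷ p *ₚ q))                 ≈⟨ ev-+ (map (a *_) q) (0# ∷ p *ₚ q) ⟩
      ev (map (a *_) q) S.+ (φ 0# S.+ x₀ S.* ev (p *ₚ q)) ≈⟨ S.+-cong (ev-scale a q) (S.+-cong φ-0 (S.*-cong S.refl (ev-* p q))) ⟩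
      φ a S.* ev q S.+ (S.0# S.+ x₀ S.* (ev p S.* ev q))  ≈⟨ S.+-cong S.refl (S.trans (S.+-identityˡ _) (S.sym (S.*-assoc _ _ _))) ⟩
      φ a S.* ev q S.+ (x₀ S.* ev p) S.* ev q             ≈⟨ S.distribʳ _ _ _ ⟨
      (φ a S.+ x₀ S.* ev p) S.* ev q                      ∎

    ev-neg : ∀ p → ev (-ₚ p) S.≈ S.- ev p
    ev-neg p = inverseˡ-unique (ev (-ₚ p)) (ev p) (S.trans (S.sym (ev-+ (-ₚ p) p)) (ev-≋[] _ (-ₚ-inverseˡ p)))

    ev-const : ∀ a → ev (const a) S.≈ φ a
    ev-const a = S.trans (S.+-cong S.refl (S.zeroʳ x₀)) (S.+-identityʳ _)

    ev-X : ev X S.≈ x₀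
    ev-X = S.trans (S.+-cong φ-0 (S.*-cong S.refl (S.trans (ev-const 1#) φ-1)))
                   (S.trans (S.+-identityˡ _) (S.*-identityʳ x₀))

    ev-^ : ∀ p n → ev (p ^ₚ n) S.≈ ev p ^S n
    ev-^ p zero    = S.trans (ev-const 1#) φ-1
    ev-^ p (suc n) = S.trans (ev-* p (p ^ₚ n)) (S.*-cong S.refl (ev-^ p n))

module RingIdeals {c ℓ} (R : CommutativeRing c ℓ) where

  open import Data.Product using (∃)
  open import Level using (_⊔_)
  open import Relation.Nullary.Negation using (DoubleNegation)

  open CommutativeRing R
  open import Algebra.Properties.Ring ring using (-1*x≈-x)
  open import Algebra.Properties.AbelianGroup +-abelianGroup using (⁻¹-anti-homo‿-; xyx⁻¹≈y)

  record IsIdeal {ℓi} (I : Carrier → Set ℓi) : Set (c ⊔ ℓ ⊔ ℓi) where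
    field
      0∈       : I 0#
      +-closed : ∀ {x y} → I x → I y → I (x + y)
      *-closed : ∀ a {x} → I x → I (a * x)
      resp     : ∀ {x y} → x ≈ y → I x → I y

    -‿closed : ∀ {x} → I x → I (- x)
    -‿closed x∈ = resp (-1*x≈-x _) (*-closed (- 1#) x∈)

    sub-closed : ∀ {x y} → I x → I y → I (x - y)
    sub-closed x∈ y∈ = +-closed x∈ (-‿closed y∈)

    *ʳ-closed : ∀ a {x} → I x → I (x * a)
    *ʳ-closed a x∈ = resp (*-comm a _) (*-closed a x∈)

    ≈0⇒∈ : ∀ {x} → x ≈ 0# → I x
    ≈0⇒∈ x≈0 = resp (sym x≈0) 0∈

    +-∈-cancelʳ : ∀ {x y} → I (x + y) → I y → I x
    +-∈-cancelʳ {x} {y} x+y∈ y∈ = resp x+y-y≈x (sub-closed x+y∈ y∈)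
      where
      x+y-y≈x : (x + y) - y ≈ x
      x+y-y≈x = trans (+-assoc x y (- y)) (trans (+-cong refl (-‿inverseʳ y)) (+-identityʳ x))

    ∈∧sub∈⇒∈ : ∀ {x y} → I x → I (x - y) → I y
    ∈∧sub∈⇒∈ {x} {y} x∈ x-y∈ = resp x-[x-y]≈y (sub-closed x∈ x-y∈)
      where
      x-[x-y]≈y : x - (x - y) ≈ y
      x-[x-y]≈y = trans (+-cong refl (⁻¹-anti-homo‿- x y)) (trans (sym (+-assoc _ _ _)) (xyx⁻¹≈y x y))

  ≈0-isIdeal : IsIdeal (_≈ 0#)
  ≈0-isIdeal = record
    { 0∈       = refl
    ; +-closed = λ x≈0 y≈0 → trans (+-cong x≈0 y≈0) (+-identityʳ _)
    ; *-closed = λ a x≈0 → trans (*-cong refl x≈0) (zeroʳ a)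
    ; resp     = λ x≈y x≈0 → trans (sym x≈y) x≈0
    }

  -- Divisibility with a double-negated quotient, so that it is stable and
  -- can be established by contradiction.
  infix 4 _∣_
  record _∣_ (d x : Carrier) : Set (c ⊔ ℓ) where
    constructor divides
    field ¬¬quotient : DoubleNegation (∃ λ q → x ≈ d * q)
  open _∣_ public

  ∣-stable : ∀ {d x} → Stable (d ∣ x)
  ∣-stable ¬¬d∣x = divides λ k → ¬¬d∣x λ d∣x → ¬¬quotient d∣x k

  ≈*⇒∣ : ∀ {d x q} → x ≈ d * q → d ∣ x
  ≈*⇒∣ x≈dq = divides λ k → k (_ , x≈dq)

  ∣-isIdeal : ∀ d → IsIdeal (d ∣_)
  ∣-isIdeal d = record
    { 0∈       = ≈*⇒∣ (sym (zeroʳ d))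
    ; +-closed = λ d∣x d∣y → divides λ k → ¬¬quotient d∣x λ (q , x≈) → ¬¬quotient d∣y λ (q′ , y≈) →
                   k (q + q′ , trans (+-cong x≈ y≈) (sym (distribˡ d q q′)))
    ; *-closed = λ a d∣x → divides λ k → ¬¬quotient d∣x λ (q , x≈) → k (a * q , trans (*-cong refl x≈) (x∙yz≈y∙xz a d q))
    ; resp     = λ x≈y d∣x → divides λ k → ¬¬quotient d∣x λ (q , x≈) → k (q , trans (sym x≈y) x≈)
    }
    where open import Algebra.Properties.CommutativeSemigroup *-commutativeSemigroup using (x∙yz≈y∙xz)

  ∣-respˡ : ∀ {d d′ x} → d ≈ d′ → d ∣ x → d′ ∣ x
  ∣-respˡ d≈d′ d∣x = divides λ k → ¬¬quotient d∣x λ (q , x≈) → k (q , trans x≈ (*-cong d≈d′ refl))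

  ∣-respʳ : ∀ {d x y} → x ≈ y → d ∣ x → d ∣ y
  ∣-respʳ {d} = IsIdeal.resp (∣-isIdeal d)

  ∣-refl : ∀ {d} → d ∣ d
  ∣-refl {d} = ≈*⇒∣ (sym (*-identityʳ d))

  ∣-trans : ∀ {d x y} → d ∣ x → x ∣ y → d ∣ y
  ∣-trans d∣x x∣y = divides λ k → ¬¬quotient d∣x λ (q , x≈) → ¬¬quotient x∣y λ (q′ , y≈) →
    k (q * q′ , trans y≈ (trans (*-cong x≈ refl) (*-assoc _ _ _)))

  *-∣-* : ∀ {a b x y} → a ∣ x → b ∣ y → a * b ∣ x * y
  *-∣-* a∣x b∣y = divides λ k → ¬¬quotient a∣x λ (q , x≈) → ¬¬quotient b∣y λ (q′ , y≈) →
    k (q * q′ , trans (*-cong x≈ y≈) (*-interchange _ _ _ _))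
    where open import Algebra.Properties.CommutativeSemigroup *-commutativeSemigroup using () renaming (interchange to *-interchange)

  record IsPrime (π : Carrier) : Set (c ⊔ ℓ) where
    field
      nonunit : ¬ π ∣ 1#
      prime   : ∀ {x y} → ¬ π ∣ x → ¬ π ∣ y → ¬ π ∣ (x * y)

module PolynomialIdeals {c ℓ ℓ′} (R₀ : RawRing c ℓ) (Eq : Rel (RawRing.Carrier R₀) ℓ′)
  (isCR : IsCommutativeRing Eq (RawRing._+_ R₀) (RawRing._*_ R₀) (RawRing.-_ R₀) (RawRing.0# R₀) (RawRing.1# R₀))
  where

  open import Data.List using ([]; _∷_)
  open import Data.Nat as ℕ using (zero; z≤n)
  open import Data.Nat.Properties using (n<1+n; <-trans; m≤n+m)
  open import Data.Product using (_×_; proj₁; proj₂)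

  open Polynomials R₀ Eq isCR
  open import Algebra.Properties.Ring ring using (-0#≈0#)
  open import Relation.Binary.Reasoning.Setoid setoid

  open RingIdeals coefficientRing public

  module IdealCoefficients {ℓi} {I : Carrier → Set ℓi} (isI : IsIdeal I) where
    open IsIdeal isI

    AllIn : Poly → Set ℓi
    AllIn p = ∀ i → I (coeff p i)

    InBelow : Poly → ℕ → Set ℓi
    InBelow p m = ∀ i → i < m → I (coeff p i)

    InAbove : Poly → ℕ → Set ℓi
    InAbove p d = ∀ i → d < i → I (coeff p i)

    *-inBelow : ∀ p q {m} → InBelow q m → InBelow (p *ₚ q) m
    *-inBelow []      q hq s       _   = 0∈
    *-inBelow (a ∷ p) q hq zero    s<m = resp (sym (coeff-*-zero a p q)) (*-closed a (hq zero s<m))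
    *-inBelow (a ∷ p) q hq (suc s) s<m =
      resp (sym (coeff-*-suc a p q s)) (+-closed (*-closed a (hq (suc s) s<m)) (*-inBelow p q hq s (<-trans (n<1+n s) s<m)))

    *-allInˡ : ∀ p q → AllIn p → AllIn (p *ₚ q)
    *-allInˡ []      q hp s       = 0∈
    *-allInˡ (a ∷ p) q hp zero    = resp (sym (coeff-*-zero a p q)) (*ʳ-closed _ (hp zero))
    *-allInˡ (a ∷ p) q hp (suc s) =
      resp (sym (coeff-*-suc a p q s)) (+-closed (*ʳ-closed _ (hp zero)) (*-allInˡ p q (λ i → hp (suc i)) s))

    coeff-∷*-suc-cancel : ∀ a p q i → (coeff ((a ∷ p) *ₚ q) (suc i) - a * coeff q (suc i)) ≈ coeff (p *ₚ q) i
    coeff-∷*-suc-cancel a p q i = begin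
      coeff ((a ∷ p) *ₚ q) (suc i) - a * coeff q (suc i)              ≈⟨ +-cong (trans (coeff-*-suc a p q i) (+-comm _ _)) refl ⟩
      (coeff (p *ₚ q) i + a * coeff q (suc i)) - a * coeff q (suc i)  ≈⟨ +-assoc _ _ _ ⟩
      coeff (p *ₚ q) i + (a * coeff q (suc i) - a * coeff q (suc i))  ≈⟨ trans (+-cong refl (-‿inverseʳ _)) (+-identityʳ _) ⟩
      coeff (p *ₚ q) i                                                ∎

    *-inBelow-+ : ∀ p q l m → InBelow p l → InBelow q m →
                  InBelow (p *ₚ q) (l ℕ.+ m) × I (coeff (p *ₚ q) (l ℕ.+ m) - coeff p l * coeff q m)
    *-inBelow-+ []      q l m hp hq = (λ _ _ → 0∈) , ≈0⇒∈ (trans (+-cong refl (trans (-‿cong (zeroˡ _)) -0#≈0#)) (+-identityʳ _))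
    *-inBelow-+ (a ∷ p) q zero zero hp hq = (λ _ ()) , ≈0⇒∈ (trans (+-cong (coeff-*-zero a p q) refl) (-‿inverseʳ _))
    *-inBelow-+ (a ∷ p) q zero (suc m) hp hq =
      *-inBelow (a ∷ p) q hq , resp (sym (coeff-∷*-suc-cancel a p q m)) (*-inBelow p q hq m (n<1+n m))
    *-inBelow-+ (a ∷ p) q (suc l) m hp hq = low , top
      where
      a∈ = hp zero (s≤s z≤n)
      ih = *-inBelow-+ p q l m (λ i i<l → hp (suc i) (s≤s i<l)) hq
      low : InBelow ((a ∷ p) *ₚ q) (suc l ℕ.+ m)
      low zero    _         = resp (sym (coeff-*-zero a p q)) (*ʳ-closed _ a∈)
      low (suc s) (s≤s s<)  = resp (sym (coeff-*-suc a p q s)) (+-closed (*ʳ-closed _ a∈) (proj₁ ih s s<))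
      top : I (coeff ((a ∷ p) *ₚ q) (suc (l ℕ.+ m)) - coeff p l * coeff q m)
      top = resp (sym (trans (+-cong (coeff-*-suc a p q (l ℕ.+ m)) refl) (+-assoc _ _ _)))
                 (+-closed (*ʳ-closed _ a∈) (proj₂ ih))

    *-inAbove-+ : ∀ p q d e → InAbove p d → InAbove q e →
                  InAbove (p *ₚ q) (d ℕ.+ e) × I (coeff (p *ₚ q) (d ℕ.+ e) - coeff p d * coeff q e)
    *-inAbove-+ []      q d e hp hq = (λ _ _ → 0∈) , ≈0⇒∈ (trans (+-cong refl (trans (-‿cong (zeroˡ _)) -0#≈0#)) (+-identityʳ _))
    *-inAbove-+ (a ∷ p) q zero e hp hq = high , leading e
      where
      p∈ : AllIn p
      p∈ i = hp (suc i) (s≤s z≤n)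
      high : InAbove ((a ∷ p) *ₚ q) e
      high (suc s) e<s = resp (sym (coeff-*-suc a p q s)) (+-closed (*-closed a (hq (suc s) e<s)) (*-allInˡ p q p∈ s))
      leading : ∀ e → I (coeff ((a ∷ p) *ₚ q) e - a * coeff q e)
      leading zero    = ≈0⇒∈ (trans (+-cong (coeff-*-zero a p q) refl) (-‿inverseʳ _))
      leading (suc m) = resp (sym (coeff-∷*-suc-cancel a p q m)) (*-allInˡ p q p∈ m)
    *-inAbove-+ (a ∷ p) q (suc d) e hp hq = high , leading
      where
      ih = *-inAbove-+ p q d e (λ i d<i → hp (suc i) (s≤s d<i)) hq
      high : InAbove ((a ∷ p) *ₚ q) (suc d ℕ.+ e)
      high (suc s) (s≤s lt) = resp (sym (coeff-*-suc a p q s))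
        (+-closed (*-closed a (hq (suc s) (<-trans (s≤s (m≤n+m e d)) (s≤s lt)))) (proj₁ ih s lt))
      leading : I (coeff ((a ∷ p) *ₚ q) (suc (d ℕ.+ e)) - coeff p d * coeff q e)
      leading = resp (sym (trans (+-cong (coeff-*-suc a p q (d ℕ.+ e)) refl) (+-assoc _ _ _)))
                     (+-closed (*-closed a (hq (suc (d ℕ.+ e)) (s≤s (m≤n+m e d)))) (proj₂ ih))

module PolynomialDegrees {c ℓ ℓ′} (R₀ : RawRing c ℓ) (Eq : Rel (RawRing.Carrier R₀) ℓ′)
  (isCR : IsCommutativeRing Eq (RawRing._+_ R₀) (RawRing._*_ R₀) (RawRing.-_ R₀) (RawRing.0# R₀) (RawRing.1# R₀))
  (≈-stable : ∀ {x y} → Stable (Eq x y))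
  where

  open import Data.List using ([]; length)
  open import Data.Nat as ℕ using (zero; z≤n)
  open import Data.Nat.Properties using (<-cmp; ≤-<-connex; ≤-refl; <⇒≤)
  open import Data.Product using (∃; _×_; proj₁; proj₂)
  open import Data.Sum using (inj₁; inj₂)
  open import Relation.Binary using (tri<; tri≈; tri>)
  open import Relation.Binary.PropositionalEquality using (_≢_)
  open import Relation.Nullary.Negation using (DoubleNegation; contradiction)

  open Polynomials R₀ Eq isCR
  open PolynomialIdeals R₀ Eq isCR

  ≋-stable : ∀ {p q} → Stable (p ≋ q)
  ≋-stable ¬¬p≋q = mk≋ λ i → ≈-stable λ ¬eq → ¬¬p≋q λ p≋q → ¬eq (at p≋q i)

  record HasDegree (p : Poly) (d : ℕ) : Set ℓ′ where
    constructor _,_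
    field
      leading≉0 : ¬ (coeff p d ≈ 0#)
      above≈0   : ∀ i → d < i → coeff p i ≈ 0#

  record HasOrder (p : Poly) (l : ℕ) : Set ℓ′ where
    constructor _,_
    field
      trailing≉0 : ¬ (coeff p l ≈ 0#)
      below≈0    : ∀ i → i < l → coeff p i ≈ 0#

  ¬¬-nonzeroCoeff : ∀ p → ¬ (p ≋ []) → DoubleNegation (∃ λ i → ¬ (coeff p i ≈ 0#))
  ¬¬-nonzeroCoeff p p≉0 k = p≉0 (mk≋ λ i → ≈-stable λ ¬eq → k (i , ¬eq))

  ¬¬-hasDegree : ∀ p → ¬ (p ≋ []) → DoubleNegation (∃ (HasDegree p))
  ¬¬-hasDegree p p≉0 k = ¬¬-nonzeroCoeff p p≉0 λ (i , pᵢ≉0) →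
    ¬¬-greatest (λ i → ¬ (coeff p i ≈ 0#)) (length p) pᵢ≉0 (λ j le → λ ne → ne (coeff-≥length p j le))
      λ (d , p_d≉0 , above) → k (d , p_d≉0 , λ j d<j → ≈-stable (above j d<j))

  ¬¬-hasOrder : ∀ p → ¬ (p ≋ []) → DoubleNegation (∃ (HasOrder p))
  ¬¬-hasOrder p p≉0 k = ¬¬-nonzeroCoeff p p≉0 λ (i , pᵢ≉0) →
    ¬¬-least (λ i → ¬ (coeff p i ≈ 0#)) i pᵢ≉0
      λ (l , p_l≉0 , below) → k (l , p_l≉0 , λ j j<l → ≈-stable (below j j<l))

  hasDegree-resp : ∀ {p q d} → p ≋ q → HasDegree p d → HasDegree q d
  hasDegree-resp e (nz , z) = (λ z′ → nz (trans (at e _) z′)) , λ i lt → trans (sym (at e i)) (z i lt)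

  hasOrder-resp : ∀ {p q l} → p ≋ q → HasOrder p l → HasOrder q l
  hasOrder-resp e (nz , z) = (λ z′ → nz (trans (at e _) z′)) , λ i lt → trans (sym (at e i)) (z i lt)

  hasDegree-unique : ∀ {p d d′} → HasDegree p d → HasDegree p d′ → d ≡ d′
  hasDegree-unique {d = d} {d′} (nz , z) (nz′ , z′) with <-cmp d d′
  ... | tri< d<d′ _ _ = contradiction (z d′ d<d′) nz′
  ... | tri≈ _ d≡d′ _ = d≡d′
  ... | tri> _ _ d′<d = contradiction (z′ d d′<d) nz

  hasOrder-unique : ∀ {p l l′} → HasOrder p l → HasOrder p l′ → l ≡ l′
  hasOrder-unique {l = l} {l′} (nz , z) (nz′ , z′) with <-cmp l l′
  ... | tri< l<l′ _ _ = contradiction (z′ l l<l′) nz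
  ... | tri≈ _ l≡l′ _ = l≡l′
  ... | tri> _ _ l′<l = contradiction (z l′ l′<l) nz′

  order≤degree : ∀ {p l d} → HasOrder p l → HasDegree p d → l ≤ d
  order≤degree {l = l} {d} (nz , _) (_ , z) with ≤-<-connex l d
  ... | inj₁ l≤d = l≤d
  ... | inj₂ d<l = contradiction (z l d<l) nz

  order≡degree⇒monomial : ∀ {p d} → HasOrder p d → HasDegree p d → ∀ i → i ≢ d → coeff p i ≈ 0#
  order≡degree⇒monomial {d = d} (_ , below) (_ , above) i i≢d with <-cmp i d
  ... | tri< i<d _ _ = below i i<d
  ... | tri≈ _ i≡d _ = contradiction i≡d i≢d
  ... | tri> _ _ d<i = above i d<i

  +ₚ-hasDegreeʳ : ∀ q {p d} → HasDegree p d → (∀ i → d ≤ i → coeff q i ≈ 0#) → HasDegree (q +ₚ p) d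
  +ₚ-hasDegreeʳ q {p} {d} (p_d≉0 , above) q≈0 =
    (λ q+p≈0 → p_d≉0 (trans (sym (trans (+-cong (q≈0 d ≤-refl) refl) (+-identityˡ _))) (trans (sym (coeff-+ q p d)) q+p≈0))) ,
    λ i d<i → trans (coeff-+ q p i) (trans (+-cong (q≈0 i (<⇒≤ d<i)) (above i d<i)) (+-identityˡ _))

  hasDegree⇒≉[] : ∀ {p d} → HasDegree p d → ¬ (p ≋ [])
  hasDegree⇒≉[] (nz , _) p≋[] = nz (at p≋[] _)

  const-hasDegree : ∀ {a} → ¬ (a ≈ 0#) → HasDegree (const a) 0
  const-hasDegree a≉0 = a≉0 , λ where (suc i) _ → refl

  hasDegree0⇒≋const : ∀ {p} → HasDegree p 0 → p ≋ const (coeff p 0)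
  hasDegree0⇒≋const {p} (_ , above) = mk≋ λ where
    zero    → refl
    (suc i) → above (suc i) (s≤s z≤n)

  module NoZeroDivisors (no-zero-divisors : ∀ {x y} → ¬ (x ≈ 0#) → ¬ (y ≈ 0#) → ¬ (x * y ≈ 0#)) where
    open IdealCoefficients ≈0-isIdeal
    open import Algebra.Properties.Group +-group using (x∙y⁻¹≈ε⇒x≈y)

    *-hasDegree : ∀ {p q d e} → HasDegree p d → HasDegree q e →
                  HasDegree (p *ₚ q) (d ℕ.+ e) × coeff (p *ₚ q) (d ℕ.+ e) ≈ coeff p d * coeff q e
    *-hasDegree {p} {q} {d} {e} (p≉ , p≈) (q≉ , q≈) =
      ((λ z → no-zero-divisors p≉ q≉ (trans (sym leading) z)) , above) , leading
      where
      above,diff = *-inAbove-+ p q d e p≈ q≈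
      above = proj₁ above,diff
      leading = x∙y⁻¹≈ε⇒x≈y _ _ (proj₂ above,diff)

    *-hasOrder : ∀ {p q l m} → HasOrder p l → HasOrder q m →
                 HasOrder (p *ₚ q) (l ℕ.+ m) × coeff (p *ₚ q) (l ℕ.+ m) ≈ coeff p l * coeff q m
    *-hasOrder {p} {q} {l} {m} (p≉ , p≈) (q≉ , q≈) =
      ((λ z → no-zero-divisors p≉ q≉ (trans (sym trailing) z)) , below) , trailing
      where
      below,diff = *-inBelow-+ p q l m p≈ q≈
      below = proj₁ below,diff
      trailing = x∙y⁻¹≈ε⇒x≈y _ _ (proj₂ below,diff)

    *ₚ-≉[] : ∀ {p q} → ¬ (p ≋ []) → ¬ (q ≋ []) → ¬ (p *ₚ q ≋ [])
    *ₚ-≉[] {p} {q} p≉0 q≉0 pq≋0 = ¬¬-hasDegree p p≉0 λ (d , deg-p) → ¬¬-hasDegree q q≉0 λ (e , deg-q) →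
      hasDegree⇒≉[] (proj₁ (*-hasDegree deg-p deg-q)) pq≋0

    *ₚ-cancelˡ : ∀ {r p q} → ¬ (r ≋ []) → r *ₚ p ≋ r *ₚ q → p ≋ q
    *ₚ-cancelˡ {r} {p} {q} r≉0 rp≋rq = ≋-stable λ p≉q →
      *ₚ-≉[] r≉0 (λ p-q≋0 → p≉q (Pₚ.x∙y⁻¹≈ε⇒x≈y p q p-q≋0)) (≋-trans (Pₚ.x[y-z]≈xy-xz r p q) (Pₚ.x≈y⇒x∙y⁻¹≈ε rp≋rq))
      where
      module Pₚ where
        open import Algebra.Properties.Ring (CommutativeRing.ring polyRing) public using (x[y-z]≈xy-xz)
        open import Algebra.Properties.Group (CommutativeRing.+-group polyRing) public using (x∙y⁻¹≈ε⇒x≈y; x≈y⇒x∙y⁻¹≈ε)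

module PolynomialPrimes {c ℓ ℓ′} (R₀ : RawRing c ℓ) (Eq : Rel (RawRing.Carrier R₀) ℓ′)
  (isCR : IsCommutativeRing Eq (RawRing._+_ R₀) (RawRing._*_ R₀) (RawRing.-_ R₀) (RawRing.0# R₀) (RawRing.1# R₀))
  where

  open import Data.List using ([]; _∷_)
  open import Data.Nat as ℕ using (zero; _≟_)
  import Data.Nat.Properties as ℕ
  open import Data.Product using (∃; proj₂)
  open import Relation.Binary.PropositionalEquality as ≡ using (_≢_)
  open import Relation.Nullary using (yes; no)
  open import Relation.Nullary.Negation using (DoubleNegation)

  open Polynomials R₀ Eq isCR
  open PolynomialIdeals R₀ Eq isCR

  ∣-coeffs⇒factor : ∀ d p → (∀ i → d ∣ coeff p i) → DoubleNegation (∃ λ p′ → p ≋ const d *ₚ p′)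
  ∣-coeffs⇒factor d []      _   k = k ([] , ≋-sym (*ₚ-zeroʳ (const d)))
  ∣-coeffs⇒factor d (a ∷ p) d∣p k = ¬¬quotient (d∣p zero) λ (q , a≈dq) → ∣-coeffs⇒factor d p (λ i → d∣p (suc i)) λ (p′ , p≋dp′) →
    k (q ∷ p′ , mk≋ λ where
      zero    → trans a≈dq (sym (coeff-const* d (q ∷ p′) zero))
      (suc i) → trans (at p≋dp′ i) (trans (coeff-const* d p′ i) (sym (coeff-const* d (q ∷ p′) (suc i)))))

  monomial-∣-coeff : ∀ {G H F g} → G *ₚ H ≋ F → (∀ i → i ≢ g → coeff G i ≈ 0#) → ∀ s → coeff G g ∣ coeff F s
  monomial-∣-coeff {G} {H} {g = g} GH≋F mono s = resp (at GH≋F s) (*-allInˡ G H G∈ s)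
    where
    open IsIdeal (∣-isIdeal (coeff G g))
    open IdealCoefficients (∣-isIdeal (coeff G g))
    G∈ : AllIn G
    G∈ i with i ≟ g
    ... | yes ≡.refl = ∣-refl
    ... | no  i≢g    = ≈0⇒∈ (mono i i≢g)

  module _ {π : Carrier} (π-prime : IsPrime π) where
    open IsPrime π-prime
    open IsIdeal (∣-isIdeal π)
    open IdealCoefficients (∣-isIdeal π)

    NonDivisibleAt : Poly → ℕ → Set _
    NonDivisibleAt p i = ¬ π ∣ coeff p i

    *-leastNonDivisible : ∀ p q {a b} → Least (NonDivisibleAt p) a → Least (NonDivisibleAt q) b →
                          NonDivisibleAt (p *ₚ q) (a ℕ.+ b)
    *-leastNonDivisible p q {a} {b} (π∤pₐ , below-a) (π∤q_b , below-b) π∣ =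
      prime π∤pₐ π∤q_b (∈∧sub∈⇒∈ π∣ (proj₂ (*-inBelow-+ p q a b (λ i i<a → ∣-stable (below-a i i<a)) (λ j j<b → ∣-stable (below-b j j<b)))))

    *-greatestNonDivisible : ∀ p q {a b} → Greatest (NonDivisibleAt p) a → Greatest (NonDivisibleAt q) b →
                             NonDivisibleAt (p *ₚ q) (a ℕ.+ b)
    *-greatestNonDivisible p q {a} {b} (π∤pₐ , above-a) (π∤q_b , above-b) π∣ =
      prime π∤pₐ π∤q_b (∈∧sub∈⇒∈ π∣ (proj₂ (*-inAbove-+ p q a b (λ i a<i → ∣-stable (above-a i a<i)) (λ j b<j → ∣-stable (above-b j b<j)))))

    ¬¬-leastNonDivisible : ∀ p → ¬ AllIn p → DoubleNegation (∃ (Least (NonDivisibleAt p)))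
    ¬¬-leastNonDivisible p ¬all k = ¬all λ i → ∣-stable λ π∤pᵢ → ¬¬-least (NonDivisibleAt p) i π∤pᵢ k

    gauss : ∀ p q → ¬ AllIn p → ¬ AllIn q → ¬ AllIn (p *ₚ q)
    gauss p q ¬all-p ¬all-q all-pq =
      ¬¬-leastNonDivisible p ¬all-p λ (a , least-a) → ¬¬-leastNonDivisible q ¬all-q λ (b , least-b) →
      *-leastNonDivisible p q least-a least-b (all-pq (a ℕ.+ b))

module TwoTermEisenstein {c ℓ ℓ′} (R₀ : RawRing c ℓ) (Eq : Rel (RawRing.Carrier R₀) ℓ′)
  (isCR : IsCommutativeRing Eq (RawRing._+_ R₀) (RawRing._*_ R₀) (RawRing.-_ R₀) (RawRing.0# R₀) (RawRing.1# R₀))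
  (≈-stable : ∀ {x y} → Stable (Eq x y))
  (no-zero-divisors : ∀ {x y} → ¬ Eq x (RawRing.0# R₀) → ¬ Eq y (RawRing.0# R₀) → ¬ Eq (RawRing._*_ R₀ x y) (RawRing.0# R₀))
  where

  open import Data.List using ([]; length)
  open import Data.Nat as ℕ using (_≟_)
  open import Data.Nat.Properties as ℕ using (≮⇒≥; ≤∧≢⇒<; +-mono-<-≤; <-irrefl)
  open import Data.Product using (∃; _×_; proj₁; proj₂)
  open import Data.Sum using (_⊎_; inj₁; inj₂)
  open import Function using (_∘_)
  open import Relation.Binary.PropositionalEquality as ≡ using (_≢_)
  open import Relation.Nullary using (yes; no)
  open import Relation.Nullary.Decidable using (¬¬-excluded-middle; decidable-stable)
  open import Relation.Nullary.Negation using (DoubleNegation; contradiction)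

  open Polynomials R₀ Eq isCR
  open PolynomialIdeals R₀ Eq isCR
  open PolynomialPrimes R₀ Eq isCR
  open PolynomialDegrees R₀ Eq isCR ≈-stable
  open NoZeroDivisors no-zero-divisors
  open HasDegree
  open HasOrder

  private
    +-≤-≤-≡ : ∀ {a b c d} → a ℕ.+ b ≡ c ℕ.+ d → a ≤ c → b ≤ d → a ≡ c
    +-≤-≤-≡ {a} {c = c} a+b≡c+d a≤c b≤d with a ≟ c
    ... | yes a≡c = a≡c
    ... | no  a≢c = contradiction a+b≡c+d (λ e → <-irrefl e (+-mono-<-≤ (≤∧≢⇒< a≤c a≢c) b≤d))

  Monomial : Poly → Set ℓ′
  Monomial G = ∃ λ g → ∀ i → i ≢ g → coeff G i ≈ 0#

  private
    factors-≉[] : ∀ {G H F N} → G *ₚ H ≋ F → HasDegree F N → ¬ (G ≋ []) × ¬ (H ≋ [])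
    factors-≉[] {G} {H} GH≋F deg-F =
      (λ G≋0 → hasDegree⇒≉[] deg-F (≋-trans (≋-sym GH≋F) (*ₚ-zeroˡ-≋ G H G≋0))) ,
      (λ H≋0 → hasDegree⇒≉[] deg-F (≋-trans (≋-sym GH≋F) (≋-trans (*ₚ-congʳ G H≋0) (*ₚ-zeroʳ G))))

  module _ {π : Carrier} (π-prime : IsPrime π) where
    open IsPrime π-prime
    open IsIdeal (∣-isIdeal π)

    private
      divisible-except : ∀ {G H F N s} → G *ₚ H ≋ F → (∀ s → s ≢ N → π ∣ coeff F s) →
                         NonDivisibleAt π-prime (G *ₚ H) s → s ≡ N
      divisible-except {N = N} {s} GH≋F π∣F π∤ = decidable-stable (s ≟ N) λ s≢N → π∤ (resp (sym (at GH≋F s)) (π∣F s s≢N))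

      -- The first coefficients of G and H not divisible by π multiply to a
      -- coefficient of F not divisible by π, which must be the one at N.
      monomial-by-order : ∀ {G H F N g₀ g₁ h₁} → G *ₚ H ≋ F → (∀ s → s ≢ N → π ∣ coeff F s) →
                HasOrder G g₀ → HasDegree G g₁ → g₁ ℕ.+ h₁ ≡ N →
                ¬ π ∣ coeff G g₀ → ¬ π ∣ coeff H h₁ → DoubleNegation (Monomial G)
      monomial-by-order {G} {H} {h₁ = h₁} GH≋F π∣F ord-G deg-G g₁+h₁≡N π∤G π∤H k =
        ¬¬-least (NonDivisibleAt π-prime H) h₁ π∤H λ (b , least-b@(_ , below-b)) →
        let g₀+b≡N = divisible-except {G} {H} GH≋F π∣F (*-leastNonDivisible π-prime G H (π∤G , λ j j<g₀ π∤ → π∤ (≈0⇒∈ (below≈0 ord-G j j<g₀))) least-b)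
            b≤h₁ = ≮⇒≥ λ h₁<b → below-b h₁ h₁<b π∤H
            g₀≡g₁ = +-≤-≤-≡ (≡.trans g₀+b≡N (≡.sym g₁+h₁≡N)) (order≤degree ord-G deg-G) b≤h₁
        in k (_ , order≡degree⇒monomial ord-G (≡.subst (HasDegree G) (≡.sym g₀≡g₁) deg-G))

      monomial-by-degree : ∀ {G H F L g₀ g₁ h₀} → G *ₚ H ≋ F → (∀ s → s ≢ L → π ∣ coeff F s) →
                 HasOrder G g₀ → HasDegree G g₁ → g₀ ℕ.+ h₀ ≡ L →
                 ¬ π ∣ coeff G g₁ → ¬ π ∣ coeff H h₀ → DoubleNegation (Monomial G)
      monomial-by-degree {G} {H} {h₀ = h₀} GH≋F π∣F ord-G deg-G g₀+h₀≡L π∤G π∤H k =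
        ¬¬-greatest (NonDivisibleAt π-prime H) (length H) π∤H (λ j le π∤ → π∤ (≈0⇒∈ (coeff-≥length H j le))) λ (b , greatest-b@(_ , above-b)) →
        let g₁+b≡L = divisible-except {G} {H} GH≋F π∣F (*-greatestNonDivisible π-prime G H (π∤G , λ j g₁<j π∤ → π∤ (≈0⇒∈ (above≈0 deg-G j g₁<j))) greatest-b)
            h₀≤b = ≮⇒≥ λ b<h₀ → above-b h₀ b<h₀ π∤H
            g₀≡g₁ = +-≤-≤-≡ (≡.trans g₀+h₀≡L (≡.sym g₁+b≡L)) (order≤degree ord-G deg-G) h₀≤b
        in k (_ , order≡degree⇒monomial ord-G (≡.subst (HasDegree G) (≡.sym g₀≡g₁) deg-G))

    private
      ∣-factorsˡ : ∀ {x y z} → z ≈ x * y → ¬ π ∣ z → ¬ π ∣ x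
      ∣-factorsˡ z≈xy π∤z π∣x = π∤z (resp (sym z≈xy) (*ʳ-closed _ π∣x))

      ∣-factorsʳ : ∀ {x y z} → z ≈ x * y → ¬ π ∣ z → ¬ π ∣ y
      ∣-factorsʳ z≈xy π∤z π∣y = π∤z (resp (sym z≈xy) (*-closed _ π∣y))

      ¬¬-one-not-divisible : ∀ {x y z} → z ≈ x * y → ¬ (π * π) ∣ z → DoubleNegation (¬ π ∣ x ⊎ ¬ π ∣ y)
      ¬¬-one-not-divisible z≈xy π²∤z k = ¬¬-excluded-middle λ where
        (yes π∣x) → k (inj₂ λ π∣y → π²∤z (IsIdeal.resp (∣-isIdeal (π * π)) (sym z≈xy) (*-∣-* π∣x π∣y)))
        (no  π∤x) → k (inj₁ π∤x)

    eisenstein-order : ∀ {G H F N L} → G *ₚ H ≋ F → HasDegree F N → HasOrder F L →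
                       ¬ π ∣ coeff F N → (∀ s → s ≢ N → π ∣ coeff F s) → ¬ (π * π) ∣ coeff F L →
                       DoubleNegation (Monomial G ⊎ Monomial H)
    eisenstein-order {G} {H} {F} GH≋F deg-F ord-F π∤F_N π∣F π²∤F_L k =
      ¬¬-hasDegree G G≉0 λ (g₁ , deg-G) → ¬¬-hasDegree H H≉0 λ (h₁ , deg-H) →
      ¬¬-hasOrder G G≉0 λ (g₀ , ord-G) → ¬¬-hasOrder H H≉0 λ (h₀ , ord-H) →
      let deg-GH , F_N≈ = *-hasDegree deg-G deg-H
          ord-GH , F_L≈ = *-hasOrder ord-G ord-H
          g₁+h₁≡N = hasDegree-unique (hasDegree-resp GH≋F deg-GH) deg-F
          g₀+h₀≡L = hasOrder-unique (hasOrder-resp GH≋F ord-GH) ord-F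
          F_N≈ = trans (coeff-≡ F (≡.sym g₁+h₁≡N)) (trans (sym (at GH≋F _)) F_N≈)
          F_L≈ = trans (coeff-≡ F (≡.sym g₀+h₀≡L)) (trans (sym (at GH≋F _)) F_L≈)
      in ¬¬-one-not-divisible F_L≈ π²∤F_L λ where
        (inj₁ π∤G) → monomial-by-order GH≋F π∣F ord-G deg-G g₁+h₁≡N π∤G (∣-factorsʳ F_N≈ π∤F_N) (k ∘ inj₁)
        (inj₂ π∤H) → monomial-by-order (≋-trans (*ₚ-comm H G) GH≋F) π∣F ord-H deg-H (≡.trans (ℕ.+-comm h₁ g₁) g₁+h₁≡N)
                             π∤H (∣-factorsˡ F_N≈ π∤F_N) (k ∘ inj₂)
      where G≉0,H≉0 = factors-≉[] GH≋F deg-F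
            G≉0 = proj₁ G≉0,H≉0
            H≉0 = proj₂ G≉0,H≉0

    eisenstein-degree : ∀ {G H F N L} → G *ₚ H ≋ F → HasDegree F N → HasOrder F L →
                        ¬ π ∣ coeff F L → (∀ s → s ≢ L → π ∣ coeff F s) → ¬ (π * π) ∣ coeff F N →
                        DoubleNegation (Monomial G ⊎ Monomial H)
    eisenstein-degree {G} {H} {F} GH≋F deg-F ord-F π∤F_L π∣F π²∤F_N k =
      ¬¬-hasDegree G G≉0 λ (g₁ , deg-G) → ¬¬-hasDegree H H≉0 λ (h₁ , deg-H) →
      ¬¬-hasOrder G G≉0 λ (g₀ , ord-G) → ¬¬-hasOrder H H≉0 λ (h₀ , ord-H) →
      let deg-GH , F_N≈ = *-hasDegree deg-G deg-H
          ord-GH , F_L≈ = *-hasOrder ord-G ord-H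
          g₁+h₁≡N = hasDegree-unique (hasDegree-resp GH≋F deg-GH) deg-F
          g₀+h₀≡L = hasOrder-unique (hasOrder-resp GH≋F ord-GH) ord-F
          F_N≈ = trans (coeff-≡ F (≡.sym g₁+h₁≡N)) (trans (sym (at GH≋F _)) F_N≈)
          F_L≈ = trans (coeff-≡ F (≡.sym g₀+h₀≡L)) (trans (sym (at GH≋F _)) F_L≈)
      in ¬¬-one-not-divisible F_N≈ π²∤F_N λ where
        (inj₁ π∤G) → monomial-by-degree GH≋F π∣F ord-G deg-G g₀+h₀≡L π∤G (∣-factorsʳ F_L≈ π∤F_L) (k ∘ inj₁)
        (inj₂ π∤H) → monomial-by-degree (≋-trans (*ₚ-comm H G) GH≋F) π∣F ord-H deg-H (≡.trans (ℕ.+-comm h₀ g₀) g₀+h₀≡L)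
                              π∤H (∣-factorsˡ F_L≈ π∤F_L) (k ∘ inj₂)
      where G≉0,H≉0 = factors-≉[] GH≋F deg-F
            G≉0 = proj₁ G≉0,H≉0
            H≉0 = proj₂ G≉0,H≉0

-- Equality in k need not be decidable, so it is replaced by its double
-- negation: this keeps k a field but makes equality stable, so that
-- nonzero polynomials have degrees and arguments by contradiction go through.
module FieldPolynomials {c ℓ} (k : Field c ℓ) where

  open import Data.List using ([]; length)
  open import Data.Nat as ℕ using (zero; _∸_; _≤?_; z≤n)
  import Data.Nat.Properties as ℕ
  open import Data.Product using (∃; ∃₂; _×_; proj₁; proj₂)
  open import Data.Sum using (inj₁; inj₂)
  open import Level using (_⊔_)
  import Relation.Binary.PropositionalEquality as ≡
  open import Relation.Nullary using (yes; no)
  open import Relation.Nullary.Decidable using (decidable-stable)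
  open import Relation.Nullary.Negation using (DoubleNegation; contradiction)

  open Field k using (commutativeRing)
  open ¬¬-Closure commutativeRing using (_≈¬¬_; ≈¬¬-stable; isCommutativeRing¬¬)

  kRaw : RawRing c ℓ
  kRaw = CommutativeRing.rawRing commutativeRing

  open Polynomials kRaw _≈¬¬_ isCommutativeRing¬¬ public
  open PolynomialDegrees kRaw _≈¬¬_ isCommutativeRing¬¬ ≈¬¬-stable public
  open import Relation.Binary.Reasoning.Setoid setoid

  1≉0 : ¬ (1# ≈ 0#)
  1≉0 1≈0 = 1≈0 (Field.1≉0 k)

  inverse : ∀ x → ¬ (x ≈ 0#) → ∃ λ y → x * y ≈ 1#
  inverse x x≉0 = let y , xy≈1 = Field.inverse k x (λ x≈0 → x≉0 λ k → k x≈0) in y , λ k → k xy≈1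

  no-zero-divisors : ∀ {x y} → ¬ (x ≈ 0#) → ¬ (y ≈ 0#) → ¬ (x * y ≈ 0#)
  no-zero-divisors {x} {y} x≉0 y≉0 xy≈0 = y≉0 (begin
    y              ≈⟨ *-identityˡ y ⟨
    1# * y         ≈⟨ *-cong (trans (*-comm x⁻¹ x) xx⁻¹≈1) refl ⟨
    (x⁻¹ * x) * y  ≈⟨ *-assoc _ _ _ ⟩
    x⁻¹ * (x * y)  ≈⟨ *-cong refl xy≈0 ⟩
    x⁻¹ * 0#       ≈⟨ zeroʳ _ ⟩
    0#             ∎)
    where
    x⁻¹ = proj₁ (inverse x x≉0)
    xx⁻¹≈1 = proj₂ (inverse x x≉0)

  open NoZeroDivisors no-zero-divisors public
  open RingIdeals polyRing public
  open HasDegree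

  1≉0ₚ : ¬ (const 1# ≋ [])
  1≉0ₚ 1≋0 = 1≉0 (at 1≋0 zero)

  const-∣-1 : ∀ {a} → ¬ (a ≈ 0#) → const a ∣ const 1#
  const-∣-1 {a} a≉0 = ≈*⇒∣ {q = const a⁻¹} (≋-sym (≋-trans (const-*ₚ a a⁻¹) (const-cong aa⁻¹≈1)))
    where
    a⁻¹ = proj₁ (inverse a a≉0)
    aa⁻¹≈1 = proj₂ (inverse a a≉0)

  degree0-∣-1 : ∀ {g} → HasDegree g 0 → g ∣ const 1#
  degree0-∣-1 deg-g = ∣-respˡ (≋-sym (hasDegree0⇒≋const deg-g)) (const-∣-1 (leading≉0 deg-g))

  ∣-const*-cancel : ∀ {γ x a} → ¬ (a ≈ 0#) → γ ∣ const a *ₚ x → γ ∣ x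
  ∣-const*-cancel {γ} {x} {a} a≉0 γ∣ax = divides λ k → ¬¬quotient (const-∣-1 a≉0) λ (s , 1≋as) →
    ¬¬quotient (IsIdeal.*-closed (∣-isIdeal γ) s γ∣ax) λ (q , sax≋γq) → k (q , ≋-trans (x≋ s 1≋as) sax≋γq)
    where
    x≋ : ∀ s → const 1# ≋ const a *ₚ s → x ≋ s *ₚ (const a *ₚ x)
    x≋ s 1≋as = ≋-trans (≋-sym (*ₚ-identityˡ x)) (≋-trans (*ₚ-congˡ x (≋-trans 1≋as (*ₚ-comm (const a) s))) (*ₚ-assoc s (const a) x))

  module MinimalDegree {ℓi} {I : Poly → Set ℓi} (isI : IsIdeal I) {g m}
    (g∈I : I g) (deg-g : HasDegree g m) (minimal : ∀ {z e} → I z → HasDegree z e → m ≤ e) where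

    private
      open IsIdeal isI
      lc⁻¹ = proj₁ (inverse (coeff g m) (leading≉0 deg-g))
      lc*lc⁻¹≈1 = proj₂ (inverse (coeff g m) (leading≉0 deg-g))
      module ∣g = IsIdeal (∣-isIdeal g)

      sub+≋ : ∀ x y → (x +ₚ -ₚ y) +ₚ y ≋ x
      sub+≋ x y = ≋-trans (+ₚ-assoc x (-ₚ y) y) (≋-trans (+ₚ-cong (≋-refl {x}) (-ₚ-inverseˡ y)) (+ₚ-identityʳ x))

    ∣-vanishingAbove : ∀ N z → I z → (∀ i → N ≤ i → coeff z i ≈ 0#) → g ∣ z
    ∣-vanishingAbove N z z∈ above with N ≤? m
    ... | yes N≤m = ∣g.≈0⇒∈ (≋-stable λ z≉0 → ¬¬-hasDegree z z≉0 λ (d , deg-z) →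
                      leading≉0 deg-z (above d (ℕ.≤-trans N≤m (minimal z∈ deg-z))))
    ∣-vanishingAbove zero     z z∈ above | no N≰m = contradiction z≤n N≰m
    ∣-vanishingAbove (suc N′) z z∈ above | no N≰m =
      ∣g.resp (sub+≋ z M*g) (∣g.+-closed (∣-vanishingAbove N′ z′ (sub-closed z∈ (*-closed M g∈I)) above′) (∣g.*-closed M ∣-refl))
      where
      m≤N′ : m ≤ N′
      m≤N′ = ℕ.≤-pred (ℕ.≰⇒> N≰m)
      e = N′ ∸ m
      e+m≡N′ : e ℕ.+ m ≡ N′
      e+m≡N′ = ℕ.m∸n+n≡m m≤N′
      M = monomial (coeff z N′ * lc⁻¹) e
      M*g = M *ₚ g
      z′ = z +ₚ -ₚ M*g

      M*g≈z : ∀ i → N′ ≤ i → coeff M*g i ≈ coeff z i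
      M*g≈z i N′≤i with ℕ.m≤n⇒m<n∨m≡n N′≤i
      ... | inj₂ ≡.refl = begin
        coeff M*g N′                      ≈⟨ coeff-≡ M*g (≡.sym e+m≡N′) ⟩
        coeff M*g (e ℕ.+ m)               ≈⟨ coeff-monomial*-+ _ e g m ⟩
        (coeff z N′ * lc⁻¹) * coeff g m   ≈⟨ *-assoc _ _ _ ⟩
        coeff z N′ * (lc⁻¹ * coeff g m)   ≈⟨ *-cong refl (trans (*-comm _ _) lc*lc⁻¹≈1) ⟩
        coeff z N′ * 1#                   ≈⟨ *-identityʳ _ ⟩
        coeff z N′                        ∎
      ... | inj₁ N′<i = begin
        coeff M*g i                       ≈⟨ coeff-≡ M*g (≡.sym e+j≡i) ⟩
        coeff M*g (e ℕ.+ (i ∸ e))         ≈⟨ coeff-monomial*-+ _ e g (i ∸ e) ⟩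
        _ * coeff g (i ∸ e)               ≈⟨ *-cong refl (above≈0 deg-g (i ∸ e) m<j) ⟩
        _ * 0#                            ≈⟨ zeroʳ _ ⟩
        0#                                ≈⟨ above i N′<i ⟨
        coeff z i                         ∎
        where
        e+j≡i : e ℕ.+ (i ∸ e) ≡ i
        e+j≡i = ℕ.m+[n∸m]≡n (ℕ.≤-trans (ℕ.m∸n≤m N′ m) (ℕ.<⇒≤ N′<i))
        m<j : m < i ∸ e
        m<j = ℕ.+-cancelˡ-< e m (i ∸ e) (≡.subst (ℕ._< e ℕ.+ (i ∸ e)) (≡.sym e+m≡N′) (≡.subst (N′ <_) (≡.sym e+j≡i) N′<i))

      above′ : ∀ i → N′ ≤ i → coeff z′ i ≈ 0#
      above′ i N′≤i = trans (coeff-+ z (-ₚ M*g) i) (trans (+-cong refl (trans (coeff-neg M*g i) (-‿cong (M*g≈z i N′≤i)))) (-‿inverseʳ _))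

    ∣-members : ∀ {z} → I z → g ∣ z
    ∣-members {z} z∈ = ∣-vanishingAbove (length z) z z∈ (coeff-≥length z)

  ¬¬-minimalDegree : ∀ {ℓi} {I : Poly → Set ℓi} → IsIdeal I → ∀ {z} → I z → ¬ (z ≋ []) →
    DoubleNegation (∃₂ λ g m → I g × HasDegree g m × (∀ {z e} → I z → HasDegree z e → m ≤ e))
  ¬¬-minimalDegree {I = I} isI {z} z∈ z≉0 k = ¬¬-hasDegree z z≉0 λ (d , deg-z) →
    ¬¬-least (λ e → ∃ λ z → I z × HasDegree z e) d (z , z∈ , deg-z) λ (m , (g , g∈ , deg-g) , below) →
    k (g , m , g∈ , deg-g , λ {z′} {e} z′∈ deg-z′ → ℕ.≮⇒≥ λ e<m → below e e<m (z′ , z′∈ , deg-z′))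

  factorʳ-≉[] : ∀ {p q r} → ¬ (r ≋ []) → r ≋ p *ₚ q → ¬ (q ≋ [])
  factorʳ-≉[] {p} r≉0 r≋pq q≋0 = r≉0 (≋-trans r≋pq (≋-trans (*ₚ-congʳ p q≋0) (*ₚ-zeroʳ p)))

  factor-hasDegree : ∀ {g s q m e} → q ≋ g *ₚ s → HasDegree g m → HasDegree q e →
                     DoubleNegation (∃ λ d → HasDegree s d × m ℕ.+ d ≡ e)
  factor-hasDegree {g} {s} q≋gs deg-g deg-q k = ¬¬-hasDegree s (factorʳ-≉[] {g} (hasDegree⇒≉[] deg-q) q≋gs) λ (d , deg-s) →
    k (d , deg-s , hasDegree-unique (hasDegree-resp (≋-sym q≋gs) (proj₁ (*-hasDegree deg-g deg-s))) deg-q)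

  ∣-1⇒degree0 : ∀ {g m} → g ∣ const 1# → HasDegree g m → m ≡ 0
  ∣-1⇒degree0 {m = m} g∣1 deg-g = decidable-stable (m ℕ.≟ 0) λ m≢0 → ¬¬quotient g∣1 λ (s , 1≋gs) →
    factor-hasDegree 1≋gs deg-g (const-hasDegree 1≉0) λ (d , _ , m+d≡0) → m≢0 (ℕ.m+n≡0⇒m≡0 m m+d≡0)

  ∣-1⇒constant : ∀ {g} → g ∣ const 1# → ∀ j → coeff g (suc j) ≈ 0#
  ∣-1⇒constant {g} g∣1 j = ≈¬¬-stable λ gⱼ≉0 → ¬¬-hasDegree g (λ g≋0 → gⱼ≉0 (at g≋0 (suc j))) λ (m , deg-g) →
    gⱼ≉0 (above≈0 deg-g (suc j) (≡.subst (_< suc j) (≡.sym (∣-1⇒degree0 g∣1 deg-g)) (s≤s z≤n)))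

  NonConstantDivisor : Poly → ℕ → Set (c ⊔ ℓ)
  NonConstantDivisor p e = ∃ λ q → q ∣ p × HasDegree q e × 1 ≤ e

  -- The ideal (x, q) is generated by an element of least degree, which
  -- divides q and so is either constant or an associate of q.
  module MinimalNonConstantDivisor {p q e₀} (q∣p : q ∣ p) (deg-q : HasDegree q e₀) (1≤e₀ : 1 ≤ e₀)
    (minimal : ∀ j → j < e₀ → ¬ NonConstantDivisor p j) where

    open import Algebra.Solver.Ring.NaturalCoefficients.Default (CommutativeRing.commutativeSemiring polyRing)

    Combination : Poly → Poly → Set (c ⊔ ℓ)
    Combination x z = DoubleNegation (∃₂ λ a b → z ≋ a *ₚ x +ₚ b *ₚ q)

    combination-isIdeal : ∀ x → IsIdeal (Combination x)
    combination-isIdeal x = record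
      { 0∈       = λ k → k ([] , [] , ≋-refl)
      ; +-closed = λ z∈ z′∈ k → z∈ λ (a , b , z≋) → z′∈ λ (a′ , b′ , z′≋) → k (a +ₚ a′ , b +ₚ b′ ,
          ≋-trans (+ₚ-cong z≋ z′≋) (solve 6 (λ a b a′ b′ x q → (a :* x :+ b :* q) :+ (a′ :* x :+ b′ :* q) := (a :+ a′) :* x :+ (b :+ b′) :* q) ≋-refl a b a′ b′ x q))
      ; *-closed = λ r z∈ k → z∈ λ (a , b , z≋) → k (r *ₚ a , r *ₚ b ,
          ≋-trans (*ₚ-congʳ r z≋) (solve 5 (λ r a b x q → r :* (a :* x :+ b :* q) := (r :* a) :* x :+ (r :* b) :* q) ≋-refl r a b x q))
      ; resp     = λ z≋z′ z∈ k → z∈ λ (a , b , z≋) → k (a , b , ≋-trans (≋-sym z≋z′) z≋)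
      }

    nonunit : ¬ q ∣ const 1#
    nonunit q∣1 = ℕ.<⇒≢ 1≤e₀ (≡.sym (∣-1⇒degree0 q∣1 deg-q))

    coprime : ∀ {x} → ¬ q ∣ x → Combination x (const 1#)
    coprime {x} q∤x k = ¬¬-minimalDegree (combination-isIdeal x) q∈ (hasDegree⇒≉[] deg-q) λ (g , m , g∈ , deg-g , minimal-g) →
      let g∣ = MinimalDegree.∣-members (combination-isIdeal x) g∈ deg-g minimal-g
      in by-degree m g∈ deg-g (g∣ q∈) (g∣ x∈) k
      where
      x∈ : Combination x x
      x∈ k = k (const 1# , [] , ≋-sym (≋-trans (+ₚ-identityʳ _) (*ₚ-identityˡ x)))
      q∈ : Combination x q
      q∈ k = k ([] , const 1# , ≋-sym (*ₚ-identityˡ q))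
      by-degree : ∀ {g} m → Combination x g → HasDegree g m → g ∣ q → g ∣ x → Combination x (const 1#)
      by-degree zero g∈ deg-g _ _ k = ¬¬quotient (degree0-∣-1 deg-g) λ (s , 1≋gs) →
        IsIdeal.resp (combination-isIdeal x) (≋-trans (*ₚ-comm s _) (≋-sym 1≋gs)) (IsIdeal.*-closed (combination-isIdeal x) s g∈) k
      by-degree {g} (suc m) g∈ deg-g g∣q g∣x _ = ¬¬quotient g∣q λ (s , q≋gs) →
        factor-hasDegree q≋gs deg-g deg-q λ (d , deg-s , m+d≡e₀) →
        let e₀≤m = ℕ.≮⇒≥ λ m<e₀ → minimal (suc m) m<e₀ (g , ∣-trans g∣q q∣p , deg-g , s≤s z≤n)
            d≡0 = ℕ.n≤0⇒n≡0 (ℕ.+-cancelˡ-≤ (suc m) d 0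
                    (ℕ.≤-trans (ℕ.≤-reflexive m+d≡e₀) (ℕ.≤-trans e₀≤m (ℕ.≤-reflexive (≡.sym (ℕ.+-identityʳ (suc m)))))))
        in ¬¬quotient (degree0-∣-1 (≡.subst (HasDegree s) d≡0 deg-s)) λ (t , 1≋st) →
           q∤x (∣-trans (≈*⇒∣ (q∣g-witness q≋gs 1≋st)) g∣x)
        where
        q∣g-witness : ∀ {g s t} → q ≋ g *ₚ s → const 1# ≋ s *ₚ t → g ≋ q *ₚ t
        q∣g-witness {g} {s} {t} q≋gs 1≋st =
          ≋-trans (≋-sym (*ₚ-identityʳ g)) (≋-trans (*ₚ-congʳ g 1≋st) (≋-trans (≋-sym (*ₚ-assoc g s t)) (*ₚ-congˡ t (≋-sym q≋gs))))

    prime : ∀ {x y} → ¬ q ∣ x → ¬ q ∣ y → ¬ q ∣ (x *ₚ y)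
    prime {x} {y} q∤x q∤y q∣xy = coprime q∤x λ (a , b , 1≋ax+bq) →
      q∤y (IsIdeal.resp (∣-isIdeal q) (≋-sym (y≋ a b 1≋ax+bq))
             (IsIdeal.+-closed (∣-isIdeal q) (IsIdeal.*-closed (∣-isIdeal q) a q∣xy) (≈*⇒∣ ≋-refl)))
      where
      y≋ : ∀ a b → const 1# ≋ a *ₚ x +ₚ b *ₚ q → y ≋ a *ₚ (x *ₚ y) +ₚ q *ₚ (b *ₚ y)
      y≋ a b 1≋ = ≋-trans (≋-sym (*ₚ-identityˡ y)) (≋-trans (*ₚ-congˡ y 1≋)
                    (solve 5 (λ a b x y q → (a :* x :+ b :* q) :* y := a :* (x :* y) :+ q :* (b :* y)) ≋-refl a b x y q))

    isPrime : IsPrime q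
    isPrime = record { nonunit = nonunit ; prime = prime }

  ¬¬-primeFactor : ∀ {p e} → HasDegree p e → 1 ≤ e → DoubleNegation (∃ λ π → IsPrime π × π ∣ p)
  ¬¬-primeFactor {p} {e} deg-p 1≤e k = ¬¬-least (NonConstantDivisor p) e (p , ∣-refl , deg-p , 1≤e)
    λ (e₀ , (q , q∣p , deg-q , 1≤e₀) , minimal) → k (q , MinimalNonConstantDivisor.isPrime q∣p deg-q 1≤e₀ minimal , q∣p)

module GeometricSums {c ℓ} (k : Field c ℓ) where

  open import Data.List using ([]; _∷_; map)
  open import Data.Nat as ℕ using (zero)
  open import Data.Nat.GCD using (gcd-GCD; GCD; module Bézout)
  import Data.Nat.Properties as ℕ
  open import Data.Product using (proj₁)
  import Relation.Binary.PropositionalEquality as ≡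

  open FieldPolynomials k
  open import Algebra.Solver.Ring.NaturalCoefficients.Default (CommutativeRing.commutativeSemiring polyRing)
  open HasDegree

  w : Poly
  w = X +ₚ const 1#

  -- S m = 1 + w + ⋯ + w ^ (m - 1) with w = 1 + u, so that u · S m = (1 + u) ^ m - 1.
  S : ℕ → Poly
  S zero    = []
  S (suc m) = const 1# +ₚ w *ₚ S m

  X*S+1≋w^ : ∀ m → X *ₚ S m +ₚ const 1# ≋ w ^ₚ m
  X*S+1≋w^ zero    = +ₚ-cong (*ₚ-zeroʳ X) (≋-refl {const 1#})
  X*S+1≋w^ (suc m) = ≋-trans
    (solve 2 (λ x s → x :* (con 1 :+ (x :+ con 1) :* s) :+ con 1 := (x :+ con 1) :* (x :* s :+ con 1)) ≋-refl X (S m))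
    (*ₚ-congʳ w (X*S+1≋w^ m))

  S-+ : ∀ a b → S (a ℕ.+ b) ≋ S a +ₚ w ^ₚ a *ₚ S b
  S-+ zero    b = ≋-sym (*ₚ-identityˡ (S b))
  S-+ (suc a) b = ≋-trans (+ₚ-cong (≋-refl {const 1#}) (*ₚ-congʳ w (S-+ a b)))
    (solve 5 (λ o w x y z → o :+ w :* (x :+ y :* z) := (o :+ w :* x) :+ (w :* y) :* z) ≋-refl (const 1#) w (S a) (w ^ₚ a) (S b))

  S-∣-S-* : ∀ x n → S n ∣ S (x ℕ.* n)
  S-∣-S-* zero    n = IsIdeal.0∈ (∣-isIdeal (S n))
  S-∣-S-* (suc x) n = IsIdeal.resp (∣-isIdeal (S n)) (≋-sym (S-+ n (x ℕ.* n)))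
    (IsIdeal.+-closed (∣-isIdeal (S n)) ∣-refl (IsIdeal.*-closed (∣-isIdeal (S n)) (w ^ₚ n) (S-∣-S-* x n)))

  ∣-S-suc : ∀ {γ} m → γ ∣ S (suc m) → γ ∣ w *ₚ S m → γ ∣ const 1#
  ∣-S-suc {γ} m = IsIdeal.+-∈-cancelʳ (∣-isIdeal γ)

  ∣-S-gcd : ∀ {γ} n t → gcd n t ≡ 1 → γ ∣ S n → γ ∣ S t → γ ∣ const 1#
  ∣-S-gcd {γ} n t gcd≡1 γ∣Sn γ∣St with Bézout.identity (≡.subst (GCD n t) gcd≡1 (gcd-GCD n t))
  ... | Bézout.+- x y 1+yt≡xn = ∣-S-suc (y ℕ.* t) (≡.subst (λ m → γ ∣ S m) (≡.sym 1+yt≡xn) (∣-trans γ∣Sn (S-∣-S-* x n))) (IsIdeal.*-closed (∣-isIdeal γ) w (∣-trans γ∣St (S-∣-S-* y t)))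
  ... | Bézout.-+ x y 1+xn≡yt = ∣-S-suc (x ℕ.* n) (≡.subst (λ m → γ ∣ S m) (≡.sym 1+xn≡yt) (∣-trans γ∣St (S-∣-S-* y t))) (IsIdeal.*-closed (∣-isIdeal γ) w (∣-trans γ∣Sn (S-∣-S-* x n)))

  w-hasDegree : HasDegree w 1
  w-hasDegree = 1≉0 , λ where
    (suc zero)    (s≤s ())
    (suc (suc i)) _ → refl

  S-hasDegree : ∀ m → HasDegree (S (suc m)) m
  S-hasDegree zero    = hasDegree-resp (≋-sym (+ₚ-cong (≋-refl {const 1#}) (*ₚ-zeroʳ w))) (const-hasDegree 1≉0)
  S-hasDegree (suc m) = +ₚ-hasDegreeʳ (const 1#) (proj₁ (*-hasDegree w-hasDegree (S-hasDegree m))) λ where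
    (suc i) _ → refl

  open import Algebra.Properties.Semiring.Mult semiring using (_×_; ×-homo-+; ×1-homo-*)
  import Relation.Binary.Reasoning.Setoid setoid as CoefficientReasoning
  import Relation.Binary.Reasoning.Setoid ≋-setoid as ≋-Reasoning

  D : Poly → Poly
  D []      = []
  D (a ∷ p) = p +ₚ (0# ∷ D p)

  coeff-D : ∀ p i → coeff (D p) i ≈ (suc i × 1#) * coeff p (suc i)
  coeff-D []      i       = sym (zeroʳ _)
  coeff-D (a ∷ p) zero    = trans (coeff-+ p (0# ∷ D p) zero) (trans (+-identityʳ _) (sym (trans (*-cong (+-identityʳ 1#) refl) (*-identityˡ _))))
  coeff-D (a ∷ p) (suc i) = trans (coeff-+ p (0# ∷ D p) (suc i)) (trans (+-cong (sym (*-identityˡ _)) (coeff-D p i)) (sym (distribʳ _ _ _)))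

  D-cong : ∀ {p q} → p ≋ q → D p ≋ D q
  D-cong {p} {q} p≋q = mk≋ λ i → trans (coeff-D p i) (trans (*-cong refl (at p≋q (suc i))) (sym (coeff-D q i)))

  D-+ : ∀ p q → D (p +ₚ q) ≋ D p +ₚ D q
  D-+ p q = mk≋ λ i → begin
    coeff (D (p +ₚ q)) i                                        ≈⟨ coeff-D (p +ₚ q) i ⟩
    (suc i × 1#) * coeff (p +ₚ q) (suc i)                       ≈⟨ trans (*-cong refl (coeff-+ p q (suc i))) (distribˡ _ _ _) ⟩
    (suc i × 1#) * coeff p (suc i) + (suc i × 1#) * coeff q (suc i) ≈⟨ trans (coeff-+ (D p) (D q) i) (+-cong (coeff-D p i) (coeff-D q i)) ⟨
    coeff (D p +ₚ D q) i                                        ∎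
    where open CoefficientReasoning

  D-const : ∀ a → D (const a) ≋ []
  D-const a = mk≋ λ i → trans (coeff-D (const a) i) (zeroʳ _)

  D-X : D X ≋ const 1#
  D-X = mk≋ λ where
    zero    → trans (coeff-D X 0) (trans (*-identityʳ _) (+-identityʳ _))
    (suc i) → trans (coeff-D X (suc i)) (zeroʳ _)

  D-const* : ∀ a p → D (const a *ₚ p) ≋ const a *ₚ D p
  D-const* a p = mk≋ λ i → begin
    coeff (D (const a *ₚ p)) i                ≈⟨ trans (coeff-D (const a *ₚ p) i) (*-cong refl (coeff-const* a p (suc i))) ⟩
    (suc i × 1#) * (a * coeff p (suc i))      ≈⟨ x∙yz≈y∙xz _ _ _ ⟩
    a * ((suc i × 1#) * coeff p (suc i))      ≈⟨ trans (coeff-const* a (D p) i) (*-cong refl (coeff-D p i)) ⟨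
    coeff (const a *ₚ D p) i                  ∎
    where open CoefficientReasoning
          open import Algebra.Properties.CommutativeSemigroup *-commutativeSemigroup using (x∙yz≈y∙xz)

  D-* : ∀ p q → D (p *ₚ q) ≋ D p *ₚ q +ₚ p *ₚ D q
  D-* []      q = ≋-refl
  D-* (a ∷ p) q =
    ≋-trans (D-+ (map (a *_) q) (0# ∷ p *ₚ q))
    (≋-trans (+ₚ-cong (≋-trans (D-cong (scale≋const* a q)) (D-const* a q))
                      (+ₚ-cong (≋-refl {p *ₚ q}) (≋-trans (∷-cong refl (D-* p q)) (≋-sym (X*ₚ≋0∷ _)))))
    (≋-trans (solve 6 (λ ca dq p q x dp → ca :* dq :+ (p :* q :+ x :* (dp :* q :+ p :* dq)) := (p :+ x :* dp) :* q :+ (ca :+ x :* p) :* dq)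
                      ≋-refl (const a) (D q) p q X (D p))
             (+ₚ-cong (*ₚ-congˡ q (+ₚ-cong (≋-refl {p}) (X*ₚ≋0∷ (D p)))) (*ₚ-congˡ (D q) (≋-sym (∷≋const+X* a p))))))

  D-^ : ∀ p m → D (p ^ₚ suc m) ≋ const (suc m × 1#) *ₚ (p ^ₚ m *ₚ D p)
  D-^ p zero    = ≋-trans (D-* p (const 1#)) (≋-trans (+ₚ-cong (*ₚ-identityʳ (D p)) (≋-trans (*ₚ-congʳ p (D-const 1#)) (*ₚ-zeroʳ p)))
                    (≋-trans (+ₚ-identityʳ (D p)) (≋-sym (≋-trans (*ₚ-congˡ _ (const-cong (+-identityʳ 1#))) (≋-trans (*ₚ-identityˡ _) (*ₚ-identityˡ (D p)))))))
  D-^ p (suc m) = ≋-trans (D-* p (p ^ₚ suc m)) (≋-trans (+ₚ-cong (≋-refl {D p *ₚ p ^ₚ suc m}) (*ₚ-congʳ p (D-^ p m)))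
    (≋-trans (solve 4 (λ dp p q c → dp :* (p :* q) :+ p :* (c :* (q :* dp)) := (con 1 :+ c) :* ((p :* q) :* dp)) ≋-refl (D p) p (p ^ₚ m) (const (suc m × 1#)))
             (*ₚ-congˡ (p ^ₚ suc m *ₚ D p) (+ₚ-cong (+ₚ-identityʳ (const 1#)) (≋-refl {const (suc m × 1#)})))))

  D-w : D w ≋ const 1#
  D-w = ≋-trans (D-+ X (const 1#)) (≋-trans (+ₚ-cong D-X (D-const 1#)) (+ₚ-identityʳ (const 1#)))

  π²∣⇒π∣D : ∀ {π z} → (π *ₚ π) ∣ z → π ∣ D z
  π²∣⇒π∣D {π} π²∣z = divides λ k → ¬¬quotient π²∣z λ (r , z≋ππr) → k (_ ,
    ≋-trans (D-cong z≋ππr) (≋-trans (D-* (π *ₚ π) r) (≋-trans (+ₚ-cong (*ₚ-congˡ r (D-* π π)) (≋-refl {(π *ₚ π) *ₚ D r}))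
      (solve 4 (λ a p r d → (a :* p :+ p :* a) :* r :+ (p :* p) :* d := p :* ((a :* r :+ a :* r) :+ p :* d)) ≋-refl (D π) π r (D r)))))

  S+X*DS≋ : ∀ t → S (suc t) +ₚ X *ₚ D (S (suc t)) ≋ const (suc t × 1#) *ₚ w ^ₚ t
  S+X*DS≋ t = begin
    S′ +ₚ X *ₚ D S′                        ≈⟨ +ₚ-cong (*ₚ-identityˡ S′) (≋-refl {X *ₚ D S′}) ⟨
    const 1# *ₚ S′ +ₚ X *ₚ D S′            ≈⟨ +ₚ-cong (*ₚ-congˡ S′ D-X) (≋-refl {X *ₚ D S′}) ⟨
    D X *ₚ S′ +ₚ X *ₚ D S′                 ≈⟨ D-* X S′ ⟨
    D (X *ₚ S′)                            ≈⟨ ≋-trans (D-+ (X *ₚ S′) (const 1#)) (≋-trans (+ₚ-cong (≋-refl {D (X *ₚ S′)}) (D-const 1#)) (+ₚ-identityʳ _)) ⟨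
    D (X *ₚ S′ +ₚ const 1#)                ≈⟨ D-cong (X*S+1≋w^ (suc t)) ⟩
    D (w ^ₚ suc t)                         ≈⟨ D-^ w t ⟩
    const (suc t × 1#) *ₚ (w ^ₚ t *ₚ D w)  ≈⟨ *ₚ-congʳ (const (suc t × 1#)) (≋-trans (*ₚ-congʳ (w ^ₚ t) D-w) (*ₚ-identityʳ (w ^ₚ t))) ⟩
    const (suc t × 1#) *ₚ w ^ₚ t           ∎
    where S′ = S (suc t)
          open ≋-Reasoning

  ∤-w^ : ∀ {π} → IsPrime π → ¬ π ∣ w → ∀ j → ¬ π ∣ w ^ₚ j
  ∤-w^ π-prime π∤w zero    = IsPrime.nonunit π-prime
  ∤-w^ π-prime π∤w (suc j) = IsPrime.prime π-prime π∤w (∤-w^ π-prime π∤w j)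

  S-squarefree : ∀ {π} t → IsPrime π → ¬ (t × 1# ≈ 0#) → π ∣ S t → ¬ (π *ₚ π) ∣ S t
  S-squarefree zero    π-prime t≉0 _   _    = t≉0 refl
  S-squarefree {π} (suc t) π-prime t≉0 π∣S π²∣S = ∤-w^ π-prime π∤w t (∣-const*-cancel t≉0 π∣tw^t)
    where
    open IsIdeal (∣-isIdeal π)
    π∣tw^t : π ∣ const (suc t × 1#) *ₚ w ^ₚ t
    π∣tw^t = resp (S+X*DS≋ t) (+-closed π∣S (*-closed X (π²∣⇒π∣D π²∣S)))
    π∤w : ¬ π ∣ w
    π∤w π∣w = IsPrime.nonunit π-prime (∣-S-suc t π∣S (*ʳ-closed (S t) π∣w))

  private
    ×-vanishes : ∀ a b → b × 1# ≈ 0# → (a ℕ.* b) × 1# ≈ 0#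
    ×-vanishes a b b≈0 = trans (×1-homo-* a b) (trans (*-cong refl b≈0) (zeroʳ _))
    1≈0 : ∀ {m} a b → suc m ≡ a ℕ.* b → m × 1# ≈ 0# → b × 1# ≈ 0# → 1# ≈ 0#
    1≈0 {m} a b 1+m≡ab m≈0 b≈0 = begin
      1#                   ≈⟨ trans (+-cong refl m≈0) (+-identityʳ 1#) ⟨
      suc m × 1#           ≡⟨ ≡.cong (_× 1#) 1+m≡ab ⟩
      (a ℕ.* b) × 1#       ≈⟨ ×-vanishes a b b≈0 ⟩
      0#                   ∎
      where open CoefficientReasoning

  characteristic-coprime : ∀ n t → gcd n t ≡ 1 → n × 1# ≈ 0# → ¬ (t × 1# ≈ 0#)
  characteristic-coprime n t gcd≡1 n≈0 t≈0 with Bézout.identity (≡.subst (GCD n t) gcd≡1 (gcd-GCD n t))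
  ... | Bézout.+- x y 1+yt≡xn = 1≉0 (1≈0 x n 1+yt≡xn (×-vanishes y t t≈0) n≈0)
  ... | Bézout.-+ x y 1+xn≡yt = 1≉0 (1≈0 y t 1+xn≡yt (×-vanishes x n n≈0) t≈0)

module RationalFunctions {c ℓ} (k : Field c ℓ) where

  import Algebra.Consequences.Setoid as Consequences
  open import Data.List using ([]; _∷_; _++_)
  open import Data.Product using (proj₁)
  open import Relation.Binary using (Setoid)

  open FieldPolynomials k
  open FracOver (PolyOver.polyRawRing kRaw) public using (NonZero; prodD; Frac; _/_; num; den; _+f_; _*f_; -f_; embed; fracRawRing)
  open import Algebra.Solver.Ring.NaturalCoefficients.Default (CommutativeRing.commutativeSemiring polyRing)
  open import Algebra.Properties.Ring (CommutativeRing.ring polyRing) using (-‿distribˡ-*)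
  open FromRaw (λ x≈y k → k x≈y) public
  open ToRaw (λ x≈¬¬y → x≈¬¬y) public

  nonZero-≉[] : (d : NonZero) → ¬ (proj₁ d ≋ [])
  nonZero-≉[] (d , d≉0) d≋0 = ≋⇒¬¬≈ₚ d≋0 d≉0

  prodD-≉[] : ∀ D → ¬ (prodD D ≋ [])
  prodD-≉[] []      = 1≉0ₚ
  prodD-≉[] (d ∷ D) = *ₚ-≉[] (nonZero-≉[] d) (prodD-≉[] D)

  prodD-++ : ∀ D E → prodD (D ++ E) ≋ prodD D *ₚ prodD E
  prodD-++ []            E = ≋-sym (*ₚ-identityˡ _)
  prodD-++ ((d , _) ∷ D) E = ≋-trans (*ₚ-congʳ d (prodD-++ D E)) (≋-sym (*ₚ-assoc d (prodD D) (prodD E)))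

  infix 4 _≈F_
  _≈F_ : Frac → Frac → Set ℓ
  (n / D) ≈F (m / E) = n *ₚ prodD E ≋ m *ₚ prodD D

  ≈F-refl : ∀ {x} → x ≈F x
  ≈F-refl {n / D} = ≋-refl

  ≈F-sym : ∀ {x y} → x ≈F y → y ≈F x
  ≈F-sym {n / D} {m / E} = ≋-sym

  ≈F-trans : ∀ {x y z} → x ≈F y → y ≈F z → x ≈F z
  ≈F-trans {a / D} {b / E} {c′ / F} aE≋bD bF≋cE = *ₚ-cancelˡ (prodD-≉[] E)
    (≋-trans (solve 3 (λ a e f → e :* (a :* f) := (a :* e) :* f) ≋-refl a e f)
    (≋-trans (*ₚ-congˡ f aE≋bD)
    (≋-trans (solve 3 (λ b d f → (b :* d) :* f := (b :* f) :* d) ≋-refl b d f)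
    (≋-trans (*ₚ-congˡ d bF≋cE)
             (solve 3 (λ c e d → (c :* e) :* d := e :* (c :* d)) ≋-refl c′ e d)))))
    where d = prodD D
          e = prodD E
          f = prodD F

  ≈F-setoid : Setoid _ ℓ
  ≈F-setoid = record
    { Carrier = Frac ; _≈_ = _≈F_
    ; isEquivalence = record { refl = λ {x} → ≈F-refl {x} ; sym = λ {x} {y} → ≈F-sym {x} {y} ; trans = λ {x} {y} {z} → ≈F-trans {x} {y} {z} } }

  ≈F-stable : ∀ {x y} → Stable (x ≈F y)
  ≈F-stable {n / D} {m / E} = ≋-stable

  +f-cong : ∀ {x x′ y y′} → x ≈F x′ → y ≈F y′ → (x +f y) ≈F (x′ +f y′)
  +f-cong {a / D} {a′ / D′} {b / E} {b′ / E′} aD′≋a′D bE′≋b′E =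
    ≋-trans (*ₚ-congʳ (a *ₚ e +ₚ b *ₚ d) (prodD-++ D′ E′))
    (≋-trans (solve 6 (λ a b d e d′ e′ → (a :* e :+ b :* d) :* (d′ :* e′) := (a :* d′) :* (e :* e′) :+ (b :* e′) :* (d :* d′)) ≋-refl a b d e d′ e′)
    (≋-trans (+ₚ-cong (*ₚ-congˡ (e *ₚ e′) aD′≋a′D) (*ₚ-congˡ (d *ₚ d′) bE′≋b′E))
    (≋-trans (solve 6 (λ a′ b′ d e d′ e′ → (a′ :* d) :* (e :* e′) :+ (b′ :* e) :* (d :* d′) := (a′ :* e′ :+ b′ :* d′) :* (d :* e)) ≋-refl a′ b′ d e d′ e′)
             (≋-sym (*ₚ-congʳ (a′ *ₚ e′ +ₚ b′ *ₚ d′) (prodD-++ D E))))))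
    where d = prodD D
          e = prodD E
          d′ = prodD D′
          e′ = prodD E′

  *f-cong : ∀ {x x′ y y′} → x ≈F x′ → y ≈F y′ → (x *f y) ≈F (x′ *f y′)
  *f-cong {a / D} {a′ / D′} {b / E} {b′ / E′} aD′≋a′D bE′≋b′E =
    ≋-trans (*ₚ-congʳ (a *ₚ b) (prodD-++ D′ E′))
    (≋-trans (solve 6 (λ a b d e d′ e′ → (a :* b) :* (d′ :* e′) := (a :* d′) :* (b :* e′)) ≋-refl a b d e d′ e′)
    (≋-trans (*ₚ-cong aD′≋a′D bE′≋b′E)
    (≋-trans (solve 6 (λ a′ b′ d e d′ e′ → (a′ :* d) :* (b′ :* e) := (a′ :* b′) :* (d :* e)) ≋-refl a′ b′ d e d′ e′)
             (≋-sym (*ₚ-congʳ (a′ *ₚ b′) (prodD-++ D E))))))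
    where d = prodD D
          e = prodD E
          d′ = prodD D′
          e′ = prodD E′

  -f-cong : ∀ {x x′} → x ≈F x′ → (-f x) ≈F (-f x′)
  -f-cong {a / D} {a′ / D′} aD′≋a′D = ≋-trans (≋-sym (-‿distribˡ-* a (prodD D′))) (≋-trans (-ₚ-cong aD′≋a′D) (-‿distribˡ-* a′ (prodD D)))

  +f-assoc : ∀ x y z → ((x +f y) +f z) ≈F (x +f (y +f z))
  +f-assoc (a / D) (b / E) (c′ / F) =
    ≋-trans (*ₚ-cong (+ₚ-cong (≋-refl {(a *ₚ e +ₚ b *ₚ d) *ₚ f}) (*ₚ-congʳ c′ (prodD-++ D E))) (≋-trans (prodD-++ D (E ++ F)) (*ₚ-congʳ d (prodD-++ E F))))
    (≋-trans (solve 6 (λ a b c d e f → ((a :* e :+ b :* d) :* f :+ c :* (d :* e)) :* (d :* (e :* f)) := (a :* (e :* f) :+ (b :* f :+ c :* e) :* d) :* ((d :* e) :* f)) ≋-refl a b c′ d e f)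
             (≋-sym (*ₚ-cong (+ₚ-cong (*ₚ-congʳ a (prodD-++ E F)) (≋-refl {(b *ₚ f +ₚ c′ *ₚ e) *ₚ d})) (≋-trans (prodD-++ (D ++ E) F) (*ₚ-congˡ f (prodD-++ D E))))))
    where d = prodD D
          e = prodD E
          f = prodD F

  +f-comm : ∀ x y → (x +f y) ≈F (y +f x)
  +f-comm (a / D) (b / E) =
    ≋-trans (*ₚ-congʳ (a *ₚ e +ₚ b *ₚ d) (prodD-++ E D))
    (≋-trans (solve 4 (λ a b d e → (a :* e :+ b :* d) :* (e :* d) := (b :* d :+ a :* e) :* (d :* e)) ≋-refl a b d e)
             (≋-sym (*ₚ-congʳ (b *ₚ d +ₚ a *ₚ e) (prodD-++ D E))))
    where d = prodD D
          e = prodD E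

  +f-identityˡ : ∀ x → (embed [] +f x) ≈F x
  +f-identityˡ (a / D) = *ₚ-congˡ (prodD D) (*ₚ-identityʳ a)

  -f-inverseˡ : ∀ x → ((-f x) +f x) ≈F embed []
  -f-inverseˡ (a / D) = ≋-trans (*ₚ-identityʳ _) (≋-trans (+ₚ-cong (≋-sym (-‿distribˡ-* a (prodD D))) (≋-refl {a *ₚ prodD D})) (-ₚ-inverseˡ (a *ₚ prodD D)))

  *f-assoc : ∀ x y z → ((x *f y) *f z) ≈F (x *f (y *f z))
  *f-assoc (a / D) (b / E) (c′ / F) =
    ≋-trans (*ₚ-congʳ ((a *ₚ b) *ₚ c′) (≋-trans (prodD-++ D (E ++ F)) (*ₚ-congʳ d (prodD-++ E F))))
    (≋-trans (solve 6 (λ a b c d e f → ((a :* b) :* c) :* (d :* (e :* f)) := (a :* (b :* c)) :* ((d :* e) :* f)) ≋-refl a b c′ d e f)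
             (≋-sym (*ₚ-congʳ (a *ₚ (b *ₚ c′)) (≋-trans (prodD-++ (D ++ E) F) (*ₚ-congˡ f (prodD-++ D E))))))
    where d = prodD D
          e = prodD E
          f = prodD F

  *f-comm : ∀ x y → (x *f y) ≈F (y *f x)
  *f-comm (a / D) (b / E) =
    ≋-trans (*ₚ-congʳ (a *ₚ b) (prodD-++ E D))
    (≋-trans (solve 4 (λ a b d e → (a :* b) :* (e :* d) := (b :* a) :* (d :* e)) ≋-refl a b d e)
             (≋-sym (*ₚ-congʳ (b *ₚ a) (prodD-++ D E))))
    where d = prodD D
          e = prodD E

  *f-identityˡ : ∀ x → (embed (const 1#) *f x) ≈F x
  *f-identityˡ (a / D) = *ₚ-congˡ (prodD D) (*ₚ-identityˡ a)

  *f-distribˡ : ∀ x y z → (x *f (y +f z)) ≈F ((x *f y) +f (x *f z))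
  *f-distribˡ (a / D) (b / E) (c′ / F) =
    ≋-trans (*ₚ-congʳ (a *ₚ (b *ₚ f +ₚ c′ *ₚ e)) (≋-trans (prodD-++ (D ++ E) (D ++ F)) (*ₚ-cong (prodD-++ D E) (prodD-++ D F))))
    (≋-trans (solve 6 (λ a b c d e f → (a :* (b :* f :+ c :* e)) :* ((d :* e) :* (d :* f)) := ((a :* b) :* (d :* f) :+ (a :* c) :* (d :* e)) :* (d :* (e :* f))) ≋-refl a b c′ d e f)
             (≋-sym (*ₚ-cong (+ₚ-cong (*ₚ-congʳ (a *ₚ b) (prodD-++ D F)) (*ₚ-congʳ (a *ₚ c′) (prodD-++ D E))) (≋-trans (prodD-++ D (E ++ F)) (*ₚ-congʳ d (prodD-++ E F))))))
    where d = prodD D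
          e = prodD E
          f = prodD F

  isCommutativeRingF : IsCommutativeRing _≈F_ _+f_ _*f_ -f_ (embed []) (embed (const 1#))
  isCommutativeRingF = record
    { isRing = record
      { +-isAbelianGroup = record
        { isGroup = record
          { isMonoid = record
            { isSemigroup = record
              { isMagma = record { isEquivalence = Setoid.isEquivalence ≈F-setoid ; ∙-cong = λ {x} {x′} {y} {y′} → +f-cong {x} {x′} {y} {y′} }
              ; assoc = +f-assoc }
            ; identity = comm∧idˡ⇒id {_∙_ = _+f_} +f-comm {e = embed []} +f-identityˡ }
          ; inverse = comm∧invˡ⇒inv {_∙_ = _+f_} {_⁻¹ = -f_} {e = embed []} +f-comm -f-inverseˡ
          ; ⁻¹-cong = λ {x} {x′} → -f-cong {x} {x′} }
        ; comm = +f-comm }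
      ; *-cong = λ {x} {x′} {y} {y′} → *f-cong {x} {x′} {y} {y′}
      ; *-assoc = *f-assoc
      ; *-identity = comm∧idˡ⇒id {_∙_ = _*f_} *f-comm {e = embed (const 1#)} *f-identityˡ
      ; distrib = comm∧distrˡ⇒distr {_∙_ = _*f_} {_◦_ = _+f_} (λ {x} {x′} {y} {y′} → +f-cong {x} {x′} {y} {y′}) *f-comm *f-distribˡ }
    ; *-comm = *f-comm }
    where open Consequences ≈F-setoid

  no-zero-divisorsF : ∀ {x y} → ¬ (x ≈F embed []) → ¬ (y ≈F embed []) → ¬ ((x *f y) ≈F embed [])
  no-zero-divisorsF {a / D} {b / E} x≉0 y≉0 xy≈0 =
    *ₚ-≉[] (λ a≋0 → x≉0 (≋-trans (*ₚ-identityʳ a) a≋0)) (λ b≋0 → y≉0 (≋-trans (*ₚ-identityʳ b) b≋0)) (≋-trans (≋-sym (*ₚ-identityʳ (a *ₚ b))) xy≈0)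

  embed-cong : ∀ {a b} → a ≋ b → embed a ≈F embed b
  embed-cong = *ₚ-congˡ (const 1#)

  embed-injective : ∀ {a b} → embed a ≈F embed b → a ≋ b
  embed-injective {a} {b} e = ≋-trans (≋-sym (*ₚ-identityʳ a)) (≋-trans e (*ₚ-identityʳ b))

  embed-+ : ∀ a b → embed (a +ₚ b) ≈F (embed a +f embed b)
  embed-+ a b = *ₚ-congˡ (const 1#) (≋-sym (+ₚ-cong (*ₚ-identityʳ a) (*ₚ-identityʳ b)))

module Substitutions {c ℓ} (k : Field c ℓ) where

  open import Data.List using ([]; _∷_)
  open import Data.Nat as ℕ using (zero)
  open import Relation.Binary.PropositionalEquality as ≡ using (_≢_)

  open FieldPolynomials k
  open GeometricSums k
  open RationalFunctions k

  -- Polynomials in Z over A = k[Y] and over K = k(Y).  The ring A[Z] also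
  -- serves as k[u][T], the target of the substitution Φ.
  module AZ = Polynomials (PolyOver.polyRawRing kRaw) _≋_ isCommutativeRingₚ
  module KZ = Polynomials fracRawRing _≈F_ isCommutativeRingF

  module ToK = AZ.Evaluation KZ.polyRing (λ a → KZ.const (embed a))
    (λ a≋b → KZ.const-cong (embed-cong a≋b)) (λ a b → KZ.const-cong (embed-+ a b))
    (λ a b → KZ.≋-sym (KZ.const-*ₚ (embed a) (embed b))) KZ.≋-refl KZ.X

  module ToT = Evaluation AZ.polyRing (λ a → AZ.const (const a))
    (λ a≈b → AZ.const-cong (const-cong a≈b)) (λ a b → AZ.≋-refl)
    (λ a b → AZ.≋-sym (AZ.≋-trans (AZ.const-*ₚ (const a) (const b)) (AZ.const-cong (const-*ₚ a b)))) AZ.≋-refl AZ.X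

  toK : AZ.Poly → KZ.Poly
  toK = ToK.ev

  toT : Poly → AZ.Poly
  toT = ToT.ev

  uT : AZ.Poly
  uT = AZ.const X AZ.*ₚ AZ.X

  module Φ-Hom = AZ.Evaluation AZ.polyRing toT
    ToT.ev-cong ToT.ev-+ ToT.ev-* (ToT.ev-const 1#) uT

  -- Φ F (u, T) = F (u T, T): the substitution Z = u Y, with Y renamed T.
  Φ : AZ.Poly → AZ.Poly
  Φ = Φ-Hom.ev

  Φ-^ : ∀ p n → Φ (p AZ.^ₚ n) AZ.≋ Φ p AZ.^ₚ n
  Φ-^ p n = ≡.subst (Φ (p AZ.^ₚ n) AZ.≋_) (AZ.^-≡-^ₚ (Φ p) n) (Φ-Hom.ev-^ p n)

  toK-^ : ∀ p n → toK (p AZ.^ₚ n) KZ.≋ toK p KZ.^ₚ n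
  toK-^ p n = ≡.subst (toK (p AZ.^ₚ n) KZ.≋_) (KZ.^-≡-^ₚ (toK p) n) (ToK.ev-^ p n)

  Z Y : AZ.Poly
  Z = AZ.X
  Y = AZ.const X

  ι : Carrier → AZ.Poly
  ι a = AZ.const (const a)

  B : ℕ → AZ.Poly
  B m = (Z AZ.+ₚ Y) AZ.^ₚ m AZ.+ₚ AZ.-ₚ (Y AZ.^ₚ m)

  RH : ℕ → ℕ → Carrier → AZ.Poly
  RH n t a = B n AZ.+ₚ AZ.-ₚ (ι a AZ.*ₚ B t)

  Q : ℕ → ℕ → Carrier → Carrier → AZ.Poly
  Q n′ t′ α β = AZ.monomial (const α *ₚ S (suc n′)) n′ AZ.+ₚ AZ.monomial (const β *ₚ S (suc t′)) t′

  Φ-Z : Φ Z AZ.≋ uT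
  Φ-Z = Φ-Hom.ev-X

  Φ-Y : Φ Y AZ.≋ AZ.X
  Φ-Y = AZ.≋-trans (Φ-Hom.ev-const X) ToT.ev-X

  Φ-ι : ∀ a → Φ (ι a) AZ.≋ ι a
  Φ-ι a = AZ.≋-trans (Φ-Hom.ev-const (const a)) (ToT.ev-const a)

  private
    import Relation.Binary.Reasoning.Setoid AZ.≋-setoid as AZ-Reasoning
    open import Algebra.Solver.Ring.NaturalCoefficients.Default (CommutativeRing.commutativeSemiring AZ.polyRing)
    open import Algebra.Properties.Ring (CommutativeRing.ring AZ.polyRing) using (-‿distribˡ-*; -‿distribʳ-*)
    open import Algebra.Properties.CommutativeSemigroup (CommutativeRing.*-commutativeSemigroup AZ.polyRing) using (x∙yz≈y∙xz)

    T = AZ.X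
    W = AZ.const w

    Φ-Z+Y : Φ (Z AZ.+ₚ Y) AZ.≋ W AZ.*ₚ T
    Φ-Z+Y = begin
      Φ (Z AZ.+ₚ Y)                                ≈⟨ AZ.≋-trans (Φ-Hom.ev-+ Z Y) (AZ.+ₚ-cong Φ-Z Φ-Y) ⟩
      uT AZ.+ₚ T                                   ≈⟨ AZ.+ₚ-cong (AZ.≋-refl {uT}) (AZ.*ₚ-identityˡ T) ⟨
      AZ.const X AZ.*ₚ T AZ.+ₚ AZ.const (const 1#) AZ.*ₚ T ≈⟨ AZ.*ₚ-distribʳ T (AZ.const X) (AZ.const (const 1#)) ⟨
      W AZ.*ₚ T                                    ∎
      where open AZ-Reasoning

    Φ-B : ∀ m → Φ (B (suc m)) AZ.≋ uT AZ.*ₚ AZ.monomial (S (suc m)) m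
    Φ-B m = begin
      Φ (B M)                                                          ≈⟨ AZ.≋-trans (Φ-Hom.ev-+ ((Z AZ.+ₚ Y) AZ.^ₚ M) (AZ.-ₚ (Y AZ.^ₚ M))) (AZ.+ₚ-cong (AZ.≋-refl {Φ ((Z AZ.+ₚ Y) AZ.^ₚ M)}) (Φ-Hom.ev-neg (Y AZ.^ₚ M))) ⟩
      Φ ((Z AZ.+ₚ Y) AZ.^ₚ M) AZ.+ₚ AZ.-ₚ Φ (Y AZ.^ₚ M)                 ≈⟨ AZ.+ₚ-cong (AZ.≋-trans (Φ-^ (Z AZ.+ₚ Y) M) (AZ.^ₚ-cong M Φ-Z+Y)) (AZ.-ₚ-cong (AZ.≋-trans (Φ-^ Y M) (AZ.^ₚ-cong M Φ-Y))) ⟩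
      (W AZ.*ₚ T) AZ.^ₚ M AZ.+ₚ AZ.-ₚ (T AZ.^ₚ M)                      ≈⟨ AZ.+ₚ-cong (AZ.≋-trans (AZ.*-^ₚ W T M) (AZ.*ₚ-congˡ (T AZ.^ₚ M) (AZ.const-^ₚ w M))) (AZ.≋-refl {AZ.-ₚ (T AZ.^ₚ M)}) ⟩
      AZ.const (w ^ₚ M) AZ.*ₚ T AZ.^ₚ M AZ.+ₚ AZ.-ₚ (T AZ.^ₚ M)         ≈⟨ AZ.+ₚ-cong (AZ.*ₚ-congˡ (T AZ.^ₚ M) (AZ.const-cong (≋-sym (X*S+1≋w^ M)))) (AZ.≋-refl {AZ.-ₚ (T AZ.^ₚ M)}) ⟩
      (AZ.const (X *ₚ S M) AZ.+ₚ AZ.const (const 1#)) AZ.*ₚ T AZ.^ₚ M AZ.+ₚ AZ.-ₚ (T AZ.^ₚ M) ≈⟨ AZ.+ₚ-cong (AZ.*ₚ-distribʳ (T AZ.^ₚ M) (AZ.const (X *ₚ S M)) (AZ.const (const 1#))) (AZ.≋-refl {AZ.-ₚ (T AZ.^ₚ M)}) ⟩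
      (XST AZ.+ₚ AZ.const (const 1#) AZ.*ₚ T AZ.^ₚ M) AZ.+ₚ AZ.-ₚ (T AZ.^ₚ M)  ≈⟨ AZ.+ₚ-cong (AZ.+ₚ-cong (AZ.≋-refl {XST}) (AZ.*ₚ-identityˡ (T AZ.^ₚ M))) (AZ.≋-refl {AZ.-ₚ (T AZ.^ₚ M)}) ⟩
      (XST AZ.+ₚ T AZ.^ₚ M) AZ.+ₚ AZ.-ₚ (T AZ.^ₚ M)                     ≈⟨ AZ.+ₚ-assoc XST (T AZ.^ₚ M) _ ⟩
      XST AZ.+ₚ (T AZ.^ₚ M AZ.+ₚ AZ.-ₚ (T AZ.^ₚ M))                     ≈⟨ AZ.≋-trans (AZ.+ₚ-cong (AZ.≋-refl {XST}) (AZ.-ₚ-inverseʳ (T AZ.^ₚ M))) (AZ.+ₚ-identityʳ XST) ⟩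
      AZ.const (X *ₚ S M) AZ.*ₚ (T AZ.*ₚ T AZ.^ₚ m)                   ≈⟨ AZ.*ₚ-congˡ (T AZ.*ₚ T AZ.^ₚ m) (AZ.const-*ₚ X (S M)) ⟨
      (AZ.const X AZ.*ₚ AZ.const (S M)) AZ.*ₚ (T AZ.*ₚ T AZ.^ₚ m)     ≈⟨ solve 4 (λ x s t tm → (x :* s) :* (t :* tm) := (x :* t) :* (s :* tm)) AZ.≋-refl (AZ.const X) (AZ.const (S M)) T (T AZ.^ₚ m) ⟩
      uT AZ.*ₚ (AZ.const (S M) AZ.*ₚ T AZ.^ₚ m)                      ≈⟨ AZ.*ₚ-congʳ uT (AZ.monomial≋const*X^ (S M) m) ⟨
      uT AZ.*ₚ AZ.monomial (S M) m                                     ∎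
      where open AZ-Reasoning
            M = suc m
            XST = AZ.const (X *ₚ S M) AZ.*ₚ T AZ.^ₚ M

  Φ-RH : ∀ n′ t′ a → Φ (RH (suc n′) (suc t′) a) AZ.≋ uT AZ.*ₚ Q n′ t′ 1# (- a)
  Φ-RH n′ t′ a = begin
    Φ (RH (suc n′) (suc t′) a)                        ≈⟨ AZ.≋-trans (Φ-Hom.ev-+ (B (suc n′)) (AZ.-ₚ (ι a AZ.*ₚ B (suc t′))))
                                                           (AZ.+ₚ-cong (AZ.≋-refl {Φ (B (suc n′))}) (AZ.≋-trans (Φ-Hom.ev-neg (ι a AZ.*ₚ B (suc t′))) (AZ.-ₚ-cong (Φ-Hom.ev-* (ι a) (B (suc t′)))))) ⟩
    Φ (B (suc n′)) AZ.+ₚ AZ.-ₚ (Φ (ι a) AZ.*ₚ Φ (B (suc t′)))  ≈⟨ AZ.+ₚ-cong (Φ-B n′) (AZ.-ₚ-cong (AZ.*ₚ-cong (Φ-ι a) (Φ-B t′))) ⟩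
    uT AZ.*ₚ Mn AZ.+ₚ AZ.-ₚ (ι a AZ.*ₚ (uT AZ.*ₚ Mt))  ≈⟨ AZ.+ₚ-cong (AZ.≋-refl {uT AZ.*ₚ Mn}) (AZ.-ₚ-cong (x∙yz≈y∙xz (ι a) uT Mt)) ⟩
    uT AZ.*ₚ Mn AZ.+ₚ AZ.-ₚ (uT AZ.*ₚ (ι a AZ.*ₚ Mt))  ≈⟨ AZ.+ₚ-cong (AZ.≋-refl {uT AZ.*ₚ Mn}) (-‿distribʳ-* uT (ι a AZ.*ₚ Mt)) ⟩
    uT AZ.*ₚ Mn AZ.+ₚ uT AZ.*ₚ AZ.-ₚ (ι a AZ.*ₚ Mt)    ≈⟨ AZ.*ₚ-distribˡ uT Mn (AZ.-ₚ (ι a AZ.*ₚ Mt)) ⟨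
    uT AZ.*ₚ (Mn AZ.+ₚ AZ.-ₚ (ι a AZ.*ₚ Mt))          ≈⟨ AZ.*ₚ-congʳ uT (AZ.+ₚ-cong Mn≋ Mt≋) ⟩
    uT AZ.*ₚ Q n′ t′ 1# (- a)                         ∎
    where
    open AZ-Reasoning
    Mn = AZ.monomial (S (suc n′)) n′
    Mt = AZ.monomial (S (suc t′)) t′
    Mn≋ : Mn AZ.≋ AZ.monomial (const 1# *ₚ S (suc n′)) n′
    Mn≋ = AZ.≋-trans (AZ.≋-sym (AZ.*ₚ-identityˡ Mn)) (AZ.const*-monomial (const 1#) (S (suc n′)) n′)
    Mt≋ : AZ.-ₚ (ι a AZ.*ₚ Mt) AZ.≋ AZ.monomial (const (- a) *ₚ S (suc t′)) t′
    Mt≋ = AZ.≋-trans (-‿distribˡ-* (ι a) Mt) (AZ.const*-monomial (const (- a)) (S (suc t′)) t′)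

  module _ {n′ t′ : ℕ} {α β : Carrier} where
    private
      Mn = AZ.monomial (const α *ₚ S (suc n′)) n′
      Mt = AZ.monomial (const β *ₚ S (suc t′)) t′

    coeff-Q-n′ : n′ ≢ t′ → AZ.coeff (Q n′ t′ α β) n′ ≋ const α *ₚ S (suc n′)
    coeff-Q-n′ n′≢t′ = ≋-trans (AZ.coeff-+ Mn Mt n′)
      (≋-trans (+ₚ-cong (AZ.coeff-monomial-≡ _ n′) (AZ.coeff-monomial-≢ _ t′ n′ n′≢t′)) (+ₚ-identityʳ _))

    coeff-Q-t′ : t′ ≢ n′ → AZ.coeff (Q n′ t′ α β) t′ ≋ const β *ₚ S (suc t′)
    coeff-Q-t′ t′≢n′ = ≋-trans (AZ.coeff-+ Mn Mt t′) (+ₚ-cong (AZ.coeff-monomial-≢ _ n′ t′ t′≢n′) (AZ.coeff-monomial-≡ _ t′))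

    coeff-Q-other : ∀ i → i ≢ n′ → i ≢ t′ → AZ.coeff (Q n′ t′ α β) i ≋ []
    coeff-Q-other i i≢n′ i≢t′ = ≋-trans (AZ.coeff-+ Mn Mt i)
      (≋-trans (+ₚ-cong (AZ.coeff-monomial-≢ _ n′ i i≢n′) (AZ.coeff-monomial-≢ _ t′ i i≢t′)) (+ₚ-identityʳ []))

  ConstantInU : AZ.Poly → Set ℓ
  ConstantInU G = ∀ i j → coeff (AZ.coeff G i) (suc j) ≈ 0#

  coeff-toT : ∀ d i → AZ.coeff (toT d) i ≋ const (coeff d i)
  coeff-toT []      i       = mk≋ λ where
    zero    → refl
    (suc j) → refl
  coeff-toT (a ∷ d) zero    = ≋-trans (AZ.coeff-+ (ι a) (AZ.X AZ.*ₚ toT d) zero) (≋-trans (+ₚ-cong (≋-refl {const a}) (AZ.at (AZ.X*ₚ≋0∷ (toT d)) zero)) (+ₚ-identityʳ _))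
  coeff-toT (a ∷ d) (suc i) = ≋-trans (AZ.coeff-+ (ι a) (AZ.X AZ.*ₚ toT d) (suc i)) (≋-trans (AZ.at (AZ.X*ₚ≋0∷ (toT d)) (suc i)) (coeff-toT d i))

  private
    coeff-uT*-zero : ∀ H → AZ.coeff (uT AZ.*ₚ H) zero ≋ []
    coeff-uT*-zero H = ≋-trans (AZ.at (AZ.*ₚ-assoc (AZ.const X) AZ.X H) zero)
      (≋-trans (AZ.coeff-const* X (AZ.X AZ.*ₚ H) zero) (≋-trans (*ₚ-congʳ X (AZ.at (AZ.X*ₚ≋0∷ H) zero)) (*ₚ-zeroʳ X)))

    coeff-uT*-suc : ∀ H i → AZ.coeff (uT AZ.*ₚ H) (suc i) ≋ X *ₚ AZ.coeff H i
    coeff-uT*-suc H i = ≋-trans (AZ.at (AZ.*ₚ-assoc (AZ.const X) AZ.X H) (suc i))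
      (≋-trans (AZ.coeff-const* X (AZ.X AZ.*ₚ H) (suc i)) (*ₚ-congʳ X (AZ.at (AZ.X*ₚ≋0∷ H) (suc i))))

    coeff-Φ-∷ : ∀ a F i → AZ.coeff (Φ (a ∷ F)) i ≋ const (coeff a i) +ₚ AZ.coeff (uT AZ.*ₚ Φ F) i
    coeff-Φ-∷ a F i = ≋-trans (AZ.coeff-+ (toT a) (uT AZ.*ₚ Φ F) i) (+ₚ-cong (coeff-toT a i) (≋-refl {AZ.coeff (uT AZ.*ₚ Φ F) i}))

    constantTerm-Φ-∷ : ∀ a F i → coeff (AZ.coeff (Φ (a ∷ F)) i) zero ≈ coeff a i
    constantTerm-Φ-∷ a F i = trans (at (coeff-Φ-∷ a F i) zero) (trans (coeff-+ (const (coeff a i)) (AZ.coeff (uT AZ.*ₚ Φ F) i) zero) (trans (+-cong refl (vanishes i)) (+-identityʳ _)))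
      where
      vanishes : ∀ i → coeff (AZ.coeff (uT AZ.*ₚ Φ F) i) zero ≈ 0#
      vanishes zero    = at (coeff-uT*-zero (Φ F)) zero
      vanishes (suc i) = trans (at (coeff-uT*-suc (Φ F) i) zero) (at (X*ₚ≋0∷ (AZ.coeff (Φ F) i)) zero)

    shift-Φ-∷ : ∀ a F i j → coeff (AZ.coeff (Φ (a ∷ F)) (suc i)) (suc j) ≈ coeff (AZ.coeff (Φ F) i) j
    shift-Φ-∷ a F i j = trans (at (coeff-Φ-∷ a F (suc i)) (suc j))
      (trans (coeff-+ (const (coeff a (suc i))) (AZ.coeff (uT AZ.*ₚ Φ F) (suc i)) (suc j)) (trans (+-identityˡ _) (trans (at (coeff-uT*-suc (Φ F) i) (suc j)) (at (X*ₚ≋0∷ (AZ.coeff (Φ F) i)) (suc j)))))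

  Φ-≋[] : ∀ F → Φ F AZ.≋ [] → F AZ.≋ []
  Φ-≋[] []      _      = AZ.≋-refl
  Φ-≋[] (a ∷ F) ΦF≋0 = AZ.mk≋ λ where
      zero    → mk≋ λ i → trans (sym (constantTerm-Φ-∷ a F i)) (at (AZ.at ΦF≋0 i) zero)
      (suc i) → AZ.at (Φ-≋[] F (AZ.mk≋ λ i → mk≋ λ j → trans (sym (shift-Φ-∷ a F i j)) (at (AZ.at ΦF≋0 (suc i)) (suc j)))) i

  constantInU⇒≋const : ∀ F → ConstantInU (Φ F) → F AZ.≋ AZ.const (AZ.coeff F zero)
  constantInU⇒≋const []      _  = AZ.mk≋ λ where
    zero    → ≋-refl
    (suc i) → ≋-refl
  constantInU⇒≋const (a ∷ F) cu = AZ.mk≋ λ where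
      zero    → ≋-refl
      (suc i) → AZ.at (Φ-≋[] F (AZ.mk≋ λ i → mk≋ λ j → trans (sym (shift-Φ-∷ a F i j)) (cu (suc i) j))) i

  coeff-toK : ∀ F i → KZ.coeff (toK F) i ≈F embed (AZ.coeff F i)
  coeff-toK []      i       = ≈F-refl {embed []}
  coeff-toK (a ∷ F) zero    = begin
    KZ.coeff (toK (a ∷ F)) zero                        ≈⟨ KZ.coeff-+ (KZ.const (embed a)) (KZ.X KZ.*ₚ toK F) zero ⟩
    embed a +f KZ.coeff (KZ.X KZ.*ₚ toK F) zero        ≈⟨ KZ.+-cong {embed a} {embed a} {KZ.coeff (KZ.X KZ.*ₚ toK F) zero} {embed []} (≈F-refl {embed a}) (KZ.at (KZ.X*ₚ≋0∷ (toK F)) zero) ⟩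
    embed a +f embed []                                ≈⟨ KZ.+-identityʳ (embed a) ⟩
    embed a                                            ∎
    where open import Relation.Binary.Reasoning.Setoid KZ.setoid
  coeff-toK (a ∷ F) (suc i) = begin
    KZ.coeff (toK (a ∷ F)) (suc i)                     ≈⟨ KZ.coeff-+ (KZ.const (embed a)) (KZ.X KZ.*ₚ toK F) (suc i) ⟩
    embed [] +f KZ.coeff (KZ.X KZ.*ₚ toK F) (suc i)    ≈⟨ KZ.+-identityˡ (KZ.coeff (KZ.X KZ.*ₚ toK F) (suc i)) ⟩
    KZ.coeff (KZ.X KZ.*ₚ toK F) (suc i)                ≈⟨ KZ.at (KZ.X*ₚ≋0∷ (toK F)) (suc i) ⟩
    KZ.coeff (toK F) i                                 ≈⟨ coeff-toK F i ⟩
    embed (AZ.coeff F i)                               ∎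
    where open import Relation.Binary.Reasoning.Setoid KZ.setoid

  toK-injective : ∀ {F G} → toK F KZ.≋ toK G → F AZ.≋ G
  toK-injective {F} {G} e = AZ.mk≋ λ i → embed-injective (begin
    embed (AZ.coeff F i)   ≈⟨ coeff-toK F i ⟨
    KZ.coeff (toK F) i     ≈⟨ KZ.at e i ⟩
    KZ.coeff (toK G) i     ≈⟨ coeff-toK G i ⟩
    embed (AZ.coeff G i)   ∎)
    where open import Relation.Binary.Reasoning.Setoid KZ.setoid

  toK-B : ∀ m → toK (B m) KZ.≋ (KZ.X KZ.+ₚ KZ.const (embed X)) KZ.^ₚ m KZ.+ₚ KZ.-ₚ (KZ.const (embed X) KZ.^ₚ m)
  toK-B m = KZ.≋-trans (ToK.ev-+ ((Z AZ.+ₚ Y) AZ.^ₚ m) (AZ.-ₚ (Y AZ.^ₚ m)))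
    (KZ.+ₚ-cong (KZ.≋-trans (toK-^ (Z AZ.+ₚ Y) m) (KZ.^ₚ-cong m (KZ.≋-trans (ToK.ev-+ Z Y) (KZ.+ₚ-cong ToK.ev-X (ToK.ev-const X)))))
                (KZ.≋-trans (ToK.ev-neg (Y AZ.^ₚ m)) (KZ.-ₚ-cong (KZ.≋-trans (toK-^ Y m) (KZ.^ₚ-cong m (ToK.ev-const X))))))

  toK-RH : ∀ n t a → toK (RH n t a) KZ.≋
    (((KZ.X KZ.+ₚ KZ.const (embed X)) KZ.^ₚ n KZ.+ₚ KZ.-ₚ (KZ.const (embed X) KZ.^ₚ n)) KZ.+ₚ
     KZ.-ₚ (KZ.const (embed (const a)) KZ.*ₚ ((KZ.X KZ.+ₚ KZ.const (embed X)) KZ.^ₚ t KZ.+ₚ KZ.-ₚ (KZ.const (embed X) KZ.^ₚ t))))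
  toK-RH n t a = KZ.≋-trans (ToK.ev-+ (B n) (AZ.-ₚ (ι a AZ.*ₚ B t)))
    (KZ.+ₚ-cong (toK-B n) (KZ.≋-trans (ToK.ev-neg (ι a AZ.*ₚ B t)) (KZ.-ₚ-cong (KZ.≋-trans (ToK.ev-* (ι a) (B t)) (KZ.*ₚ-cong (ToK.ev-const (const a)) (toK-B t))))))

module GaussReduction {c ℓ} (k : Field c ℓ) where

  open import Data.List using ([]; _∷_)
  open import Data.Nat as ℕ using (zero; z≤n)
  open import Data.Nat.Induction using (<-rec)
  import Data.Nat.Properties as ℕ
  open import Data.Product using (∃; ∃₂; _×_)
  open import Level using (_⊔_)
  import Relation.Binary.PropositionalEquality as ≡
  open import Relation.Nullary using (yes; no)
  open import Relation.Nullary.Decidable using (¬¬-excluded-middle)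
  open import Relation.Nullary.Negation using (DoubleNegation; contradiction)

  open FieldPolynomials k
  open RationalFunctions k
  open Substitutions k

  private
    module AZI = PolynomialIdeals (PolyOver.polyRawRing kRaw) _≋_ isCommutativeRingₚ
    module AZP = PolynomialPrimes (PolyOver.polyRawRing kRaw) _≋_ isCommutativeRingₚ
    module AZD = PolynomialDegrees (PolyOver.polyRawRing kRaw) _≋_ isCommutativeRingₚ ≋-stable
    module AZN = AZD.NoZeroDivisors *ₚ-≉[]
    open import Algebra.Solver.Ring.NaturalCoefficients.Default (CommutativeRing.commutativeSemiring AZ.polyRing)
    import Algebra.Solver.Ring.NaturalCoefficients.Default (CommutativeRing.commutativeSemiring KZ.polyRing) as KZ-Solver
    open import Algebra.Properties.CommutativeSemigroup (CommutativeRing.*-commutativeSemigroup polyRing) using (xy∙z≈zy∙x)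

  denominator : KZ.Poly → Poly
  denominator []      = const 1#
  denominator (x ∷ f) = prodD (den x) *ₚ denominator f

  numerator : KZ.Poly → AZ.Poly
  numerator []      = []
  numerator (x ∷ f) = (num x *ₚ denominator f) ∷ (AZ.const (prodD (den x)) AZ.*ₚ numerator f)

  denominator-≉[] : ∀ f → ¬ (denominator f ≋ [])
  denominator-≉[] []      = 1≉0ₚ
  denominator-≉[] (x ∷ f) = *ₚ-≉[] (prodD-≉[] (den x)) (denominator-≉[] f)

  toK-numerator : ∀ f → toK (numerator f) KZ.≋ KZ.const (embed (denominator f)) KZ.*ₚ f
  toK-numerator []            = KZ.≋-sym (KZ.*ₚ-zeroʳ (KZ.const (embed (const 1#))))
  toK-numerator ((n / D) ∷ f) = begin
    toK (numerator ((n / D) ∷ f))                                            ≈⟨ KZ.+ₚ-cong (KZ.≋-refl {KZ.const (embed (n *ₚ dF))}) (KZ.*ₚ-congʳ KZ.X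
                                                                                  (KZ.≋-trans (ToK.ev-* (AZ.const dD) (numerator f)) (KZ.*ₚ-cong (ToK.ev-const dD) (toK-numerator f)))) ⟩
    KZ.const (embed (n *ₚ dF)) KZ.+ₚ KZ.X KZ.*ₚ (cD KZ.*ₚ (cF KZ.*ₚ f))     ≈⟨ KZ.+ₚ-cong (KZ.const-cong {embed (n *ₚ dF)} {embed (dD *ₚ dF) *f (n / D)} lead≈) tail≋ ⟩
    KZ.const (embed (dD *ₚ dF) *f (n / D)) KZ.+ₚ cDF KZ.*ₚ (KZ.X KZ.*ₚ f)   ≈⟨ KZ.+ₚ-cong (KZ.const-*ₚ (embed (dD *ₚ dF)) (n / D)) (KZ.≋-refl {cDF KZ.*ₚ (KZ.X KZ.*ₚ f)}) ⟨
    cDF KZ.*ₚ KZ.const (n / D) KZ.+ₚ cDF KZ.*ₚ (KZ.X KZ.*ₚ f)               ≈⟨ KZ.*ₚ-distribˡ cDF (KZ.const (n / D)) (KZ.X KZ.*ₚ f) ⟨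
    cDF KZ.*ₚ (KZ.const (n / D) KZ.+ₚ KZ.X KZ.*ₚ f)                         ≈⟨ KZ.*ₚ-congʳ cDF (KZ.∷≋const+X* (n / D) f) ⟨
    cDF KZ.*ₚ ((n / D) ∷ f)                                                  ∎
    where
    open import Relation.Binary.Reasoning.Setoid KZ.≋-setoid
    dD = prodD D
    dF = denominator f
    cD = KZ.const (embed dD)
    cF = KZ.const (embed dF)
    cDF = KZ.const (embed (dD *ₚ dF))
    lead≈ : embed (n *ₚ dF) ≈F (embed (dD *ₚ dF) *f (n / D))
    lead≈ = ≋-trans (xy∙z≈zy∙x n dF dD) (≋-sym (*ₚ-identityʳ _))
    tail≋ : KZ.X KZ.*ₚ (cD KZ.*ₚ (cF KZ.*ₚ f)) KZ.≋ cDF KZ.*ₚ (KZ.X KZ.*ₚ f)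
    tail≋ = KZ.≋-trans (KZ-Solver.solve 4 (λ x a b f → x KZ-Solver.:* (a KZ-Solver.:* (b KZ-Solver.:* f)) KZ-Solver.:= (a KZ-Solver.:* b) KZ-Solver.:* (x KZ-Solver.:* f)) KZ.≋-refl KZ.X cD cF f)
                       (KZ.*ₚ-congˡ (KZ.X KZ.*ₚ f) (KZ.const-*ₚ (embed dD) (embed dF)))

  Proportional : AZ.Poly → KZ.Poly → Set (c ⊔ ℓ)
  Proportional F f = ∃₂ λ α β → ¬ (α ≋ []) × ¬ (β ≋ []) × KZ.const (embed α) KZ.*ₚ toK F KZ.≋ KZ.const (embed β) KZ.*ₚ f

  numerator-proportional : ∀ f → Proportional (numerator f) f
  numerator-proportional f = const 1# , denominator f , 1≉0ₚ , denominator-≉[] f , KZ.≋-trans (KZ.*ₚ-identityˡ _) (toK-numerator f)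

  proportional-÷ : ∀ {F F′ f π} → ¬ (π ≋ []) → F AZ.≋ AZ.const π AZ.*ₚ F′ → Proportional F f → Proportional F′ f
  proportional-÷ {F} {F′} {f} {π} π≉0 F≋πF′ (α , β , α≉0 , β≉0 , αF≋βf) = α *ₚ π , β , *ₚ-≉[] α≉0 π≉0 , β≉0 , (begin
    KZ.const (embed (α *ₚ π)) KZ.*ₚ toK F′                        ≈⟨ KZ.*ₚ-congˡ (toK F′) (KZ.const-*ₚ (embed α) (embed π)) ⟨
    (KZ.const (embed α) KZ.*ₚ KZ.const (embed π)) KZ.*ₚ toK F′    ≈⟨ KZ.*ₚ-assoc (KZ.const (embed α)) (KZ.const (embed π)) (toK F′) ⟩
    KZ.const (embed α) KZ.*ₚ (KZ.const (embed π) KZ.*ₚ toK F′)    ≈⟨ KZ.*ₚ-congʳ (KZ.const (embed α)) toK-F≋ ⟨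
    KZ.const (embed α) KZ.*ₚ toK F                                ≈⟨ αF≋βf ⟩
    KZ.const (embed β) KZ.*ₚ f                                    ∎)
    where
    open import Relation.Binary.Reasoning.Setoid KZ.≋-setoid
    toK-F≋ : toK F KZ.≋ KZ.const (embed π) KZ.*ₚ toK F′
    toK-F≋ = KZ.≋-trans (ToK.ev-cong F≋πF′) (KZ.≋-trans (ToK.ev-* (AZ.const π) F′) (KZ.*ₚ-congˡ (toK F′) (ToK.ev-const π)))

  -- Gauss's lemma: a prime π dividing d divides every coefficient of
  -- Z F G, hence every coefficient of F or of G, which can then be divided
  -- by π; repeating this until d is a constant clears all denominators.
  module Reduction (R : AZ.Poly) (f g : KZ.Poly) where

    Equation : Poly → AZ.Poly → AZ.Poly → Set ℓ
    Equation d F G = Z AZ.*ₚ (F AZ.*ₚ G) AZ.≋ AZ.const d AZ.*ₚ R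

    Reduced : Set (c ⊔ ℓ)
    Reduced = ∃ λ a → ¬ (a ≈ 0#) × ∃₂ λ F G → Equation (const a) F G × Proportional F f × Proportional G g

    private
      Equation-comm : ∀ {d F G} → Equation d F G → Equation d G F
      Equation-comm {F = F} {G} eq = AZ.≋-trans (AZ.*ₚ-congʳ Z (AZ.*ₚ-comm G F)) eq

      divideˡ : ∀ {d π d′ F F′ G} → d ≋ π *ₚ d′ → ¬ (π ≋ []) → Equation d F G → F AZ.≋ AZ.const π AZ.*ₚ F′ → Equation d′ F′ G
      divideˡ {d} {π} {d′} {F} {F′} {G} d≋πd′ π≉0 eq F≋πF′ = AZN.*ₚ-cancelˡ {AZ.const π} (λ π≋0 → π≉0 (AZ.at π≋0 zero)) (begin
        AZ.const π AZ.*ₚ (Z AZ.*ₚ (F′ AZ.*ₚ G))      ≈⟨ solve 4 (λ p z f g → p :* (z :* (f :* g)) := z :* ((p :* f) :* g)) AZ.≋-refl (AZ.const π) Z F′ G ⟩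
        Z AZ.*ₚ ((AZ.const π AZ.*ₚ F′) AZ.*ₚ G)      ≈⟨ AZ.*ₚ-congʳ Z (AZ.*ₚ-congˡ G F≋πF′) ⟨
        Z AZ.*ₚ (F AZ.*ₚ G)                          ≈⟨ eq ⟩
        AZ.const d AZ.*ₚ R                           ≈⟨ AZ.*ₚ-congˡ R (AZ.≋-trans (AZ.const-cong d≋πd′) (AZ.≋-sym (AZ.const-*ₚ π d′))) ⟩
        (AZ.const π AZ.*ₚ AZ.const d′) AZ.*ₚ R       ≈⟨ AZ.*ₚ-assoc (AZ.const π) (AZ.const d′) R ⟩
        AZ.const π AZ.*ₚ (AZ.const d′ AZ.*ₚ R)       ∎)
        where open import Relation.Binary.Reasoning.Setoid AZ.≋-setoid

      step : ∀ {d π d′ F G} → ¬ (d ≋ []) → IsPrime π → d ≋ π *ₚ d′ → Equation d F G → Proportional F f → Proportional G g →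
             DoubleNegation (∃₂ λ F′ G′ → Equation d′ F′ G′ × Proportional F′ f × Proportional G′ g)
      step {d} {π} {d′} {F} {G} d≉0 π-prime d≋πd′ eq F∼f G∼g k = ¬¬-excluded-middle λ where
          (yes π∣F) → AZP.∣-coeffs⇒factor π F π∣F λ (F′ , F≋πF′) →
            k (F′ , G , divideˡ {F = F} {F′} {G} d≋πd′ π≉0 eq F≋πF′ , proportional-÷ π≉0 F≋πF′ F∼f , G∼g)
          (no π∤F)  → AZP.∣-coeffs⇒factor π G (π∣G π∤F) λ (G′ , G≋πG′) →
            k (F , G′ , Equation-comm {d′} {G′} {F} (divideˡ {F = G} {G′} {F} d≋πd′ π≉0 (Equation-comm {d} {F} {G} eq) G≋πG′) , F∼f , proportional-÷ π≉0 G≋πG′ G∼g)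
        where
        open IsIdeal (∣-isIdeal π)
        π≉0 : ¬ (π ≋ [])
        π≉0 π≋0 = d≉0 (≋-trans d≋πd′ (*ₚ-zeroˡ-≋ π d′ π≋0))
        π∣ZFG : ∀ s → π ∣ AZ.coeff (Z AZ.*ₚ (F AZ.*ₚ G)) s
        π∣ZFG s = resp (≋-sym (AZ.at eq s)) (≈*⇒∣ (≋-trans (AZ.coeff-const* d R s) (≋-trans (*ₚ-congˡ (AZ.coeff R s) d≋πd′) (*ₚ-assoc π d′ (AZ.coeff R s)))))
        π∤Z : ¬ (∀ i → π ∣ AZ.coeff Z i)
        π∤Z π∣Z = IsPrime.nonunit π-prime (π∣Z 1)
        π∣FG : ∀ j → π ∣ AZ.coeff (F AZ.*ₚ G) j
        π∣FG j = ∣-stable λ π∤ → AZP.gauss π-prime Z (F AZ.*ₚ G) π∤Z (λ all → π∤ (all j)) π∣ZFG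
        π∣G : ¬ (∀ i → π ∣ AZ.coeff F i) → ∀ j → π ∣ AZ.coeff G j
        π∣G π∤F j = ∣-stable λ π∤ → AZP.gauss π-prime F G π∤F (λ all → π∤ (all j)) π∣FG

    reduce : ∀ e {d F G} → HasDegree d e → Equation d F G → Proportional F f → Proportional G g → DoubleNegation Reduced
    reduce = <-rec (λ e → ∀ {d F G} → HasDegree d e → Equation d F G → Proportional F f → Proportional G g → DoubleNegation Reduced) go
      where
      go : ∀ e → (∀ {e′} → e′ < e → ∀ {d F G} → HasDegree d e′ → Equation d F G → Proportional F f → Proportional G g → DoubleNegation Reduced) →
           ∀ {d F G} → HasDegree d e → Equation d F G → Proportional F f → Proportional G g → DoubleNegation Reduced
      go zero    _   {d} {F} {G} deg-d eq F∼f G∼g k =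
        k (coeff d 0 , HasDegree.leading≉0 deg-d , F , G , AZ.≋-trans eq (AZ.*ₚ-congˡ R (AZ.const-cong (hasDegree0⇒≋const deg-d))) , F∼f , G∼g)
      go (suc e) rec {d} {F} {G} deg-d eq F∼f G∼g k =
        ¬¬-primeFactor deg-d (s≤s z≤n) λ (π , π-prime , π∣d) →
        ¬¬quotient π∣d λ (d′ , d≋πd′) →
        ¬¬-hasDegree π (λ π≋0 → d≉0 (≋-trans d≋πd′ (*ₚ-zeroˡ-≋ π d′ π≋0))) λ (eπ , deg-π) →
        factor-hasDegree d≋πd′ deg-π deg-d λ (e′ , deg-d′ , eπ+e′≡1+e) →
        step {F = F} {G} d≉0 π-prime d≋πd′ eq F∼f G∼g λ (F′ , G′ , eq′ , F′∼f , G′∼g) →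
        rec (e′<1+e π-prime deg-π eπ+e′≡1+e) {F = F′} {G′} deg-d′ eq′ F′∼f G′∼g k
        where
        d≉0 : ¬ (d ≋ [])
        d≉0 = hasDegree⇒≉[] deg-d
        e′<1+e : ∀ {π eπ e′} → IsPrime π → HasDegree π eπ → eπ ℕ.+ e′ ≡ suc e → e′ < suc e
        e′<1+e {eπ = zero}   π-prime deg-π _    = contradiction (degree0-∣-1 deg-π) (IsPrime.nonunit π-prime)
        e′<1+e {eπ = suc eπ} _       _     sum≡ = s≤s (ℕ.m+n≤o⇒n≤o eπ (ℕ.≤-reflexive (ℕ.suc-injective sum≡)))

module TwoTermFactorizations {c ℓ} (k : Field c ℓ) {n′ t′ : ℕ} (1≤t′ : 1 ≤ t′) (t′<n′ : t′ < n′)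
  (coprime : gcd (suc n′) (suc t′) ≡ 1) where

  open import Data.List using ([])
  open import Data.Nat as ℕ using (zero; _≟_)
  open import Data.Nat.GCD using (gcd-comm)
  import Data.Nat.Properties as ℕ
  open import Data.Sum using (_⊎_; inj₁; inj₂)
  open import Function using (_∘_)
  open import Relation.Binary.PropositionalEquality as ≡ using (_≢_)
  open import Relation.Nullary using (yes; no)
  open import Relation.Nullary.Decidable using (¬¬-excluded-middle)
  open import Relation.Nullary.Negation using (DoubleNegation)

  open FieldPolynomials k
  open GeometricSums k
  open Substitutions k
  open import Algebra.Properties.Semiring.Mult semiring using (_×_)

  private
    module AZD = PolynomialDegrees (PolyOver.polyRawRing kRaw) _≋_ isCommutativeRingₚ ≋-stable
    module AZP = PolynomialPrimes (PolyOver.polyRawRing kRaw) _≋_ isCommutativeRingₚ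
    module AZE = TwoTermEisenstein (PolyOver.polyRawRing kRaw) _≋_ isCommutativeRingₚ ≋-stable *ₚ-≉[]

    n′≢t′ : n′ ≢ t′
    n′≢t′ n′≡t′ = ℕ.<-irrefl (≡.sym n′≡t′) t′<n′

    const*S≉[] : ∀ {α} m → ¬ (α ≈ 0#) → ¬ (const α *ₚ S (suc m) ≋ [])
    const*S≉[] {α} m α≉0 = *ₚ-≉[] {const α} (λ α≋0 → α≉0 (at α≋0 zero)) (hasDegree⇒≉[] (S-hasDegree m))

  module _ {α β : Carrier} (α≉0 : ¬ (α ≈ 0#)) (β≉0 : ¬ (β ≈ 0#)) where

    Q-hasDegree : AZD.HasDegree (Q n′ t′ α β) n′
    Q-hasDegree = record
      { leading≉0 = λ Qn≋0 → const*S≉[] n′ α≉0 (≋-trans (≋-sym (coeff-Q-n′ n′≢t′)) Qn≋0)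
      ; above≈0   = λ i n′<i → coeff-Q-other i (λ i≡n′ → ℕ.<-irrefl (≡.sym i≡n′) n′<i) (λ i≡t′ → ℕ.<-asym t′<n′ (≡.subst (n′ <_) i≡t′ n′<i))
      }

    Q-hasOrder : AZD.HasOrder (Q n′ t′ α β) t′
    Q-hasOrder = record
      { trailing≉0 = λ Qt≋0 → const*S≉[] t′ β≉0 (≋-trans (≋-sym (coeff-Q-t′ (n′≢t′ ∘ ≡.sym))) Qt≋0)
      ; below≈0    = λ i i<t′ → coeff-Q-other i (λ i≡n′ → ℕ.<-asym t′<n′ (≡.subst (_< t′) i≡n′ i<t′)) (λ i≡t′ → ℕ.<-irrefl i≡t′ i<t′)
      }

    private
      coeff-Q-n′-∣ : ∀ {γ} → γ ∣ AZ.coeff (Q n′ t′ α β) n′ → γ ∣ S (suc n′)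
      coeff-Q-n′-∣ {γ} γ∣ = ∣-const*-cancel α≉0 (∣-respʳ (coeff-Q-n′ n′≢t′) γ∣)

      coeff-Q-t′-∣ : ∀ {γ} → γ ∣ AZ.coeff (Q n′ t′ α β) t′ → γ ∣ S (suc t′)
      coeff-Q-t′-∣ {γ} γ∣ = ∣-const*-cancel β≉0 (∣-respʳ (coeff-Q-t′ (n′≢t′ ∘ ≡.sym)) γ∣)

      ∣-Q-except-n′ : ∀ {π} → π ∣ S (suc t′) → ∀ s → s ≢ n′ → π ∣ AZ.coeff (Q n′ t′ α β) s
      ∣-Q-except-n′ {π} π∣St s s≢n′ with s ≟ t′
      ... | yes ≡.refl = ∣-respʳ (≋-sym (coeff-Q-t′ (n′≢t′ ∘ ≡.sym))) (IsIdeal.*-closed (∣-isIdeal π) (const β) π∣St)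
      ... | no  s≢t′   = IsIdeal.≈0⇒∈ (∣-isIdeal π) (coeff-Q-other s s≢n′ s≢t′)

      ∣-Q-except-t′ : ∀ {π} → π ∣ S (suc n′) → ∀ s → s ≢ t′ → π ∣ AZ.coeff (Q n′ t′ α β) s
      ∣-Q-except-t′ {π} π∣Sn s s≢t′ with s ≟ n′
      ... | yes ≡.refl = ∣-respʳ (≋-sym (coeff-Q-n′ n′≢t′)) (IsIdeal.*-closed (∣-isIdeal π) (const α) π∣Sn)
      ... | no  s≢n′   = IsIdeal.≈0⇒∈ (∣-isIdeal π) (coeff-Q-other s s≢n′ s≢t′)

      monomial⇒constantInU : ∀ {G H} → G AZ.*ₚ H AZ.≋ Q n′ t′ α β → AZE.Monomial G → ConstantInU G
      monomial⇒constantInU {G} {H} GH≋Q (g , mono) i j with i ≟ g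
      ... | yes ≡.refl = ∣-1⇒constant (∣-S-gcd (suc n′) (suc t′) coprime (coeff-Q-n′-∣ (γ∣ n′)) (coeff-Q-t′-∣ (γ∣ t′))) j
        where γ∣ = AZP.monomial-∣-coeff {G} {H} GH≋Q mono
      ... | no  i≢g    = at (mono i i≢g) (suc j)

    -- When the characteristic divides t, S t need not be squarefree, but
    -- then it does not divide n and a prime factor of S n serves instead.
    Q-factor-constantInU : ∀ {G H} → G AZ.*ₚ H AZ.≋ Q n′ t′ α β → DoubleNegation (ConstantInU G ⊎ ConstantInU H)
    Q-factor-constantInU {G} {H} GH≋Q k = ¬¬-excluded-middle {A = suc t′ × 1# ≈ 0#} λ where
        (no  t≉0) → ¬¬-primeFactor (S-hasDegree t′) 1≤t′ λ (π , π-prime , π∣St) →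
          AZE.eisenstein-order π-prime {G} {H} GH≋Q Q-hasDegree Q-hasOrder
            (λ π∣Qn → IsPrime.nonunit π-prime (∣-S-gcd (suc n′) (suc t′) coprime (coeff-Q-n′-∣ π∣Qn) π∣St))
            (∣-Q-except-n′ π∣St)
            (λ π²∣Qt → S-squarefree (suc t′) π-prime t≉0 π∣St (coeff-Q-t′-∣ π²∣Qt))
            (k ∘ conclude)
        (yes t≈0) → ¬¬-primeFactor (S-hasDegree n′) (ℕ.≤-trans 1≤t′ (ℕ.<⇒≤ t′<n′)) λ (π , π-prime , π∣Sn) →
          AZE.eisenstein-degree π-prime {G} {H} GH≋Q Q-hasDegree Q-hasOrder
            (λ π∣Qt → IsPrime.nonunit π-prime (∣-S-gcd (suc n′) (suc t′) coprime π∣Sn (coeff-Q-t′-∣ π∣Qt)))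
            (∣-Q-except-t′ π∣Sn)
            (λ π²∣Qn → S-squarefree (suc n′) π-prime (characteristic-coprime (suc t′) (suc n′) (≡.trans (gcd-comm (suc t′) (suc n′)) coprime) t≈0) π∣Sn (coeff-Q-n′-∣ π²∣Qn))
            (k ∘ conclude)
      where
      conclude : AZE.Monomial G ⊎ AZE.Monomial H → ConstantInU G ⊎ ConstantInU H
      conclude (inj₁ mono-G) = inj₁ (monomial⇒constantInU {G} {H} GH≋Q mono-G)
      conclude (inj₂ mono-H) = inj₂ (monomial⇒constantInU {H} {G} (AZ.≋-trans (AZ.*ₚ-comm H G) GH≋Q) mono-H)

  ι*Q : ∀ c {α β} → ι c AZ.*ₚ Q n′ t′ α β AZ.≋ Q n′ t′ (c * α) (c * β)
  ι*Q c {α} {β} = AZ.≋-trans (AZ.*ₚ-distribˡ (ι c) (AZ.monomial (const α *ₚ S (suc n′)) n′) (AZ.monomial (const β *ₚ S (suc t′)) t′))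
    (AZ.+ₚ-cong (AZ.≋-trans (AZ.const*-monomial (const c) (const α *ₚ S (suc n′)) n′) (AZ.monomial-cong n′ (≋-trans (≋-sym (*ₚ-assoc (const c) (const α) (S (suc n′)))) (*ₚ-congˡ (S (suc n′)) (const-*ₚ c α)))))
                (AZ.≋-trans (AZ.const*-monomial (const c) (const β *ₚ S (suc t′)) t′) (AZ.monomial-cong t′ (≋-trans (≋-sym (*ₚ-assoc (const c) (const β) (S (suc t′)))) (*ₚ-congˡ (S (suc t′)) (const-*ₚ c β))))))

module Irreducibility {c ℓ} (k : Field c ℓ) {n′ t′ : ℕ} (1≤t′ : 1 ≤ t′) (t′<n′ : t′ < n′)
  (coprime : gcd (suc n′) (suc t′) ≡ 1) {a} (a≉0 : ¬ FieldPolynomials._≈_ k a (FieldPolynomials.0# k)) where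

  open import Data.Empty using (⊥)
  open import Data.List using ([]; _∷_)
  open import Data.Nat as ℕ using (zero)
  import Data.Nat.Properties as ℕ
  open import Data.Product using (∃)
  open import Data.Sum using (inj₁; inj₂)
  open import Level using (_⊔_)
  import Relation.Binary.PropositionalEquality as ≡
  open import Relation.Nullary using (yes; no)
  open import Relation.Nullary.Decidable using (¬¬-excluded-middle)
  open import Relation.Nullary.Negation using (DoubleNegation)

  open FieldPolynomials k

  open GeometricSums k
  open RationalFunctions k
  open Substitutions k
  open GaussReduction k
  open TwoTermFactorizations k 1≤t′ t′<n′ coprime

  private
    module AZD = PolynomialDegrees (PolyOver.polyRawRing kRaw) _≋_ isCommutativeRingₚ ≋-stable
    module AZN = AZD.NoZeroDivisors *ₚ-≉[]
    module KZD = PolynomialDegrees fracRawRing _≈F_ isCommutativeRingF (λ {x} {y} → ≈F-stable {x} {y})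
    module KZN = KZD.NoZeroDivisors (λ {x} {y} → no-zero-divisorsF {x} {y})
    open import Algebra.Properties.Ring (CommutativeRing.ring (FieldPolynomials.coefficientRing k)) using (-‿involutive; -0#≈0#)

    -a≉0 : ¬ (- a ≈ 0#)
    -a≉0 -a≈0 = a≉0 (trans (sym (-‿involutive a)) (trans (-‿cong -a≈0) -0#≈0#))

    uT≉[] : ¬ (uT AZ.≋ [])
    uT≉[] uT≋0 = 1≉0 (at (≋-trans (≋-sym (≋-trans (AZ.coeff-const* X AZ.X 1) (*ₚ-identityʳ X))) (AZ.at uT≋0 1)) 1)

    1ᴷ : KZ.Poly
    1ᴷ = KZ.const (embed (const 1#))

  IsUnitᴷ : KZ.Poly → Set (c ⊔ ℓ)
  IsUnitᴷ f = ∃ λ v → f KZ.*ₚ v KZ.≋ 1ᴷ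

  RHS : AZ.Poly
  RHS = RH (suc n′) (suc t′) a

  Φ-RHS≋ : Φ RHS AZ.≋ uT AZ.*ₚ Q n′ t′ 1# (- a)
  Φ-RHS≋ = Φ-RH n′ t′ a

  RHS≉[] : ¬ (RHS AZ.≋ [])
  RHS≉[] RHS≋0 = AZN.*ₚ-≉[] uT≉[] Q≉[] (AZ.≋-trans (AZ.≋-sym Φ-RHS≋) (Φ-Hom.ev-cong RHS≋0))
    where
    Q≉[] : ¬ (Q n′ t′ 1# (- a) AZ.≋ [])
    Q≉[] = AZD.hasDegree⇒≉[] (Q-hasDegree 1≉0 -a≉0)

  constantInU⇒unit : ∀ {F f} → Proportional F f → ConstantInU (Φ F) → ¬ (f KZ.≋ []) → DoubleNegation (IsUnitᴷ f)
  constantInU⇒unit {F} {f} (α , β , α≉0 , β≉0 , αF≋βf) cu f≉0 k = ¬¬-excluded-middle {A = F₀ ≋ []} λ where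
      (yes F₀≋0) → f≉0 (KZN.*ₚ-cancelˡ {KZ.const (embed β)} β≉0ᴷ (KZ.≋-trans (KZ.≋-sym αF₀≋βf)
                     (KZ.≋-trans (KZ.const-≈0 {embed (α *ₚ F₀)} (embed-cong (≋-trans (*ₚ-congʳ α F₀≋0) (*ₚ-zeroʳ α)))) (KZ.≋-sym (KZ.*ₚ-zeroʳ (KZ.const (embed β)))))))
      (no  F₀≉0) → k (KZ.const (v F₀≉0) , KZN.*ₚ-cancelˡ {KZ.const (embed β)} β≉0ᴷ (begin
        KZ.const (embed β) KZ.*ₚ (f KZ.*ₚ KZ.const (v F₀≉0))     ≈⟨ KZ.*ₚ-assoc (KZ.const (embed β)) f _ ⟨
        (KZ.const (embed β) KZ.*ₚ f) KZ.*ₚ KZ.const (v F₀≉0)     ≈⟨ KZ.*ₚ-congˡ (KZ.const (v F₀≉0)) αF₀≋βf ⟨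
        KZ.const (embed (α *ₚ F₀)) KZ.*ₚ KZ.const (v F₀≉0)       ≈⟨ KZ.const-*ₚ (embed (α *ₚ F₀)) (v F₀≉0) ⟩
        KZ.const (embed (α *ₚ F₀) *f v F₀≉0)                     ≈⟨ KZ.const-cong {embed (α *ₚ F₀) *f v F₀≉0} {embed β} (≋-trans (*ₚ-identityʳ _) (≋-trans (*ₚ-comm (α *ₚ F₀) β) (*ₚ-congʳ β (≋-sym (*ₚ-identityʳ (α *ₚ F₀)))))) ⟩
        KZ.const (embed β)                                        ≈⟨ KZ.*ₚ-identityʳ (KZ.const (embed β)) ⟨
        KZ.const (embed β) KZ.*ₚ 1ᴷ                               ∎))
    where
    open import Relation.Binary.Reasoning.Setoid KZ.≋-setoid
    F₀ = AZ.coeff F zero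
    β≉0ᴷ : ¬ (KZ.const (embed β) KZ.≋ [])
    β≉0ᴷ β≋0 = β≉0 (embed-injective (KZ.at β≋0 zero))
    αF₀≋βf : KZ.const (embed (α *ₚ F₀)) KZ.≋ KZ.const (embed β) KZ.*ₚ f
    αF₀≋βf = KZ.≋-trans (KZ.≋-sym (KZ.const-*ₚ (embed α) (embed F₀)))
               (KZ.≋-trans (KZ.*ₚ-congʳ (KZ.const (embed α)) (KZ.≋-sym (KZ.≋-trans (ToK.ev-cong (constantInU⇒≋const F cu)) (ToK.ev-const F₀)))) αF≋βf)
    v : ¬ (F₀ ≋ []) → Frac
    v F₀≉0 = β / ((α *ₚ F₀ , λ αF₀≈0 → *ₚ-≉[] α≉0 F₀≉0 (≈ₚ⇒≋ αF₀≈0)) ∷ [])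

  Φ-factors : ∀ {c F G} → Z AZ.*ₚ (F AZ.*ₚ G) AZ.≋ AZ.const (const c) AZ.*ₚ RHS → Φ F AZ.*ₚ Φ G AZ.≋ Q n′ t′ (c * 1#) (c * - a)
  Φ-factors {c} {F} {G} eq = AZN.*ₚ-cancelˡ {uT} uT≉[] (begin
    uT AZ.*ₚ (Φ F AZ.*ₚ Φ G)                     ≈⟨ AZ.*ₚ-congʳ uT (Φ-Hom.ev-* F G) ⟨
    uT AZ.*ₚ Φ (F AZ.*ₚ G)                       ≈⟨ AZ.*ₚ-congˡ (Φ (F AZ.*ₚ G)) Φ-Z ⟨
    Φ Z AZ.*ₚ Φ (F AZ.*ₚ G)                      ≈⟨ Φ-Hom.ev-* Z (F AZ.*ₚ G) ⟨
    Φ (Z AZ.*ₚ (F AZ.*ₚ G))                      ≈⟨ Φ-Hom.ev-cong eq ⟩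
    Φ (ι c AZ.*ₚ RHS)                            ≈⟨ AZ.≋-trans (Φ-Hom.ev-* (ι c) RHS) (AZ.*ₚ-cong (Φ-ι c) Φ-RHS≋) ⟩
    ι c AZ.*ₚ (uT AZ.*ₚ Q n′ t′ 1# (- a))        ≈⟨ x∙yz≈y∙xz (ι c) uT (Q n′ t′ 1# (- a)) ⟩
    uT AZ.*ₚ (ι c AZ.*ₚ Q n′ t′ 1# (- a))        ≈⟨ AZ.*ₚ-congʳ uT (ι*Q c) ⟩
    uT AZ.*ₚ Q n′ t′ (c * 1#) (c * - a)          ∎)
    where
    open import Relation.Binary.Reasoning.Setoid AZ.≋-setoid
    open import Algebra.Properties.CommutativeSemigroup (CommutativeRing.*-commutativeSemigroup AZ.polyRing) using (x∙yz≈y∙xz)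

  module _ {P : KZ.Poly} (ZP≋RHS : KZ.X KZ.*ₚ P KZ.≋ toK RHS) where

    P≉[] : ¬ (P KZ.≋ [])
    P≉[] P≋0 = RHS≉[] (toK-injective {RHS} {[]} (KZ.≋-trans (KZ.≋-sym ZP≋RHS) (KZ.≋-trans (KZ.*ₚ-congʳ KZ.X P≋0) (KZ.*ₚ-zeroʳ KZ.X))))

    factors-nonunit : ∀ {f g} → P KZ.≋ f KZ.*ₚ g → ¬ IsUnitᴷ f → ¬ IsUnitᴷ g → ⊥
    factors-nonunit {f} {g} P≋fg f-nonunit g-nonunit =
      ¬¬-hasDegree (df *ₚ dg) (*ₚ-≉[] (denominator-≉[] f) (denominator-≉[] g)) λ (e , deg) →
      Reduction.reduce RHS f g e {F = numerator f} {numerator g} deg eq₀ (numerator-proportional f) (numerator-proportional g)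
        λ (c , c≉0 , F′ , G′ , eq , F′∼f , G′∼g) →
      Q-factor-constantInU (no-zero-divisors c≉0 1≉0) (no-zero-divisors c≉0 -a≉0) {Φ F′} {Φ G′} (Φ-factors {c} {F′} {G′} eq) λ where
        (inj₁ cu) → constantInU⇒unit {F′} F′∼f cu f≉0 f-nonunit
        (inj₂ cu) → constantInU⇒unit {G′} G′∼g cu g≉0 g-nonunit
      where
      open import Relation.Binary.Reasoning.Setoid KZ.≋-setoid
      df = denominator f
      dg = denominator g
      f≉0 : ¬ (f KZ.≋ [])
      f≉0 f≋0 = P≉[] (KZ.≋-trans P≋fg (KZ.*ₚ-zeroˡ-≋ f g f≋0))
      g≉0 : ¬ (g KZ.≋ [])
      g≉0 g≋0 = P≉[] (KZ.≋-trans P≋fg (KZ.≋-trans (KZ.*ₚ-congʳ f g≋0) (KZ.*ₚ-zeroʳ f)))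
      cf = KZ.const (embed df)
      cg = KZ.const (embed dg)
      eq₀ : Z AZ.*ₚ (numerator f AZ.*ₚ numerator g) AZ.≋ AZ.const (df *ₚ dg) AZ.*ₚ RHS
      eq₀ = toK-injective (begin
        toK (Z AZ.*ₚ (numerator f AZ.*ₚ numerator g))               ≈⟨ KZ.≋-trans (ToK.ev-* Z (numerator f AZ.*ₚ numerator g)) (KZ.*ₚ-cong ToK.ev-X (ToK.ev-* (numerator f) (numerator g))) ⟩
        KZ.X KZ.*ₚ (toK (numerator f) KZ.*ₚ toK (numerator g))      ≈⟨ KZ.*ₚ-congʳ KZ.X (KZ.*ₚ-cong (toK-numerator f) (toK-numerator g)) ⟩
        KZ.X KZ.*ₚ ((cf KZ.*ₚ f) KZ.*ₚ (cg KZ.*ₚ g))                ≈⟨ KZ-solve 5 (λ x a f b g → x :* ((a :* f) :* (b :* g)) := (a :* b) :* (x :* (f :* g))) KZ.≋-refl KZ.X cf f cg g ⟩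
        (cf KZ.*ₚ cg) KZ.*ₚ (KZ.X KZ.*ₚ (f KZ.*ₚ g))                ≈⟨ KZ.*ₚ-cong (KZ.const-*ₚ (embed df) (embed dg)) (KZ.*ₚ-congʳ KZ.X (KZ.≋-sym P≋fg)) ⟩
        KZ.const (embed (df *ₚ dg)) KZ.*ₚ (KZ.X KZ.*ₚ P)            ≈⟨ KZ.*ₚ-congʳ (KZ.const (embed (df *ₚ dg))) ZP≋RHS ⟩
        KZ.const (embed (df *ₚ dg)) KZ.*ₚ toK RHS                    ≈⟨ KZ.≋-trans (ToK.ev-* (AZ.const (df *ₚ dg)) RHS) (KZ.*ₚ-congˡ (toK RHS) (ToK.ev-const (df *ₚ dg))) ⟨
        toK (AZ.const (df *ₚ dg) AZ.*ₚ RHS)                         ∎)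
        where open import Algebra.Solver.Ring.NaturalCoefficients.Default (CommutativeRing.commutativeSemiring KZ.polyRing) renaming (solve to KZ-solve)

    nonunit : ¬ IsUnitᴷ P
    nonunit (v , Pv≋1) = AZD.¬¬-hasOrder (Φ V) ΦV≉0 λ (v₀ , ord-ΦV) →
      let ord-QΦV , trailing≈ = AZN.*-hasOrder (Q-hasOrder 1≉0 -a≉0) ord-ΦV
          cₑ≋ : const (coeff dv (t′ ℕ.+ v₀)) ≋ AZ.coeff (Q₁ AZ.*ₚ Φ V) (t′ ℕ.+ v₀)
          cₑ≋ = ≋-trans (≋-sym (coeff-toT dv (t′ ℕ.+ v₀))) (AZ.at (AZ.≋-sym QΦV≋) (t′ ℕ.+ v₀))
          e≉0 : ¬ (coeff dv (t′ ℕ.+ v₀) ≈ 0#)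
          e≉0 e≈0 = AZD.HasOrder.trailing≉0 ord-QΦV (≋-trans (≋-sym cₑ≋) (const-≈0 e≈0))
          St∣cₑ : S (suc t′) ∣ const (coeff dv (t′ ℕ.+ v₀)) *ₚ const 1#
          St∣cₑ = ≈*⇒∣ (≋-trans (*ₚ-identityʳ _) (≋-trans cₑ≋ (≋-trans trailing≈
                    (≋-trans (*ₚ-congˡ _ (coeff-Q-t′ (λ t′≡n′ → ℕ.<-irrefl t′≡n′ t′<n′))) (xy∙z≈y∙xz (const (- a)) (S (suc t′)) _)))))
      in ℕ.<⇒≢ 1≤t′ (≡.sym (∣-1⇒degree0 (∣-const*-cancel e≉0 St∣cₑ) (S-hasDegree t′)))
      where
      open import Algebra.Properties.CommutativeSemigroup (CommutativeRing.*-commutativeSemigroup polyRing) using (xy∙z≈y∙xz)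
      Q₁ = Q n′ t′ 1# (- a)
      V = numerator v
      dv = denominator v
      cv = KZ.const (embed dv)
      RHS*V≋ : RHS AZ.*ₚ V AZ.≋ AZ.const dv AZ.*ₚ Z
      RHS*V≋ = toK-injective (begin
        toK (RHS AZ.*ₚ V)                        ≈⟨ KZ.≋-trans (ToK.ev-* RHS V) (KZ.*ₚ-cong (KZ.≋-sym ZP≋RHS) (toK-numerator v)) ⟩
        (KZ.X KZ.*ₚ P) KZ.*ₚ (cv KZ.*ₚ v)        ≈⟨ KZ-solve 4 (λ x p c v → (x :* p) :* (c :* v) := c :* (x :* (p :* v))) KZ.≋-refl KZ.X P cv v ⟩
        cv KZ.*ₚ (KZ.X KZ.*ₚ (P KZ.*ₚ v))        ≈⟨ KZ.*ₚ-congʳ cv (KZ.≋-trans (KZ.*ₚ-congʳ KZ.X Pv≋1) (KZ.*ₚ-identityʳ KZ.X)) ⟩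
        cv KZ.*ₚ KZ.X                            ≈⟨ KZ.≋-trans (ToK.ev-* (AZ.const dv) Z) (KZ.*ₚ-cong (ToK.ev-const dv) ToK.ev-X) ⟨
        toK (AZ.const dv AZ.*ₚ Z)                ∎)
        where open import Relation.Binary.Reasoning.Setoid KZ.≋-setoid
              open import Algebra.Solver.Ring.NaturalCoefficients.Default (CommutativeRing.commutativeSemiring KZ.polyRing) renaming (solve to KZ-solve)
      QΦV≋ : Q₁ AZ.*ₚ Φ V AZ.≋ toT dv
      QΦV≋ = AZN.*ₚ-cancelˡ {uT} uT≉[] (begin
        uT AZ.*ₚ (Q₁ AZ.*ₚ Φ V)                  ≈⟨ AZ.*ₚ-assoc uT Q₁ (Φ V) ⟨
        (uT AZ.*ₚ Q₁) AZ.*ₚ Φ V                  ≈⟨ AZ.*ₚ-congˡ (Φ V) Φ-RHS≋ ⟨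
        Φ RHS AZ.*ₚ Φ V                          ≈⟨ Φ-Hom.ev-* RHS V ⟨
        Φ (RHS AZ.*ₚ V)                          ≈⟨ Φ-Hom.ev-cong RHS*V≋ ⟩
        Φ (AZ.const dv AZ.*ₚ Z)                  ≈⟨ AZ.≋-trans (Φ-Hom.ev-* (AZ.const dv) Z) (AZ.*ₚ-cong (Φ-Hom.ev-const dv) Φ-Z) ⟩
        toT dv AZ.*ₚ uT                          ≈⟨ AZ.*ₚ-comm (toT dv) uT ⟩
        uT AZ.*ₚ toT dv                          ∎)
        where open import Relation.Binary.Reasoning.Setoid AZ.≋-setoid
      ΦV≉0 : ¬ (Φ V AZ.≋ [])
      ΦV≉0 ΦV≋0 = denominator-≉[] v (mk≋ λ i → at (≋-trans (≋-sym (coeff-toT dv i)) (AZ.at toT-dv≋0 i)) zero)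
        where
        toT-dv≋0 : toT dv AZ.≋ []
        toT-dv≋0 = AZ.≋-trans (AZ.≋-sym QΦV≋) (AZ.≋-trans (AZ.*ₚ-congʳ Q₁ ΦV≋0) (AZ.*ₚ-zeroʳ Q₁))

mainTheorem12 : ∀ {c ℓ : Level} (k : Field c ℓ) (n t : ℕ) → 1 < t → t < n → gcd n t ≡ 1 →
    (a : Field.Carrier k) → ¬ (Field._≈_ k a (Field.0# k)) →
    let open RationalFunctionPolys k in
    let open RawRing KYZring in
    (P : Carrier) →
    Z * P ≈ ((((Z + Y) ^ n) + (- (Y ^ n))) + (- (ι a * (((Z + Y) ^ t) + (- (Y ^ t)))))) →
    Irreducible P
mainTheorem12 k (suc n′) (suc t′) (s≤s 1≤t′) (s≤s t′<n′) coprime a a≉0 P ZP≈ =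
  (λ P≈0 → P≉[] ZP≋RHS (≈ₚ⇒≋ᴷ P≈0)) ,
  (λ (v , Pv≈1) → nonunit ZP≋RHS (v , ≈ₚ⇒≋ᴷ Pv≈1)) ,
  (λ f g P≈fg (f-nonunit , g-nonunit) → factors-nonunit ZP≋RHS {f} {g} (≈ₚ⇒≋ᴷ P≈fg)
     (λ (v , fv≋1) → ≋⇒¬¬≈ₚᴷ fv≋1 λ fv≈1 → f-nonunit (v , fv≈1))
     (λ (v , gv≋1) → ≋⇒¬¬≈ₚᴷ gv≋1 λ gv≈1 → g-nonunit (v , gv≈1)))
  where
  open RationalFunctions k using (≈ₚ⇒≋; ≋⇒¬¬≈ₚ)
  open Substitutions k using (module KZ; toK; toK-RH)
  open Irreducibility k 1≤t′ t′<n′ coprime {a} (λ a≈0 → a≈0 a≉0)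
  open KZ.FromRaw (λ {x} {y} → ≈ₚ⇒≋) renaming (≈ₚ⇒≋ to ≈ₚ⇒≋ᴷ)
  open KZ.ToRaw (λ {x} {y} → ≋⇒¬¬≈ₚ) renaming (≋⇒¬¬≈ₚ to ≋⇒¬¬≈ₚᴷ)
  ZP≋RHS : KZ.X KZ.*ₚ P KZ.≋ toK RHS
  ZP≋RHS = KZ.≋-trans (≈ₚ⇒≋ᴷ ZP≈) (KZ.≋-sym (toK-RH (suc n′) (suc t′) a))
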